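{- Let $U,L\in\mathcal{P}(n,d)$ with $U$ weakly above $L$, and let $\Lambda=\Lambda_{M[U,L]}$. Then $\operatorname{st}_L(C)=\Lambda(E(C))$ for all $C\in\mathcal{P}[U,L]$. In particular, \[ \mathcal{S}_{\mathsf{lex}}(M[U,L])=\{\operatorname{st}_L(C): C\in\mathcal{P}[U,L]\}. \]
   Context: $\mathcal{P}(n,d)$ is the set of words of length $n$ in $\mathbf{e}$ (east step $(1,0)$) and $\mathbf{n}$ (north step $(0,1)$) with exactly $d$ letters $\mathbf{e}$, viewed as lattice paths from $(0,0)$ to $(d,n-d)$; $C_i$ is the $i$-th letter and $E(C)\subseteq[n]$ the set of positions of $\mathbf{e}$'s. $U$ is weakly above $L$ if every prefix of $L$ has at least as many $\mathbf{e}$'s as the equally long prefix of $U$; $\mathcal{P}[U,L]$ is the set of $C\in\mathcal{P}(n,d)$ weakly below $U$ and weakly above $L$; the lattice path matroid $M[U,L]$ is the matroid on $[n]$ with bases $\{E(C):C\in\mathcal{P}[U,L]\}$. For $C$ weakly above $L$: the $L$-demarcation path $D$ starts at $(0,0)$ and its $i$-th step is $\mathbf{n}$ if $C_i=L_i=\mathbf{n}$, $\mathbf{e}$ if $C_i=L_i=\mathbf{e}$, a diagonal step $(1,1)$ if $C_i=\mathbf{n},L_i=\mathbf{e}$, and empty if $C_i=\mathbf{e},L_i=\mathbf{n}$. The $L$-marking path $P$ goes from $(0,0)$ to $(d,n-d)$ with diagonal $(1,1)$, east and north steps: it uses a diagonal step whenever possible without going above $C$ or below $D$; if a diagonal step would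 go above $C$ it uses an east step, and if it would go below $D$ it uses a north step. An east step of $C$ is marked if its unit segment in $\mathbb{R}^2$ is also an east step of $P$; $\operatorname{st}_L(C)\subseteq E(C)$ is the set of positions of unmarked east steps of $C$. Standard complex: for a matroid $M$ on finite $E\subseteq\mathbb{N}$ with bases $\mathcal{B}(M)$, $\mathcal{S}_{\mathsf{lex}}(M)=\{\tau\subseteq E:\prod_{i\in\tau}x_i\notin\mathrm{in}_{\mathsf{lex}}(I(V_M))\}$ with $V_M=\{\mathbf{e}_B:B\in\mathcal{B}(M)\}$, $I(V_M)$ its vanishing ideal, and $\mathsf{lex}$ the lexicographic order with $x_i\succ x_j$ for $i<j$. $\{\Lambda_M\}$ is the unique family (over all matroids with finite groundset in $\mathbb{N}$) of bijections $\Lambda_M:\mathcal{B}(M)\to\mathcal{S}_{\mathsf{lex}}(M)$ with $\Lambda_M(B)\subseteq B$ and, for nonempty groundset with largest element $m$, $\Lambda_M(B)=\Lambda_{M\setminus m}(B)$ if $m\notin B$, $\Lambda_M(B)\setminus\{m\}=\Lambda_{M/m}(B\setminus\{m\})$ if $m\in B$. -}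

module Defs where

open import Data.Nat using (ℕ; zero; suc; _≤_; _<_; _∸_; _≡ᵇ_; _<ᵇ_)
open import Data.Bool using (Bool; true; false; not; _∧_; _∨_; if_then_else_)
open import Data.Product using (Σ; _×_; _,_; proj₁; proj₂)
open import Data.Sum using (_⊎_)
open import Data.Empty using (⊥)
open import Data.List using (List; []; _∷_)
open import Data.List.Relation.Unary.All using (All)
open import Data.Vec using (Vec; []; _∷_; _∷ʳ_; init; toList; map; _[_]≔_)
open import Data.Fin using (Fin)
open import Data.Fin.Subset using (Subset; inside; outside; _∈_; _∉_; _⊆_)
open import Data.Rational using (ℚ; 0ℚ; 1ℚ; _+_; _*_)
open import Relation.Binary.PropositionalEquality using (_≡_)
open import Relation.Nullary using (¬_)

-- Lattice paths.  A word of length n; Fin index i stands for position i+1.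

data Step : Set where
  𝐞 𝐧 : Step

Path : ℕ → Set
Path n = Vec Step n

isE : Step → Bool
isE 𝐞 = true
isE 𝐧 = false

countE : List Step → ℕ
countE [] = 0
countE (𝐞 ∷ s) = suc (countE s)
countE (𝐧 ∷ s) = countE s

prefE : ℕ → List Step → ℕ
prefE zero s = 0
prefE (suc i) [] = 0
prefE (suc i) (𝐞 ∷ s) = suc (prefE i s)
prefE (suc i) (𝐧 ∷ s) = prefE i s

numE : ∀ {n} → Path n → ℕ
numE C = countE (toList C)

InP : (n d : ℕ) → Path n → Set
InP n d C = numE C ≡ d

WeaklyAbove : ∀ {n} → Path n → Path n → Set
WeaklyAbove {n} U L = ∀ i → i ≤ n → prefE i (toList U) ≤ prefE i (toList L)

Epos : ∀ {n} → Path n → Subset n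
Epos C = map isE C

InPUL : (n d : ℕ) → Path n → Path n → Path n → Set
InPUL n d U L C = InP n d C × WeaklyAbove U C × WeaklyAbove C L

LPM : (n d : ℕ) → Path n → Path n → Subset n → Set
LPM n d U L B = Σ (Path n) λ C → InPUL n d U L C × Epos C ≡ B

-- heights of the east steps of a path, in order (the k-th one spans [k,k+1])
eastHeights : List Step → ℕ → List ℕ
eastHeights [] y = []
eastHeights (𝐞 ∷ s) y = y ∷ eastHeights s y
eastHeights (𝐧 ∷ s) y = eastHeights s (suc y)

data DStep : Set where
  dN dE dD : DStep

-- L-demarcation path (empty steps omitted)
demarc : List Step → List Step → List DStep
demarc (𝐧 ∷ c) (𝐧 ∷ l) = dN ∷ demarc c l
demarc (𝐞 ∷ c) (𝐞 ∷ l) = dE ∷ demarc c l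
demarc (𝐧 ∷ c) (𝐞 ∷ l) = dD ∷ demarc c l
demarc (𝐞 ∷ c) (𝐧 ∷ l) = demarc c l
demarc _ _ = []

-- starting heights of the steps of D that move right (east or diagonal);
-- the k-th one spans the x-interval [k,k+1]
crossHeights : List DStep → ℕ → List ℕ
crossHeights [] y = []
crossHeights (dN ∷ s) y = crossHeights s (suc y)
crossHeights (dE ∷ s) y = y ∷ crossHeights s y
crossHeights (dD ∷ s) y = y ∷ crossHeights s (suc y)

nth : List ℕ → ℕ → ℕ
nth [] _ = 0
nth (a ∷ as) zero = a
nth (a ∷ as) (suc k) = nth as k

-- The L-marking path from (x,y) to (d,m), returned as the list of starting
-- points of its east steps.  cH = heights of east steps of C,
-- dH = crossing heights of D.  At (x,y) with x < d: a diagonal step stays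
-- weakly above D iff y ≥ dH[x], and weakly below C iff y+1 ≤ cH[x].
markingEast : ℕ → (d m : ℕ) → List ℕ → List ℕ → ℕ → ℕ → List (ℕ × ℕ)
markingEast zero d m cH dH x y = []
markingEast (suc f) d m cH dH x y =
  if (x ≡ᵇ d) ∧ (y ≡ᵇ m) then []
  else if x ≡ᵇ d then markingEast f d m cH dH x (suc y)
  else if y <ᵇ nth dH x then markingEast f d m cH dH x (suc y)
  else if nth cH x <ᵇ suc y then (x , y) ∷ markingEast f d m cH dH (suc x) y
  else markingEast f d m cH dH (suc x) (suc y)

memPt : ℕ × ℕ → List (ℕ × ℕ) → Bool
memPt p [] = false
memPt (a , b) ((c , e) ∷ ps) = ((a ≡ᵇ c) ∧ (b ≡ᵇ e)) ∨ memPt (a , b) ps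

-- walk along C; an east step from (x,y) is marked iff P has an east step from (x,y)
unmarked : ∀ {k} → List (ℕ × ℕ) → Vec Step k → ℕ → ℕ → Subset k
unmarked ps [] x y = []
unmarked ps (𝐞 ∷ c) x y = not (memPt (x , y) ps) ∷ unmarked ps c (suc x) y
unmarked ps (𝐧 ∷ c) x y = outside ∷ unmarked ps c x (suc y)

st : ∀ {n} → Path n → Path n → Subset n
st {n} L C =
  unmarked (markingEast n (numE C) (n ∸ numE C)
              (eastHeights (toList C) 0)
              (crossHeights (demarc (toList C) (toList L)) 0) 0 0)
           C 0 0

-- Matroids on the groundset Fin k (= {1,…,k}), given by their bases.

IsMatroid : ∀ {k} → (Subset k → Set) → Set
IsMatroid {k} 𝓑 =
  Σ (Subset k) 𝓑 ×
  (∀ B₁ B₂ → 𝓑 B₁ → 𝓑 B₂ → (x : Fin k) → x ∈ B₁ → x ∉ B₂ →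
     Σ (Fin k) λ y → y ∈ B₂ × y ∉ B₁ × 𝓑 ((B₁ [ x ]≔ outside) [ y ]≔ inside))

-- deletion / contraction of the largest element (used only when it is
-- not a coloop / not a loop respectively)
del : ∀ {k} → (Subset (suc k) → Set) → Subset k → Set
del 𝓑 X = 𝓑 (X ∷ʳ outside)

con : ∀ {k} → (Subset (suc k) → Set) → Subset k → Set
con 𝓑 X = 𝓑 (X ∷ʳ inside)

-- Standard complex w.r.t. lex with x_1 ≻ x_2 ≻ … , over the field ℚ.

Monomial : ℕ → Set
Monomial k = Vec ℕ k

_≺lex_ : ∀ {k} → Monomial k → Monomial k → Set
[] ≺lex [] = ⊥
(a ∷ as) ≺lex (b ∷ bs) = a < b ⊎ (a ≡ b × as ≺lex bs)

Poly : ℕ → Set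
Poly k = List (ℚ × Monomial k)

powℚ : ℚ → ℕ → ℚ
powℚ q zero = 1ℚ
powℚ q (suc e) = q * powℚ q e

evalMon : ∀ {k} → Monomial k → Vec ℚ k → ℚ
evalMon [] [] = 1ℚ
evalMon (a ∷ as) (p ∷ ps) = powℚ p a * evalMon as ps

evalPoly : ∀ {k} → Poly k → Vec ℚ k → ℚ
evalPoly [] p = 0ℚ
evalPoly ((c , a) ∷ f) p = c * evalMon a p + evalPoly f p

indicator : ∀ {k} → Subset k → Vec ℚ k
indicator B = map (λ b → if b then 1ℚ else 0ℚ) B

Vanishes : ∀ {k} → (Subset k → Set) → Poly k → Set
Vanishes 𝓑 f = ∀ B → 𝓑 B → evalPoly f (indicator B) ≡ 0ℚ

monOf : ∀ {k} → Subset k → Monomial k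
monOf τ = map (λ b → if b then 1 else 0) τ

-- x^τ ∈ in_lex(I(V_M)): some f ∈ I(V_M) has leading monomial x^τ
-- (f = x^τ + lower terms)
InInitial : ∀ {k} → (Subset k → Set) → Subset k → Set
InInitial {k} 𝓑 τ =
  Σ (Poly k) λ g → All (λ t → proj₂ t ≺lex monOf τ) g ×
                   Vanishes 𝓑 ((1ℚ , monOf τ) ∷ g)

Standard : ∀ {k} → (Subset k → Set) → Subset k → Set
Standard 𝓑 τ = ¬ InInitial 𝓑 τ

LambdaFam : Set₁
LambdaFam = (k : ℕ) → (Subset k → Set) → Subset k → Subset k

record IsLexFamily (Λ : LambdaFam) : Set₁ where
  field
    subset  : ∀ k (𝓑 : Subset k → Set) → IsMatroid 𝓑 →
              ∀ B → 𝓑 B → Λ k 𝓑 B ⊆ B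
    intoStd : ∀ k (𝓑 : Subset k → Set) → IsMatroid 𝓑 →
              ∀ B → 𝓑 B → Standard 𝓑 (Λ k 𝓑 B)
    inj     : ∀ k (𝓑 : Subset k → Set) → IsMatroid 𝓑 →
              ∀ B B′ → 𝓑 B → 𝓑 B′ → Λ k 𝓑 B ≡ Λ k 𝓑 B′ → B ≡ B′
    surj    : ∀ k (𝓑 : Subset k → Set) → IsMatroid 𝓑 →
              ∀ τ → Standard 𝓑 τ → Σ (Subset k) λ B → 𝓑 B × Λ k 𝓑 B ≡ τ
    recDel  : ∀ k (𝓑 : Subset (suc k) → Set) → IsMatroid 𝓑 →
              ∀ X → 𝓑 (X ∷ʳ outside) →
              Λ (suc k) 𝓑 (X ∷ʳ outside) ≡ Λ k (del 𝓑) X ∷ʳ outside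
    recCon  : ∀ k (𝓑 : Subset (suc k) → Set) → IsMatroid 𝓑 →
              ∀ X → 𝓑 (X ∷ʳ inside) →
              init (Λ (suc k) 𝓑 (X ∷ʳ inside)) ≡ Λ k (con 𝓑) X

{-# OPTIONS --safe #-}
module Submission where

-- Both Λ and st_L are computed by deleting or contracting the last element m.
-- For Λ this is the defining recursion, completed by the fact that for m ∈ B,
-- m ∈ Λ(B) iff Λ_{M/m}(B ∖ m) is also a value of Λ_{M∖m} (Λ is injective, and
-- τ ∪ {m} standard implies τ standard).  The minors M∖m and M/m of M[U,L] are again
-- families of paths whose prefix counts lie between a lower bound u and those of L,
-- so by induction Λ = st_L on them.  Removing the last step of C does not change the
-- marks of its other east steps, so for C = C′𝐞 it remains to show that the last
-- east step is unmarked iff st_L(C₂) = st_L(C′) for some path C₂𝐧 of the family.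
-- If it is unmarked, C′𝐞 = A𝐧B𝐞 gives C₂𝐧 = A𝐞B𝐧, where the moved step sits in the
-- last column in which the marking path could leave C; conversely, moving the last
-- marked east step of C₂ to the end yields a path with the statistic of C′, hence C′
-- itself, since st_L is injective by induction.

open import Defs
open import Data.Nat using (ℕ)
open import Data.Nat.Properties using (≤-refl)
open import Data.Product using (Σ; _×_; _,_)
open import Data.Vec using (toList)
open import Data.Fin.Subset using (Subset)
open import Function.Bundles using (_⇔_; mk⇔)
open import Relation.Binary.PropositionalEquality using (_≡_; refl; sym; trans; subst)
open import Relation.Unary.Properties using (≐-refl)

module NatSearch where

  open import Data.Nat using (ℕ; zero; suc; _+_; _≤_; _<_)
  open import Data.Nat.Properties
  open import Data.Product using (∃; _×_; _,_)
  open import Data.Sum using (_⊎_; inj₁; inj₂)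
  open import Relation.Binary.PropositionalEquality
  open import Relation.Nullary using (¬_; yes; no; contradiction)
  open import Relation.Unary using (Decidable)

  module _ {P : ℕ → Set} (P? : Decidable P) where

    LastUpTo : ℕ → ℕ → Set
    LastUpTo t r = r ≤ t × P r × (∀ x → r < x → x ≤ t → ¬ P x)

    lastUpTo : ∀ t → ∃ (LastUpTo t) ⊎ (∀ x → x ≤ t → ¬ P x)
    lastUpTo t with P? t
    ... | yes Pt = inj₁ (t , ≤-refl , Pt , λ x t<x x≤t → contradiction (<-≤-trans t<x x≤t) (<-irrefl refl))
    lastUpTo zero    | no ¬P0 = inj₂ λ { zero _ → ¬P0 }
    lastUpTo (suc t) | no ¬Pt with lastUpTo t
    ... | inj₁ (r , r≤t , Pr , none) = inj₁ (r , m≤n⇒m≤1+n r≤t , Pr , none′)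
      where
        none′ : ∀ x → r < x → x ≤ suc t → ¬ P x
        none′ x r<x x≤1+t with m≤n⇒m<n∨m≡n x≤1+t
        ... | inj₁ x<1+t = none x r<x (≤-pred x<1+t)
        ... | inj₂ refl  = ¬Pt
    ... | inj₂ none = inj₂ none′
      where
        none′ : ∀ x → x ≤ suc t → ¬ P x
        none′ x x≤1+t with m≤n⇒m<n∨m≡n x≤1+t
        ... | inj₁ x<1+t = none x (≤-pred x<1+t)
        ... | inj₂ refl  = ¬Pt

    lastUpTo-witness : ∀ t k → k ≤ t → P k → ∃ (LastUpTo t)
    lastUpTo-witness t k k≤t Pk with lastUpTo t
    ... | inj₁ last = last
    ... | inj₂ none = contradiction Pk (none k k≤t)

    FirstFrom : ℕ → ℕ → Set
    FirstFrom a t = a ≤ t × P t × (∀ i → a ≤ i → i < t → ¬ P i)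

    firstFrom : ∀ a k → P (a + k) → ∃ λ t → t ≤ a + k × FirstFrom a t
    firstFrom a k Pa+k with P? a
    ... | yes Pa = a , m≤m+n a k , ≤-refl , Pa , λ i a≤i i<a → contradiction (≤-<-trans a≤i i<a) (<-irrefl refl)
    firstFrom a zero    Pa+0 | no ¬Pa = contradiction (subst P (+-identityʳ a) Pa+0) ¬Pa
    firstFrom a (suc k) Pa+k | no ¬Pa with firstFrom (suc a) k (subst P (+-suc a k) Pa+k)
    ... | t , t≤ , 1+a≤t , Pt , none = t , ≤-trans t≤ (≤-reflexive (sym (+-suc a k))) , ≤-trans (n≤1+n a) 1+a≤t , Pt , none′
      where
        none′ : ∀ i → a ≤ i → i < t → ¬ P i
        none′ i a≤i i<t with m≤n⇒m<n∨m≡n a≤i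
        ... | inj₁ a<i = none i a<i i<t
        ... | inj₂ refl = ¬Pa

module StandardComplex where

  open import Defs
  open import Data.Nat using (ℕ; suc; s≤s)
  open import Data.Bool using (if_then_else_)
  open import Data.Product using (_,_; proj₂)
  open import Data.Sum using (inj₁; inj₂)
  open import Data.List using ([]; _∷_)
  open import Data.List.Relation.Unary.All using (All; []; _∷_)
  open import Data.Vec using (Vec; []; _∷_; _∷ʳ_; last)
  open import Data.Fin.Subset using (Subset; inside; outside)
  open import Data.Rational using (ℚ; 0ℚ; 1ℚ; _+_; _*_)
  open import Data.Rational.Properties using (*-assoc; *-comm; *-zeroʳ; *-distribˡ-+)
  open import Function using (_∘_)
  open import Relation.Binary.PropositionalEquality

  private
    variable
      k : ℕ

  *-left-comm : ∀ x y z → x * (y * z) ≡ y * (x * z)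
  *-left-comm x y z = begin
    x * (y * z) ≡⟨ *-assoc x y z ⟨
    (x * y) * z ≡⟨ cong (_* z) (*-comm x y) ⟩
    (y * x) * z ≡⟨ *-assoc y x z ⟩
    y * (x * z) ∎
    where open ≡-Reasoning

  mulLastVar : Monomial (suc k) → Monomial (suc k)
  mulLastVar (a ∷ [])     = suc a ∷ []
  mulLastVar (a ∷ b ∷ as) = a ∷ mulLastVar (b ∷ as)

  mulLastVar-∷ʳ : ∀ (as : Monomial k) a → mulLastVar (as ∷ʳ a) ≡ as ∷ʳ suc a
  mulLastVar-∷ʳ []           a = refl
  mulLastVar-∷ʳ (b ∷ [])     a = refl
  mulLastVar-∷ʳ (b ∷ c ∷ as) a = cong (b ∷_) (mulLastVar-∷ʳ (c ∷ as) a)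

  mulLastVar-mono-≺lex : ∀ (as bs : Monomial (suc k)) →
                         as ≺lex bs → mulLastVar as ≺lex mulLastVar bs
  mulLastVar-mono-≺lex (a ∷ [])     (b ∷ [])     (inj₁ a<b)      = inj₁ (s≤s a<b)
  mulLastVar-mono-≺lex (a ∷ _ ∷ _)  (b ∷ _ ∷ _)  (inj₁ a<b)      = inj₁ a<b
  mulLastVar-mono-≺lex (a ∷ a′ ∷ as) (b ∷ b′ ∷ bs) (inj₂ (a≡b , r)) =
    inj₂ (a≡b , mulLastVar-mono-≺lex (a′ ∷ as) (b′ ∷ bs) r)

  evalMon-mulLastVar : ∀ (as : Monomial (suc k)) (p : Vec ℚ (suc k)) →
                       evalMon (mulLastVar as) p ≡ last p * evalMon as p
  evalMon-mulLastVar (a ∷ [])     (q ∷ [])      = *-assoc q (powℚ q a) 1ℚ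
  evalMon-mulLastVar (a ∷ b ∷ as) (q ∷ q′ ∷ ps) = begin
    powℚ q a * evalMon (mulLastVar (b ∷ as)) (q′ ∷ ps)
      ≡⟨ cong (powℚ q a *_) (evalMon-mulLastVar (b ∷ as) (q′ ∷ ps)) ⟩
    powℚ q a * (last (q′ ∷ ps) * evalMon (b ∷ as) (q′ ∷ ps))
      ≡⟨ *-left-comm (powℚ q a) (last (q′ ∷ ps)) _ ⟩
    last (q′ ∷ ps) * (powℚ q a * evalMon (b ∷ as) (q′ ∷ ps)) ∎
    where open ≡-Reasoning

  mulLastVarPoly : Poly (suc k) → Poly (suc k)
  mulLastVarPoly []            = []
  mulLastVarPoly ((c , a) ∷ f) = (c , mulLastVar a) ∷ mulLastVarPoly f

  evalPoly-mulLastVarPoly : ∀ (f : Poly (suc k)) (p : Vec ℚ (suc k)) →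
                            evalPoly (mulLastVarPoly f) p ≡ last p * evalPoly f p
  evalPoly-mulLastVarPoly []            p = sym (*-zeroʳ (last p))
  evalPoly-mulLastVarPoly ((c , a) ∷ f) p = begin
    c * evalMon (mulLastVar a) p + evalPoly (mulLastVarPoly f) p
      ≡⟨ cong₂ (λ u v → c * u + v) (evalMon-mulLastVar a p) (evalPoly-mulLastVarPoly f p) ⟩
    c * (last p * evalMon a p) + last p * evalPoly f p
      ≡⟨ cong (_+ last p * evalPoly f p) (*-left-comm c (last p) (evalMon a p)) ⟩
    last p * (c * evalMon a p) + last p * evalPoly f p
      ≡⟨ *-distribˡ-+ (last p) _ _ ⟨
    last p * (c * evalMon a p + evalPoly f p) ∎
    where open ≡-Reasoning

  mulLastVarPoly-below : ∀ (m : Monomial (suc k)) (g : Poly (suc k)) →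
                         All (λ t → proj₂ t ≺lex m) g →
                         All (λ t → proj₂ t ≺lex mulLastVar m) (mulLastVarPoly g)
  mulLastVarPoly-below m []            []       = []
  mulLastVarPoly-below m ((c , a) ∷ g) (a≺m ∷ ps) =
    mulLastVar-mono-≺lex a m a≺m ∷ mulLastVarPoly-below m g ps

  monOf-∷ʳ : ∀ (τ : Subset k) b → monOf (τ ∷ʳ b) ≡ monOf τ ∷ʳ (if b then 1 else 0)
  monOf-∷ʳ []      b = refl
  monOf-∷ʳ (x ∷ τ) b = cong (_ ∷_) (monOf-∷ʳ τ b)

  mulLastVar-monOf-outside : ∀ (τ : Subset k) →
                             mulLastVar (monOf (τ ∷ʳ outside)) ≡ monOf (τ ∷ʳ inside)
  mulLastVar-monOf-outside τ = begin
    mulLastVar (monOf (τ ∷ʳ outside)) ≡⟨ cong mulLastVar (monOf-∷ʳ τ outside) ⟩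
    mulLastVar (monOf τ ∷ʳ 0)         ≡⟨ mulLastVar-∷ʳ (monOf τ) 0 ⟩
    monOf τ ∷ʳ 1                      ≡⟨ monOf-∷ʳ τ inside ⟨
    monOf (τ ∷ʳ inside)               ∎
    where open ≡-Reasoning

  -- Multiply a witness for x^τ by the last variable x_m.
  InInitial-outside⇒inside : ∀ (𝓑 : Subset (suc k) → Set) (τ : Subset k) →
                             InInitial 𝓑 (τ ∷ʳ outside) → InInitial 𝓑 (τ ∷ʳ inside)
  InInitial-outside⇒inside 𝓑 τ (g , g≺ , vanishes) =
    mulLastVarPoly g , below , vanishes′
    where
      m-eq = mulLastVar-monOf-outside τ
      below : All (λ t → proj₂ t ≺lex monOf (τ ∷ʳ inside)) (mulLastVarPoly g)
      below = subst (λ m → All (λ t → proj₂ t ≺lex m) (mulLastVarPoly g)) m-eq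
                    (mulLastVarPoly-below _ g g≺)
      vanishes′ : Vanishes 𝓑 ((1ℚ , monOf (τ ∷ʳ inside)) ∷ mulLastVarPoly g)
      vanishes′ B B∈𝓑 = begin
        evalPoly ((1ℚ , monOf (τ ∷ʳ inside)) ∷ mulLastVarPoly g) (indicator B)
          ≡⟨ cong (λ m → evalPoly ((1ℚ , m) ∷ mulLastVarPoly g) (indicator B)) (sym m-eq) ⟩
        evalPoly (mulLastVarPoly ((1ℚ , monOf (τ ∷ʳ outside)) ∷ g)) (indicator B)
          ≡⟨ evalPoly-mulLastVarPoly ((1ℚ , monOf (τ ∷ʳ outside)) ∷ g) (indicator B) ⟩
        last (indicator B) * evalPoly ((1ℚ , monOf (τ ∷ʳ outside)) ∷ g) (indicator B)
          ≡⟨ cong (last (indicator B) *_) (vanishes B B∈𝓑) ⟩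
        last (indicator B) * 0ℚ
          ≡⟨ *-zeroʳ (last (indicator B)) ⟩
        0ℚ ∎
        where open ≡-Reasoning

  Standard-inside⇒outside : ∀ (𝓑 : Subset (suc k) → Set) (τ : Subset k) →
                            Standard 𝓑 (τ ∷ʳ inside) → Standard 𝓑 (τ ∷ʳ outside)
  Standard-inside⇒outside 𝓑 τ std = std ∘ InInitial-outside⇒inside 𝓑 τ

module Minors where

  open import Defs
  open StandardComplex using (Standard-inside⇒outside)
  open import Data.Nat using (ℕ; zero; suc)
  open import Data.Bool using (Bool; true; false)
  open import Data.Product using (Σ; ∃; _×_; _,_; proj₂)
  open import Data.Sum using (_⊎_; inj₁; inj₂)
  open import Data.Vec using (Vec; []; _∷_; _∷ʳ_; init; last; initLast; _[_]≔_; _[_]=_; here; there)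
  open import Data.Vec.Properties using ([]=-injective; ∷ʳ-injectiveˡ; ∷ʳ-injectiveʳ; init-∷ʳ; last-∷ʳ)
  open import Data.Fin using (Fin; zero; suc; inject₁; fromℕ)
  open import Data.Fin.Subset using (Subset; inside; outside; _∈_; _∉_)
  open import Function using (_∘_)
  open import Function.Bundles using (_⇔_; mk⇔)
  open import Relation.Binary.PropositionalEquality
  open import Relation.Nullary using (contradiction)

  private
    variable
      A : Set
      k : ℕ

  inject₁⊎fromℕ : (i : Fin (suc k)) → (∃ λ j → i ≡ inject₁ j) ⊎ i ≡ fromℕ k
  inject₁⊎fromℕ {zero}  zero    = inj₂ refl
  inject₁⊎fromℕ {suc k} zero    = inj₁ (zero , refl)
  inject₁⊎fromℕ {suc k} (suc i) with inject₁⊎fromℕ i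
  ... | inj₁ (j , refl) = inj₁ (suc j , refl)
  ... | inj₂ refl       = inj₂ refl

  ∷ʳ-[inject₁]=⁻ : ∀ (v : Vec A k) {a b} j → (v ∷ʳ a) [ inject₁ j ]= b → v [ j ]= b
  ∷ʳ-[inject₁]=⁻ (x ∷ v) zero    here      = here
  ∷ʳ-[inject₁]=⁻ (x ∷ v) (suc j) (there p) = there (∷ʳ-[inject₁]=⁻ v j p)

  ∷ʳ-[inject₁]=⁺ : ∀ (v : Vec A k) {a b} j → v [ j ]= b → (v ∷ʳ a) [ inject₁ j ]= b
  ∷ʳ-[inject₁]=⁺ (x ∷ v) zero    here      = here
  ∷ʳ-[inject₁]=⁺ (x ∷ v) (suc j) (there p) = there (∷ʳ-[inject₁]=⁺ v j p)

  ∷ʳ-[fromℕ]= : ∀ (v : Vec A k) a → (v ∷ʳ a) [ fromℕ k ]= a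
  ∷ʳ-[fromℕ]= []      a = here
  ∷ʳ-[fromℕ]= (x ∷ v) a = there (∷ʳ-[fromℕ]= v a)

  ∷ʳ-[inject₁]≔ : ∀ (v : Vec A k) a j b → (v ∷ʳ a) [ inject₁ j ]≔ b ≡ (v [ j ]≔ b) ∷ʳ a
  ∷ʳ-[inject₁]≔ (x ∷ v) a zero    b = refl
  ∷ʳ-[inject₁]≔ (x ∷ v) a (suc j) b = cong (x ∷_) (∷ʳ-[inject₁]≔ v a j b)

  init∷ʳlast : (v : Vec A (suc k)) → v ≡ init v ∷ʳ last v
  init∷ʳlast v = proj₂ (proj₂ (initLast v))

  -- The exchanged element y cannot be the last one, since B₁ ∷ʳ s and B₂ ∷ʳ s agree there.
  exchange-∷ʳ : ∀ (𝓑 : Subset (suc k) → Set) (s : Bool) → IsMatroid 𝓑 →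
    ∀ (B₁ B₂ : Subset k) → 𝓑 (B₁ ∷ʳ s) → 𝓑 (B₂ ∷ʳ s) → (x : Fin k) → x ∈ B₁ → x ∉ B₂ →
    Σ (Fin k) λ y → y ∈ B₂ × y ∉ B₁ × 𝓑 (((B₁ [ x ]≔ outside) [ y ]≔ inside) ∷ʳ s)
  exchange-∷ʳ {k} 𝓑 s (_ , exchange) B₁ B₂ B₁∈𝓑 B₂∈𝓑 x x∈B₁ x∉B₂
    with exchange (B₁ ∷ʳ s) (B₂ ∷ʳ s) B₁∈𝓑 B₂∈𝓑 (inject₁ x)
           (∷ʳ-[inject₁]=⁺ B₁ x x∈B₁) (x∉B₂ ∘ ∷ʳ-[inject₁]=⁻ B₂ x)
  ... | y′ , y′∈B₂ , y′∉B₁ , B₃∈𝓑 with inject₁⊎fromℕ y′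
  ...   | inj₂ refl =
          contradiction (subst (λ b → (B₁ ∷ʳ s) [ fromℕ k ]= b)
                               ([]=-injective (∷ʳ-[fromℕ]= B₂ s) y′∈B₂) (∷ʳ-[fromℕ]= B₁ s)) y′∉B₁
  ...   | inj₁ (y , refl) =
          y , ∷ʳ-[inject₁]=⁻ B₂ y y′∈B₂ , (λ y∈B₁ → y′∉B₁ (∷ʳ-[inject₁]=⁺ B₁ y y∈B₁)) ,
          subst 𝓑 B₃≡ B₃∈𝓑
    where
      B₃≡ : ((B₁ ∷ʳ s) [ inject₁ x ]≔ outside) [ inject₁ y ]≔ inside
          ≡ ((B₁ [ x ]≔ outside) [ y ]≔ inside) ∷ʳ s
      B₃≡ = trans (cong (_[ inject₁ y ]≔ inside) (∷ʳ-[inject₁]≔ B₁ s x outside))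
                  (∷ʳ-[inject₁]≔ (B₁ [ x ]≔ outside) s y inside)

  del-isMatroid : ∀ (𝓑 : Subset (suc k) → Set) → IsMatroid 𝓑 →
                  ∀ X → 𝓑 (X ∷ʳ outside) → IsMatroid (del 𝓑)
  del-isMatroid 𝓑 M X X∈𝓑 = (X , X∈𝓑) , exchange-∷ʳ 𝓑 outside M

  con-isMatroid : ∀ (𝓑 : Subset (suc k) → Set) → IsMatroid 𝓑 →
                  ∀ X → 𝓑 (X ∷ʳ inside) → IsMatroid (con 𝓑)
  con-isMatroid 𝓑 M X X∈𝓑 = (X , X∈𝓑) , exchange-∷ʳ 𝓑 inside M

  module _ (Λ : LambdaFam) (isLex : IsLexFamily Λ) where
    open IsLexFamily isLex

    Λ-∷ʳ-inside : ∀ k (𝓑 : Subset (suc k) → Set) → IsMatroid 𝓑 → ∀ X → 𝓑 (X ∷ʳ inside) →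
                  Λ (suc k) 𝓑 (X ∷ʳ inside) ≡ Λ k (con 𝓑) X ∷ʳ last (Λ (suc k) 𝓑 (X ∷ʳ inside))
    Λ-∷ʳ-inside k 𝓑 M X X∈𝓑 =
      trans (init∷ʳlast _) (cong (_∷ʳ last (Λ (suc k) 𝓑 (X ∷ʳ inside))) (recCon k 𝓑 M X X∈𝓑))

    module _ (k : ℕ) (𝓑 : Subset (suc k) → Set) (M : IsMatroid 𝓑) (X : Subset k) (X∈𝓑 : 𝓑 (X ∷ʳ inside)) where

      private
        τ = Λ k (con 𝓑) X

      Attained : Set
      Attained = ∃ λ X′ → 𝓑 (X′ ∷ʳ outside) × Λ k (del 𝓑) X′ ≡ τ

      -- Otherwise X ∷ʳ inside and X′ ∷ʳ outside would have the same image under Λ.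
      attained⇒last-Λ≡inside : Attained → last (Λ (suc k) 𝓑 (X ∷ʳ inside)) ≡ inside
      attained⇒last-Λ≡inside (X′ , X′∈𝓑 , Λ≡τ) with last (Λ (suc k) 𝓑 (X ∷ʳ inside)) in lastΛ
      ... | true  = refl
      ... | false = contradiction (∷ʳ-injectiveʳ X X′ (inj (suc k) 𝓑 M _ _ X∈𝓑 X′∈𝓑 Λ≡)) λ ()
        where
          Λ≡ : Λ (suc k) 𝓑 (X ∷ʳ inside) ≡ Λ (suc k) 𝓑 (X′ ∷ʳ outside)
          Λ≡ = begin
            Λ (suc k) 𝓑 (X ∷ʳ inside)   ≡⟨ Λ-∷ʳ-inside k 𝓑 M X X∈𝓑 ⟩
            τ ∷ʳ _                      ≡⟨ cong (τ ∷ʳ_) lastΛ ⟩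
            τ ∷ʳ outside                ≡⟨ cong (_∷ʳ outside) Λ≡τ ⟨
            Λ k (del 𝓑) X′ ∷ʳ outside   ≡⟨ recDel k 𝓑 M X′ X′∈𝓑 ⟨
            Λ (suc k) 𝓑 (X′ ∷ʳ outside) ∎
            where open ≡-Reasoning

      -- τ ∪ {m} is standard, hence so is τ, and its preimage under Λ cannot contain m.
      last-Λ≡inside⇒attained : last (Λ (suc k) 𝓑 (X ∷ʳ inside)) ≡ inside → Attained
      last-Λ≡inside⇒attained lastΛ with surj (suc k) 𝓑 M (τ ∷ʳ outside) (Standard-inside⇒outside 𝓑 τ τ∪m-std)
        where
          τ∪m-std : Standard 𝓑 (τ ∷ʳ inside)
          τ∪m-std = subst (Standard 𝓑) (trans (Λ-∷ʳ-inside k 𝓑 M X X∈𝓑) (cong (τ ∷ʳ_) lastΛ))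
                          (intoStd (suc k) 𝓑 M _ X∈𝓑)
      ... | B , B∈𝓑 , ΛB≡ with initLast B
      ...   | Y , false , refl = Y , B∈𝓑 , ∷ʳ-injectiveˡ _ _ (trans (sym (recDel k 𝓑 M Y B∈𝓑)) ΛB≡)
      ...   | Y , true  , refl = contradiction outside≡inside λ ()
        where
          Y≡X : Y ≡ X
          Y≡X = inj k (con 𝓑) (con-isMatroid 𝓑 M X X∈𝓑) Y X B∈𝓑 X∈𝓑
                  (trans (sym (recCon k 𝓑 M Y B∈𝓑)) (trans (cong init ΛB≡) (init-∷ʳ outside τ)))
          outside≡inside : outside ≡ inside
          outside≡inside = begin
            outside                            ≡⟨ last-∷ʳ outside τ ⟨
            last (τ ∷ʳ outside)                ≡⟨ cong last ΛB≡ ⟨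
            last (Λ (suc k) 𝓑 (Y ∷ʳ inside))   ≡⟨ cong (λ Z → last (Λ (suc k) 𝓑 (Z ∷ʳ inside))) Y≡X ⟩
            last (Λ (suc k) 𝓑 (X ∷ʳ inside))   ≡⟨ lastΛ ⟩
            inside                             ∎
            where open ≡-Reasoning

      last-Λ≡inside⇔attained : last (Λ (suc k) 𝓑 (X ∷ʳ inside)) ≡ inside ⇔ Attained
      last-Λ≡inside⇔attained = mk⇔ last-Λ≡inside⇒attained attained⇒last-Λ≡inside

module PathCounts where

  open import Defs
  open import Data.Nat using (ℕ; zero; suc; _+_; _≤_; _<_; _∸_; z≤n; s≤s; _<?_)
  open import Data.Nat.Properties
  open import Data.Bool using (Bool; true; false)
  open import Data.Product using (∃; ∃₂; _×_; _,_; proj₁; proj₂)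
  open import Data.List using (List; []; _∷_; _++_; [_]; length; map)
  open import Data.List.Properties using (length-++; ++-assoc)
  open import Relation.Binary.PropositionalEquality hiding ([_])
  open import Relation.Nullary using (yes; no; contradiction)

  private
    variable
      A : Set

  countN : List Step → ℕ
  countN []      = 0
  countN (𝐞 ∷ s) = countN s
  countN (𝐧 ∷ s) = suc (countN s)

  rise : List DStep → ℕ
  rise []       = 0
  rise (dN ∷ s) = suc (rise s)
  rise (dE ∷ s) = rise s
  rise (dD ∷ s) = suc (rise s)

  selectE : List Step → (ℕ → Bool) → ℕ → List Bool
  selectE []      f x = []
  selectE (𝐞 ∷ s) f x = f x ∷ selectE s f (suc x)
  selectE (𝐧 ∷ s) f x = false ∷ selectE s f x

  Above : List Step → List Step → Set
  Above C L = ∀ i → i ≤ length C → prefE i C ≤ prefE i L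


  length≡countE+countN : ∀ s → length s ≡ countE s + countN s
  length≡countE+countN []      = refl
  length≡countE+countN (𝐞 ∷ s) = cong suc (length≡countE+countN s)
  length≡countE+countN (𝐧 ∷ s) =
    trans (cong suc (length≡countE+countN s)) (sym (+-suc (countE s) (countN s)))

  countE-++ : ∀ X Y → countE (X ++ Y) ≡ countE X + countE Y
  countE-++ []      Y = refl
  countE-++ (𝐞 ∷ X) Y = cong suc (countE-++ X Y)
  countE-++ (𝐧 ∷ X) Y = countE-++ X Y

  countN-++ : ∀ X Y → countN (X ++ Y) ≡ countN X + countN Y
  countN-++ []      Y = refl
  countN-++ (𝐞 ∷ X) Y = countN-++ X Y
  countN-++ (𝐧 ∷ X) Y = cong suc (countN-++ X Y)

  countE-[]≤1 : ∀ s → countE [ s ] ≤ 1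
  countE-[]≤1 𝐞 = ≤-refl
  countE-[]≤1 𝐧 = z≤n


  prefE-++ˡ : ∀ i X Y → i ≤ length X → prefE i (X ++ Y) ≡ prefE i X
  prefE-++ˡ zero    X       Y _         = refl
  prefE-++ˡ (suc i) (𝐞 ∷ X) Y (s≤s i≤X) = cong suc (prefE-++ˡ i X Y i≤X)
  prefE-++ˡ (suc i) (𝐧 ∷ X) Y (s≤s i≤X) = prefE-++ˡ i X Y i≤X

  prefE-++ʳ : ∀ i X Y → prefE (length X + i) (X ++ Y) ≡ countE X + prefE i Y
  prefE-++ʳ i []      Y = refl
  prefE-++ʳ i (𝐞 ∷ X) Y = cong suc (prefE-++ʳ i X Y)
  prefE-++ʳ i (𝐧 ∷ X) Y = prefE-++ʳ i X Y

  prefE-full : ∀ i s → length s ≤ i → prefE i s ≡ countE s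
  prefE-full zero    []      _         = refl
  prefE-full (suc i) []      _         = refl
  prefE-full (suc i) (𝐞 ∷ s) (s≤s s≤i) = cong suc (prefE-full i s s≤i)
  prefE-full (suc i) (𝐧 ∷ s) (s≤s s≤i) = prefE-full i s s≤i

  prefE-length-++ : ∀ X Y → prefE (length X) (X ++ Y) ≡ countE X
  prefE-length-++ X Y = trans (prefE-++ˡ (length X) X Y ≤-refl) (prefE-full (length X) X ≤-refl)

  prefE-suc-∷ : ∀ i s R → prefE (suc i) (s ∷ R) ≡ countE [ s ] + prefE i R
  prefE-suc-∷ i 𝐞 R = refl
  prefE-suc-∷ i 𝐧 R = refl

  prefE-middle : ∀ A s B T i → i ≤ length B →
                 prefE (suc (length A) + i) ((A ++ s ∷ B) ++ T) ≡ countE A + (countE [ s ] + prefE i B)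
  prefE-middle A s B T i i≤B = begin
    prefE (suc (length A) + i) ((A ++ s ∷ B) ++ T)
      ≡⟨ cong₂ prefE (sym (+-suc (length A) i)) (++-assoc A (s ∷ B) T) ⟩
    prefE (length A + suc i) (A ++ s ∷ B ++ T)
      ≡⟨ prefE-++ʳ (suc i) A (s ∷ B ++ T) ⟩
    countE A + prefE (suc i) (s ∷ B ++ T)
      ≡⟨ cong (countE A +_) (prefE-suc-∷ i s (B ++ T)) ⟩
    countE A + (countE [ s ] + prefE i (B ++ T))
      ≡⟨ cong (λ w → countE A + (countE [ s ] + w)) (prefE-++ˡ i B T i≤B) ⟩
    countE A + (countE [ s ] + prefE i B) ∎
    where open ≡-Reasoning

  prefE-[] : ∀ i → prefE i [] ≡ 0
  prefE-[] zero    = refl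
  prefE-[] (suc i) = refl

  prefE-1 : ∀ l R → prefE 1 (l ∷ R) ≡ countE [ l ]
  prefE-1 𝐞 R = refl
  prefE-1 𝐧 R = refl

  prefE-1-≥1 : ∀ L → 1 ≤ prefE 1 L → ∃ λ L′ → L ≡ 𝐞 ∷ L′
  prefE-1-≥1 (𝐞 ∷ L′) _ = L′ , refl
  prefE-1-≥1 (𝐧 ∷ L′) ()

  prefE-length-+1 : ∀ X l Y → prefE (length X + 1) (X ++ l ∷ Y) ≡ countE X + countE [ l ]
  prefE-length-+1 X l Y = trans (prefE-++ʳ 1 X (l ∷ Y)) (cong (countE X +_) (prefE-1 l Y))

  prefE-𝐧→𝐞 : ∀ i A B → prefE i (A ++ 𝐧 ∷ B) ≤ prefE i (A ++ 𝐞 ∷ B)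
  prefE-𝐧→𝐞 zero    A       B = z≤n
  prefE-𝐧→𝐞 (suc i) []      B = n≤1+n _
  prefE-𝐧→𝐞 (suc i) (𝐞 ∷ A) B = s≤s (prefE-𝐧→𝐞 i A B)
  prefE-𝐧→𝐞 (suc i) (𝐧 ∷ A) B = prefE-𝐧→𝐞 i A B

  prefE-∷ʳ-≤ : ∀ i B x y → prefE i (B ++ [ x ]) ≤ suc (prefE i (B ++ [ y ]))
  prefE-∷ʳ-≤ zero    B       x y = z≤n
  prefE-∷ʳ-≤ (suc i) []      𝐞 y = s≤s (≤-trans (≤-reflexive (prefE-[] i)) z≤n)
  prefE-∷ʳ-≤ (suc i) []      𝐧 y = ≤-trans (≤-reflexive (prefE-[] i)) z≤n
  prefE-∷ʳ-≤ (suc i) (𝐞 ∷ B) x y = s≤s (prefE-∷ʳ-≤ i B x y)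
  prefE-∷ʳ-≤ (suc i) (𝐧 ∷ B) x y = prefE-∷ʳ-≤ i B x y

  prefE-swap-≤ : ∀ i A B → prefE i ((A ++ 𝐧 ∷ B) ++ [ 𝐞 ]) ≤ prefE i ((A ++ 𝐞 ∷ B) ++ [ 𝐧 ])
  prefE-swap-≤ zero    A       B = z≤n
  prefE-swap-≤ (suc i) []      B = prefE-∷ʳ-≤ i B 𝐞 𝐧
  prefE-swap-≤ (suc i) (𝐞 ∷ A) B = s≤s (prefE-swap-≤ i A B)
  prefE-swap-≤ (suc i) (𝐧 ∷ A) B = prefE-swap-≤ i A B

  Above-countE : ∀ X Y LX LY → length X ≡ length LX →
                 Above (X ++ Y) (LX ++ LY) → countE X ≤ countE LX
  Above-countE X Y LX LY X≡LX above = begin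
    countE X                   ≡⟨ prefE-length-++ X Y ⟨
    prefE (length X) (X ++ Y)  ≤⟨ above (length X) (≤-trans (m≤m+n _ _) (≤-reflexive (sym (length-++ X)))) ⟩
    prefE (length X) (LX ++ LY) ≡⟨ cong (λ i → prefE i (LX ++ LY)) X≡LX ⟩
    prefE (length LX) (LX ++ LY) ≡⟨ prefE-length-++ LX LY ⟩
    countE LX                  ∎
    where open ≤-Reasoning

  Above-∷ʳ-countE : ∀ X LX s l → length X ≡ length LX → Above (X ++ [ s ]) (LX ++ [ l ]) →
                    countE X ≤ countE LX
  Above-∷ʳ-countE X LX s l X≡LX = Above-countE X [ s ] LX [ l ] X≡LX

  Above-∷ʳ-at-end : ∀ X LX s l → length X ≡ length LX → Above (X ++ [ s ]) (LX ++ [ l ]) →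
                    countE X + countE [ s ] ≤ countE LX + countE [ l ]
  Above-∷ʳ-at-end X LX s l X≡LX above = begin
    countE X + countE [ s ]             ≡⟨ prefE-length-+1 X s [] ⟨
    prefE (length X + 1) (X ++ [ s ])   ≤⟨ above _ (≤-reflexive (sym (length-++ X))) ⟩
    prefE (length X + 1) (LX ++ [ l ])  ≡⟨ cong (λ w → prefE (w + 1) (LX ++ [ l ])) X≡LX ⟩
    prefE (length LX + 1) (LX ++ [ l ]) ≡⟨ prefE-length-+1 LX l [] ⟩
    countE LX + countE [ l ]            ∎
    where open ≤-Reasoning


  split-at : ∀ (xs : List A) i → i ≤ length xs →
             ∃₂ λ ys zs → xs ≡ ys ++ zs × length ys ≡ i
  split-at xs       zero    _         = [] , xs , refl , refl
  split-at (x ∷ xs) (suc i) (s≤s i≤n) with split-at xs i i≤n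
  ... | ys , zs , refl , refl = x ∷ ys , zs , refl , refl

  split-alike : ∀ (X : List A) s Y (L : List A) → length (X ++ s ∷ Y) ≡ length L →
                ∃₂ λ LX LY → ∃ λ l → L ≡ LX ++ l ∷ LY × length X ≡ length LX × length Y ≡ length LY
  split-alike X s Y L eq with split-at L (length X) (≤-trans (m≤m+n _ _) (≤-trans (≤-reflexive (sym (length-++ X))) (≤-reflexive eq)))
  ... | LX , []     , refl , LX≡X =
    contradiction (trans (sym (length-++ X)) (trans eq (trans (length-++ LX) (trans (+-identityʳ _) LX≡X)))) (m+1+n≢m (length X))
  ... | LX , l ∷ LY , refl , LX≡X = LX , LY , l , refl , sym LX≡X ,
    suc-injective (+-cancelˡ-≡ (length X) _ _
      (trans (sym (length-++ X)) (trans eq (trans (length-++ LX) (cong (_+ suc (length LY)) LX≡X)))))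

  split-at-east : ∀ C k → k < countE C → ∃₂ λ X Y → C ≡ X ++ 𝐞 ∷ Y × countE X ≡ k
  split-at-east (𝐞 ∷ C) zero    _         = [] , C , refl , refl
  split-at-east (𝐞 ∷ C) (suc k) (s≤s k<C) with split-at-east C k k<C
  ... | X , Y , refl , refl = 𝐞 ∷ X , Y , refl , refl
  split-at-east (𝐧 ∷ C) k k<C with split-at-east C k k<C
  ... | X , Y , refl , refl = 𝐧 ∷ X , Y , refl , refl

  ++-∷-++-assoc : ∀ (A B₁ B₂ : List Step) x y → (A ++ x ∷ (B₁ ++ B₂)) ++ y ≡ (A ++ x ∷ B₁) ++ (B₂ ++ y)
  ++-∷-++-assoc []      B₁ B₂ x y = cong (x ∷_) (++-assoc B₁ B₂ y)
  ++-∷-++-assoc (a ∷ A) B₁ B₂ x y = cong (a ∷_) (++-∷-++-assoc A B₁ B₂ x y)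

  -- nth returns 0 out of range.

  nth-++ˡ : ∀ xs ys i → i < length xs → nth (xs ++ ys) i ≡ nth xs i
  nth-++ˡ (x ∷ xs) ys zero    _         = refl
  nth-++ˡ (x ∷ xs) ys (suc i) (s≤s i<n) = nth-++ˡ xs ys i i<n

  nth-++ʳ : ∀ xs ys i → nth (xs ++ ys) (length xs + i) ≡ nth ys i
  nth-++ʳ []       ys i = refl
  nth-++ʳ (x ∷ xs) ys i = nth-++ʳ xs ys i

  nth-++-≥ : ∀ xs ys k → length xs ≤ k → nth (xs ++ ys) k ≡ nth ys (k ∸ length xs)
  nth-++-≥ xs ys k xs≤k = trans (cong (nth (xs ++ ys)) (sym (m+[n∸m]≡n xs≤k))) (nth-++ʳ xs ys (k ∸ length xs))

  nth-++-length : ∀ xs y ys → nth (xs ++ y ∷ ys) (length xs) ≡ y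
  nth-++-length xs y ys = trans (cong (nth (xs ++ y ∷ ys)) (sym (+-identityʳ _))) (nth-++ʳ xs (y ∷ ys) 0)

  nth-map-suc : ∀ xs i → i < length xs → nth (map suc xs) i ≡ suc (nth xs i)
  nth-map-suc (x ∷ xs) zero    _         = refl
  nth-map-suc (x ∷ xs) (suc i) (s≤s i<n) = nth-map-suc xs i i<n

  nth-≥length : ∀ xs i → length xs ≤ i → nth xs i ≡ 0
  nth-≥length []       i       _         = refl
  nth-≥length (x ∷ xs) (suc i) (s≤s n≤i) = nth-≥length xs i n≤i


  eastHeights-suc : ∀ X y → eastHeights X (suc y) ≡ map suc (eastHeights X y)
  eastHeights-suc []      y = refl
  eastHeights-suc (𝐞 ∷ X) y = cong (suc y ∷_) (eastHeights-suc X y)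
  eastHeights-suc (𝐧 ∷ X) y = eastHeights-suc X (suc y)

  eastHeights-++ : ∀ X Y y → eastHeights (X ++ Y) y ≡ eastHeights X y ++ eastHeights Y (countN X + y)
  eastHeights-++ []      Y y = refl
  eastHeights-++ (𝐞 ∷ X) Y y = cong (y ∷_) (eastHeights-++ X Y y)
  eastHeights-++ (𝐧 ∷ X) Y y =
    trans (eastHeights-++ X Y (suc y))
          (cong (λ w → eastHeights X (suc y) ++ eastHeights Y w) (+-suc (countN X) y))

  length-eastHeights : ∀ X y → length (eastHeights X y) ≡ countE X
  length-eastHeights []      y = refl
  length-eastHeights (𝐞 ∷ X) y = cong suc (length-eastHeights X y)
  length-eastHeights (𝐧 ∷ X) y = length-eastHeights X (suc y)

  eastHeights-bounded : ∀ X y i → i < countE X →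
                        y ≤ nth (eastHeights X y) i × nth (eastHeights X y) i ≤ countN X + y
  eastHeights-bounded (𝐞 ∷ X) y zero    _         = ≤-refl , m≤n+m y (countN X)
  eastHeights-bounded (𝐞 ∷ X) y (suc i) (s≤s i<X) = eastHeights-bounded X y i i<X
  eastHeights-bounded (𝐧 ∷ X) y i i<X with eastHeights-bounded X (suc y) i i<X
  ... | lo , hi = ≤-trans (n≤1+n y) lo , ≤-trans hi (≤-reflexive (+-suc (countN X) y))

  eastHeights-mono : ∀ X y i → suc i < countE X →
                     nth (eastHeights X y) i ≤ nth (eastHeights X y) (suc i)
  eastHeights-mono (𝐞 ∷ X) y zero    (s≤s i<X) = proj₁ (eastHeights-bounded X y 0 i<X)
  eastHeights-mono (𝐞 ∷ X) y (suc i) (s≤s i<X) = eastHeights-mono X y i i<X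
  eastHeights-mono (𝐧 ∷ X) y i       i<X       = eastHeights-mono X (suc y) i i<X

  nth-eastHeights-++-𝐞 : ∀ X Y → nth (eastHeights (X ++ 𝐞 ∷ Y) 0) (countE X) ≡ countN X + 0
  nth-eastHeights-++-𝐞 X Y = begin
    nth (eastHeights (X ++ 𝐞 ∷ Y) 0) (countE X)
      ≡⟨ cong (λ w → nth w (countE X)) (eastHeights-++ X (𝐞 ∷ Y) 0) ⟩
    nth (eastHeights X 0 ++ eastHeights (𝐞 ∷ Y) (countN X + 0)) (countE X)
      ≡⟨ cong (nth (eastHeights X 0 ++ _)) (sym (length-eastHeights X 0)) ⟩
    nth (eastHeights X 0 ++ eastHeights (𝐞 ∷ Y) (countN X + 0)) (length (eastHeights X 0))
      ≡⟨ nth-++-length (eastHeights X 0) _ _ ⟩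
    countN X + 0 ∎
    where open ≡-Reasoning


  demarc-++ : ∀ X LX Y LY → length X ≡ length LX →
              demarc (X ++ Y) (LX ++ LY) ≡ demarc X LX ++ demarc Y LY
  demarc-++ []      []       Y LY _  = refl
  demarc-++ (𝐞 ∷ X) (𝐞 ∷ LX) Y LY eq = cong (dE ∷_) (demarc-++ X LX Y LY (suc-injective eq))
  demarc-++ (𝐞 ∷ X) (𝐧 ∷ LX) Y LY eq = demarc-++ X LX Y LY (suc-injective eq)
  demarc-++ (𝐧 ∷ X) (𝐞 ∷ LX) Y LY eq = cong (dD ∷_) (demarc-++ X LX Y LY (suc-injective eq))
  demarc-++ (𝐧 ∷ X) (𝐧 ∷ LX) Y LY eq = cong (dN ∷_) (demarc-++ X LX Y LY (suc-injective eq))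

  crossHeights-suc : ∀ P y → crossHeights P (suc y) ≡ map suc (crossHeights P y)
  crossHeights-suc []       y = refl
  crossHeights-suc (dN ∷ P) y = crossHeights-suc P (suc y)
  crossHeights-suc (dE ∷ P) y = cong (suc y ∷_) (crossHeights-suc P y)
  crossHeights-suc (dD ∷ P) y = cong (suc y ∷_) (crossHeights-suc P (suc y))

  crossHeights-++ : ∀ P Q y → crossHeights (P ++ Q) y ≡ crossHeights P y ++ crossHeights Q (rise P + y)
  crossHeights-++-suc : ∀ P Q y → crossHeights (P ++ Q) (suc y) ≡ crossHeights P (suc y) ++ crossHeights Q (suc (rise P + y))
  crossHeights-++ []       Q y = refl
  crossHeights-++ (dN ∷ P) Q y = crossHeights-++-suc P Q y
  crossHeights-++ (dE ∷ P) Q y = cong (y ∷_) (crossHeights-++ P Q y)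
  crossHeights-++ (dD ∷ P) Q y = cong (y ∷_) (crossHeights-++-suc P Q y)

  crossHeights-++-suc P Q y =
    trans (crossHeights-++ P Q (suc y))
          (cong (λ w → crossHeights P (suc y) ++ crossHeights Q w) (+-suc (rise P) y))

  length-crossHeights-demarc : ∀ X LX y → length X ≡ length LX →
                               length (crossHeights (demarc X LX) y) ≡ countE LX
  length-crossHeights-demarc []      []       y _  = refl
  length-crossHeights-demarc (𝐞 ∷ X) (𝐞 ∷ LX) y eq = cong suc (length-crossHeights-demarc X LX y (suc-injective eq))
  length-crossHeights-demarc (𝐞 ∷ X) (𝐧 ∷ LX) y eq = length-crossHeights-demarc X LX y (suc-injective eq)
  length-crossHeights-demarc (𝐧 ∷ X) (𝐞 ∷ LX) y eq = cong suc (length-crossHeights-demarc X LX (suc y) (suc-injective eq))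
  length-crossHeights-demarc (𝐧 ∷ X) (𝐧 ∷ LX) y eq = length-crossHeights-demarc X LX (suc y) (suc-injective eq)

  rise-demarc : ∀ X LX → length X ≡ length LX → rise (demarc X LX) ≡ countN X
  rise-demarc []      []       _  = refl
  rise-demarc (𝐞 ∷ X) (𝐞 ∷ LX) eq = rise-demarc X LX (suc-injective eq)
  rise-demarc (𝐞 ∷ X) (𝐧 ∷ LX) eq = rise-demarc X LX (suc-injective eq)
  rise-demarc (𝐧 ∷ X) (𝐞 ∷ LX) eq = cong suc (rise-demarc X LX (suc-injective eq))
  rise-demarc (𝐧 ∷ X) (𝐧 ∷ LX) eq = cong suc (rise-demarc X LX (suc-injective eq))

  crossHeights-bounded : ∀ P y i → i < length (crossHeights P y) →
                         y ≤ nth (crossHeights P y) i × nth (crossHeights P y) i ≤ rise P + y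
  crossHeights-bounded (dN ∷ P) y i i<P with crossHeights-bounded P (suc y) i i<P
  ... | lo , hi = ≤-trans (n≤1+n y) lo , ≤-trans hi (≤-reflexive (+-suc (rise P) y))
  crossHeights-bounded (dE ∷ P) y zero    _         = ≤-refl , m≤n+m y (rise P)
  crossHeights-bounded (dE ∷ P) y (suc i) (s≤s i<P) = crossHeights-bounded P y i i<P
  crossHeights-bounded (dD ∷ P) y zero    _         = ≤-refl , ≤-trans (n≤1+n y) (s≤s (m≤n+m y (rise P)))
  crossHeights-bounded (dD ∷ P) y (suc i) (s≤s i<P) = crossHeights-bounded (dN ∷ P) y i i<P

  nth-crossHeights-≤ : ∀ P y i → nth (crossHeights P y) i ≤ rise P + y
  nth-crossHeights-≤ P y i with i <? length (crossHeights P y)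
  ... | yes i<P = proj₂ (crossHeights-bounded P y i i<P)
  ... | no  i≮P = ≤-trans (≤-reflexive (nth-≥length (crossHeights P y) i (≮⇒≥ i≮P))) z≤n

  crossHeights-demarc-++ : ∀ X LX Y LY → length X ≡ length LX →
    crossHeights (demarc (X ++ Y) (LX ++ LY)) 0
    ≡ crossHeights (demarc X LX) 0 ++ crossHeights (demarc Y LY) (countN X + 0)
  crossHeights-demarc-++ X LX Y LY X≡LX = begin
    crossHeights (demarc (X ++ Y) (LX ++ LY)) 0
      ≡⟨ cong (λ P → crossHeights P 0) (demarc-++ X LX Y LY X≡LX) ⟩
    crossHeights (demarc X LX ++ demarc Y LY) 0
      ≡⟨ crossHeights-++ (demarc X LX) _ 0 ⟩
    crossHeights (demarc X LX) 0 ++ crossHeights (demarc Y LY) (rise (demarc X LX) + 0)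
      ≡⟨ cong (λ v → crossHeights (demarc X LX) 0 ++ crossHeights (demarc Y LY) (v + 0)) (rise-demarc X LX X≡LX) ⟩
    crossHeights (demarc X LX) 0 ++ crossHeights (demarc Y LY) (countN X + 0) ∎
    where open ≡-Reasoning


  selectE-++ : ∀ X Y f x → selectE (X ++ Y) f x ≡ selectE X f x ++ selectE Y f (countE X + x)
  selectE-++ []      Y f x = refl
  selectE-++ (𝐞 ∷ X) Y f x =
    cong (f x ∷_) (trans (selectE-++ X Y f (suc x))
                         (cong (λ w → selectE X f (suc x) ++ selectE Y f w) (+-suc (countE X) x)))
  selectE-++ (𝐧 ∷ X) Y f x = cong (false ∷_) (selectE-++ X Y f x)

  selectE-cong : ∀ X f g x x′ → (∀ i → i < countE X → f (i + x) ≡ g (i + x′)) →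
                 selectE X f x ≡ selectE X g x′
  selectE-cong []      f g x x′ f≗g = refl
  selectE-cong (𝐞 ∷ X) f g x x′ f≗g =
    cong₂ _∷_ (f≗g 0 (s≤s z≤n))
              (selectE-cong X f g (suc x) (suc x′) λ i i<X →
                 trans (cong f (+-suc i x)) (trans (f≗g (suc i) (s≤s i<X)) (cong g (sym (+-suc i x′)))))
  selectE-cong (𝐧 ∷ X) f g x x′ f≗g = cong (false ∷_) (selectE-cong X f g x x′ f≗g)

  countTrue : List Bool → ℕ
  countTrue []           = 0
  countTrue (true ∷ bs)  = suc (countTrue bs)
  countTrue (false ∷ bs) = countTrue bs

  countTrue-selectE-≤ : ∀ X f x → countTrue (selectE X f x) ≤ countE X
  countTrue-selectE-≤ []      f x = z≤n
  countTrue-selectE-≤ (𝐞 ∷ X) f x with f x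
  ... | true  = s≤s (countTrue-selectE-≤ X f (suc x))
  ... | false = m≤n⇒m≤1+n (countTrue-selectE-≤ X f (suc x))
  countTrue-selectE-≤ (𝐧 ∷ X) f x = countTrue-selectE-≤ X f x

  countTrue-selectE-all : ∀ X f x → (∀ i → i < countE X → f (i + x) ≡ true) → countTrue (selectE X f x) ≡ countE X
  countTrue-selectE-all []      f x all = refl
  countTrue-selectE-all (𝐞 ∷ X) f x all rewrite all 0 (s≤s z≤n) =
    cong suc (countTrue-selectE-all X f (suc x) λ i i<X → trans (cong f (+-suc i x)) (all (suc i) (s≤s i<X)))
  countTrue-selectE-all (𝐧 ∷ X) f x all = countTrue-selectE-all X f x all

module LatticePathMatroid where

  open import Defs
  open NatSearch
  open PathCounts
  open import Data.Nat using (ℕ; zero; suc; pred; _+_; _≤_; _<_; _∸_; z≤n; s≤s; _<ᵇ_; _≤?_; _<?_; >-nonZero)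
  open import Data.Nat.Properties
  open import Data.Bool using (if_then_else_)
  open import Data.Product using (∃; _×_; _,_; proj₁; proj₂)
  open import Data.List using (List; []; _∷_; [_]; length)
  open import Data.Vec using ([]; _∷_; toList; lookup; _[_]≔_)
  open import Data.Vec.Properties using (length-toList; []=⇒lookup; lookup⇒[]=; lookup-map; map-[]≔)
  open import Data.Fin using (Fin; zero; suc; toℕ; fromℕ<)
  open import Data.Fin.Properties using (toℕ-fromℕ<; toℕ<n)
  open import Data.Fin.Subset using (Subset; inside; outside; _∈_; _∉_)
  open import Function using (_∘_)
  open import Relation.Binary.PropositionalEquality hiding ([_])
  open import Relation.Nullary using (yes; no; contradiction)

  -- With u the prefix counts of U these are the paths of 𝒫[U,L]; unlike 𝒫[U,L],
  -- the family is closed under deleting or contracting the last element.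
  Bounded : ℕ → (ℕ → ℕ) → List Step → List Step → Set
  Bounded d u L C = countE C ≡ d × (∀ i → i ≤ length C → u i ≤ prefE i C) × Above C L

  lookupL : List Step → ℕ → Step
  lookupL []      _       = 𝐧
  lookupL (s ∷ C) zero    = s
  lookupL (s ∷ C) (suc i) = lookupL C i

  setL : List Step → ℕ → Step → List Step
  setL []      _       _ = []
  setL (c ∷ C) zero    s = s ∷ C
  setL (c ∷ C) (suc i) s = c ∷ setL C i s

  length-setL : ∀ C i s → length (setL C i s) ≡ length C
  length-setL []      i       s = refl
  length-setL (c ∷ C) zero    s = refl
  length-setL (c ∷ C) (suc i) s = cong suc (length-setL C i s)

  lookupL-setL : ∀ C i j s → i ≢ j → lookupL (setL C i s) j ≡ lookupL C j
  lookupL-setL []      i       j       s i≢j = refl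
  lookupL-setL (c ∷ C) zero    zero    s i≢j = contradiction refl i≢j
  lookupL-setL (c ∷ C) zero    (suc j) s i≢j = refl
  lookupL-setL (c ∷ C) (suc i) zero    s i≢j = refl
  lookupL-setL (c ∷ C) (suc i) (suc j) s i≢j = lookupL-setL C i j s (i≢j ∘ cong suc)

  before : ℕ → ℕ → ℕ
  before x i = if x <ᵇ i then 1 else 0

  before-< : ∀ {x i} → x < i → before x i ≡ 1
  before-< {zero}  {suc i} _         = refl
  before-< {suc x} {suc i} (s≤s x<i) = before-< x<i

  before-≥ : ∀ {x i} → i ≤ x → before x i ≡ 0
  before-≥ {x}     {zero}  _         = refl
  before-≥ {suc x} {suc i} (s≤s i≤x) = before-≥ i≤x

  before-anti : ∀ {x y} i → x ≤ y → before y i ≤ before x i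
  before-anti {x} {y} i x≤y with y <? i
  ... | yes y<i = ≤-reflexive (trans (before-< y<i) (sym (before-< (≤-<-trans x≤y y<i))))
  ... | no  y≮i = ≤-trans (≤-reflexive (before-≥ (≮⇒≥ y≮i))) z≤n

  prefE-set-𝐧 : ∀ C x → lookupL C x ≡ 𝐞 → x < length C → ∀ i → prefE i (setL C x 𝐧) + before x i ≡ prefE i C
  prefE-set-𝐧 (c ∷ C) zero    _    _         zero    = refl
  prefE-set-𝐧 (𝐞 ∷ C) zero    refl _         (suc i) = +-comm (prefE i C) 1
  prefE-set-𝐧 (c ∷ C) (suc x) _    _         zero    = refl
  prefE-set-𝐧 (𝐞 ∷ C) (suc x) Cx   (s≤s x<C) (suc i) = cong suc (prefE-set-𝐧 C x Cx x<C i)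
  prefE-set-𝐧 (𝐧 ∷ C) (suc x) Cx   (s≤s x<C) (suc i) = prefE-set-𝐧 C x Cx x<C i

  prefE-set-𝐞 : ∀ C y → lookupL C y ≡ 𝐧 → y < length C → ∀ i → prefE i (setL C y 𝐞) ≡ prefE i C + before y i
  prefE-set-𝐞 (c ∷ C) zero    _    _         zero    = refl
  prefE-set-𝐞 (𝐧 ∷ C) zero    refl _         (suc i) = +-comm 1 (prefE i C)
  prefE-set-𝐞 (c ∷ C) (suc y) _    _         zero    = refl
  prefE-set-𝐞 (𝐞 ∷ C) (suc y) Cy   (s≤s y<C) (suc i) = cong suc (prefE-set-𝐞 C y Cy y<C i)
  prefE-set-𝐞 (𝐧 ∷ C) (suc y) Cy   (s≤s y<C) (suc i) = prefE-set-𝐞 C y Cy y<C i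

  prefE-suc : ∀ C i → i < length C → prefE (suc i) C ≡ prefE i C + countE [ lookupL C i ]
  prefE-suc (𝐞 ∷ C) zero    _         = refl
  prefE-suc (𝐧 ∷ C) zero    _         = refl
  prefE-suc (𝐞 ∷ C) (suc i) (s≤s i<C) = cong suc (prefE-suc C i i<C)
  prefE-suc (𝐧 ∷ C) (suc i) (s≤s i<C) = prefE-suc C i i<C

  letters : ∀ s t → suc (countE [ s ]) ≤ countE [ t ] → s ≡ 𝐧 × t ≡ 𝐞
  letters 𝐧 𝐞 _ = refl , refl
  letters 𝐞 𝐞 (s≤s ())
  letters 𝐧 𝐧 ()
  letters 𝐞 𝐧 ()

  module Exchange (d : ℕ) (u : ℕ → ℕ) (L C₁ C₂ : List Step) (C₁≡C₂ : length C₁ ≡ length C₂)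
                  (b₁ : Bounded d u L C₁) (b₂ : Bounded d u L C₂)
                  (x : ℕ) (x<N : x < length C₁) (C₁x : lookupL C₁ x ≡ 𝐞) (C₂x : lookupL C₂ x ≡ 𝐧) where

    N : ℕ
    N = length C₁

    p₁ p₂ : ℕ → ℕ
    p₁ i = prefE i C₁
    p₂ i = prefE i C₂

    p₁N≡p₂N : p₁ N ≡ p₂ N
    p₁N≡p₂N = trans (prefE-full N C₁ ≤-refl)
                (trans (proj₁ b₁) (sym (trans (prefE-full N C₂ (≤-reflexive (sym C₁≡C₂))) (proj₁ b₂))))

    p₂-suc : ∀ y → y < N → p₂ (suc y) ≡ p₂ y + countE [ lookupL C₂ y ]
    p₂-suc y y<N = prefE-suc C₂ y (≤-trans y<N (≤-reflexive C₁≡C₂))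

    Exchanged : ℕ → Set
    Exchanged y = lookupL C₂ y ≡ 𝐞 × lookupL C₁ y ≡ 𝐧 × Bounded d u L (setL (setL C₁ x 𝐧) y 𝐞)

    module Moved (y : ℕ) (y<N : y < N) (x≢y : x ≢ y) (C₁y : lookupL C₁ y ≡ 𝐧) where

      C₃ : List Step
      C₃ = setL (setL C₁ x 𝐧) y 𝐞

      length-C₃ : length C₃ ≡ N
      length-C₃ = trans (length-setL (setL C₁ x 𝐧) y 𝐞) (length-setL C₁ x 𝐧)

      prefE-C₃ : ∀ i → prefE i C₃ + before x i ≡ p₁ i + before y i
      prefE-C₃ i = begin
        prefE i C₃ + before x i                         ≡⟨ cong (_+ before x i) (prefE-set-𝐞 C′ y C′y y<C′ i) ⟩
        prefE i C′ + before y i + before x i            ≡⟨ +-assoc (prefE i C′) _ _ ⟩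
        prefE i C′ + (before y i + before x i)          ≡⟨ cong (prefE i C′ +_) (+-comm (before y i) _) ⟩
        prefE i C′ + (before x i + before y i)          ≡⟨ +-assoc (prefE i C′) _ _ ⟨
        prefE i C′ + before x i + before y i            ≡⟨ cong (_+ before y i) (prefE-set-𝐧 C₁ x C₁x x<N i) ⟩
        p₁ i + before y i                               ∎
        where
          open ≡-Reasoning
          C′ = setL C₁ x 𝐧
          C′y = trans (lookupL-setL C₁ x y 𝐧 x≢y) C₁y
          y<C′ = ≤-trans y<N (≤-reflexive (sym (length-setL C₁ x 𝐧)))

      prefE-C₃-≡ : ∀ i → before x i ≡ before y i → prefE i C₃ ≡ p₁ i
      prefE-C₃-≡ i bx≡by = +-cancelʳ-≡ (before x i) _ _ (trans (prefE-C₃ i) (cong (p₁ i +_) (sym bx≡by)))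

      bounded : (∀ i → i ≤ N → u i ≤ prefE i C₃) → (∀ i → i ≤ N → prefE i C₃ ≤ prefE i L) →
                Bounded d u L C₃
      bounded lo hi = countE-C₃ , (λ i i≤ → lo i (≤-trans i≤ (≤-reflexive length-C₃)))
                                , (λ i i≤ → hi i (≤-trans i≤ (≤-reflexive length-C₃)))
        where
          countE-C₃ : countE C₃ ≡ d
          countE-C₃ = +-cancelʳ-≡ 1 _ _ (begin
            countE C₃ + 1            ≡⟨ cong₂ _+_ (prefE-full N C₃ (≤-reflexive length-C₃)) (before-< x<N) ⟨
            prefE N C₃ + before x N  ≡⟨ prefE-C₃ N ⟩
            p₁ N + before y N        ≡⟨ cong₂ _+_ (trans (prefE-full N C₁ ≤-refl) (proj₁ b₁)) (before-< y<N) ⟩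
            d + 1                    ∎)
            where open ≡-Reasoning

    catch-up-after : p₂ x ≤ p₁ x →
      ∃ λ y → x < y × y < N × (∀ i → x < i → i ≤ y → p₂ i < p₁ i) × p₁ (suc y) ≤ p₂ (suc y)
    catch-up-after p₂x≤p₁x
      with firstFrom (λ t → p₁ t ≤? p₂ t) (suc x) (N ∸ suc x)
                     (subst (λ t → p₁ t ≤ p₂ t) (sym (m+[n∸m]≡n x<N)) (≤-reflexive p₁N≡p₂N))
    ... | t , t≤N , 1+x≤t , p₁t≤p₂t , behind =
      pred t , x<y , y<N , (λ i x<i i≤y → ≰⇒> (behind i x<i (≤-trans (s≤s i≤y) (≤-reflexive 1+y≡t))))
             , subst (λ t → p₁ t ≤ p₂ t) (sym 1+y≡t) p₁t≤p₂t
      where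
        p₁-1+x : p₁ (suc x) ≡ suc (p₁ x)
        p₁-1+x = trans (prefE-suc C₁ x x<N) (trans (cong (λ s → p₁ x + countE [ s ]) C₁x) (+-comm (p₁ x) 1))
        p₂-1+x : p₂ (suc x) ≡ p₂ x
        p₂-1+x = trans (p₂-suc x x<N) (trans (cong (λ s → p₂ x + countE [ s ]) C₂x) (+-identityʳ (p₂ x)))
        1+x<t : suc x < t
        1+x<t = ≤∧≢⇒< 1+x≤t λ 1+x≡t → <-irrefl refl (begin-strict
          p₁ x       <⟨ ≤-reflexive (sym p₁-1+x) ⟩
          p₁ (suc x) ≤⟨ subst (λ t → p₁ t ≤ p₂ t) (sym 1+x≡t) p₁t≤p₂t ⟩
          p₂ (suc x) ≡⟨ p₂-1+x ⟩
          p₂ x       ≤⟨ p₂x≤p₁x ⟩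
          p₁ x       ∎)
          where open ≤-Reasoning
        1+y≡t : suc (pred t) ≡ t
        1+y≡t = suc-pred t {{>-nonZero (<-trans (s≤s z≤n) 1+x<t)}}
        x<y : x < pred t
        x<y = ≤-pred (≤-trans 1+x<t (≤-reflexive (sym 1+y≡t)))
        y<N : pred t < N
        y<N = ≤-trans (≤-reflexive 1+y≡t) (≤-trans t≤N (≤-reflexive (m+[n∸m]≡n x<N)))

    catch-up-before : p₁ x < p₂ x → ∃ λ y → y < x × (∀ i → y < i → i ≤ x → p₁ i < p₂ i) × p₂ y ≤ p₁ y
    catch-up-before p₁x<p₂x with lastUpTo-witness (λ t → p₂ t ≤? p₁ t) x 0 z≤n z≤n
    ... | y , y≤x , p₂y≤p₁y , ahead = y , y<x , (λ i y<i i≤x → ≰⇒> (ahead i y<i i≤x)) , p₂y≤p₁y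
      where
        y<x : y < x
        y<x = ≤∧≢⇒< y≤x λ y≡x → <-irrefl refl (≤-trans p₁x<p₂x (subst (λ t → p₂ t ≤ p₁ t) y≡x p₂y≤p₁y))

    exchange-after : p₂ x ≤ p₁ x → ∃ λ y → y < N × Exchanged y
    exchange-after p₂x≤p₁x with catch-up-after p₂x≤p₁x
    ... | y , x<y , y<N , C₂behind , p₁≤p₂ = y , y<N , proj₂ C₁₂y , proj₁ C₁₂y , bounded lo hi
      where
        C₁₂y : lookupL C₁ y ≡ 𝐧 × lookupL C₂ y ≡ 𝐞
        C₁₂y = letters _ _ (+-cancelˡ-≤ (p₂ y) _ _ (begin
          p₂ y + suc (countE [ lookupL C₁ y ]) ≡⟨ +-suc (p₂ y) _ ⟩
          suc (p₂ y) + countE [ lookupL C₁ y ] ≤⟨ +-monoˡ-≤ _ (C₂behind y x<y ≤-refl) ⟩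
          p₁ y + countE [ lookupL C₁ y ]       ≡⟨ prefE-suc C₁ y y<N ⟨
          p₁ (suc y)                           ≤⟨ p₁≤p₂ ⟩
          p₂ (suc y)                           ≡⟨ p₂-suc y y<N ⟩
          p₂ y + countE [ lookupL C₂ y ]       ∎))
          where open ≤-Reasoning
        open Moved y y<N (<⇒≢ x<y) (proj₁ C₁₂y)
        lo : ∀ i → i ≤ N → u i ≤ prefE i C₃
        lo i i≤N with x <? i | y <? i
        ... | no x≮i | _ = ≤-trans (proj₁ (proj₂ b₁) i i≤N)
                             (≤-reflexive (sym (prefE-C₃-≡ i (trans (before-≥ (≮⇒≥ x≮i))
                                                                     (sym (before-≥ (≤-trans (≮⇒≥ x≮i) (<⇒≤ x<y))))))))
        ... | yes x<i | yes y<i = ≤-trans (proj₁ (proj₂ b₁) i i≤N)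
                                    (≤-reflexive (sym (prefE-C₃-≡ i (trans (before-< x<i) (sym (before-< y<i))))))
        ... | yes x<i | no y≮i = ≤-trans (proj₁ (proj₂ b₂) i (≤-trans i≤N (≤-reflexive C₁≡C₂)))
                                   (≤-pred (≤-trans (C₂behind i x<i (≮⇒≥ y≮i)) (≤-reflexive (sym C₃+1≡))))
          where
            C₃+1≡ : suc (prefE i C₃) ≡ p₁ i
            C₃+1≡ = trans (+-comm 1 _) (trans (cong (prefE i C₃ +_) (sym (before-< x<i)))
                      (trans (prefE-C₃ i) (trans (cong (p₁ i +_) (before-≥ (≮⇒≥ y≮i))) (+-identityʳ _))))
        hi : ∀ i → i ≤ N → prefE i C₃ ≤ prefE i L
        hi i i≤N = ≤-trans (+-cancelʳ-≤ (before x i) _ _ (≤-trans (≤-reflexive (prefE-C₃ i)) (+-monoʳ-≤ (p₁ i) (before-anti i (<⇒≤ x<y)))))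
                           (proj₂ (proj₂ b₁) i i≤N)

    exchange-before : p₁ x < p₂ x → ∃ λ y → y < N × Exchanged y
    exchange-before p₁x<p₂x with catch-up-before p₁x<p₂x
    ... | y , y<x , C₁behind , p₂y≤p₁y = y , y<N , proj₂ C₁₂y , proj₁ C₁₂y , bounded lo hi
      where
        y<N : y < N
        y<N = <-trans y<x x<N
        C₁₂y : lookupL C₁ y ≡ 𝐧 × lookupL C₂ y ≡ 𝐞
        C₁₂y = letters _ _ (+-cancelˡ-≤ (p₁ y) _ _ (begin
          p₁ y + suc (countE [ lookupL C₁ y ]) ≡⟨ +-suc (p₁ y) _ ⟩
          suc (p₁ y + countE [ lookupL C₁ y ]) ≡⟨ cong suc (prefE-suc C₁ y y<N) ⟨
          suc (p₁ (suc y))                     ≤⟨ C₁behind (suc y) ≤-refl y<x ⟩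
          p₂ (suc y)                           ≡⟨ p₂-suc y y<N ⟩
          p₂ y + countE [ lookupL C₂ y ]       ≤⟨ +-monoˡ-≤ _ p₂y≤p₁y ⟩
          p₁ y + countE [ lookupL C₂ y ]       ∎))
          where open ≤-Reasoning
        open Moved y y<N (<⇒≢ y<x ∘ sym) (proj₁ C₁₂y)
        lo : ∀ i → i ≤ N → u i ≤ prefE i C₃
        lo i i≤N = ≤-trans (proj₁ (proj₂ b₁) i i≤N)
                     (+-cancelʳ-≤ (before x i) _ _ (≤-trans (+-monoʳ-≤ (p₁ i) (before-anti i (<⇒≤ y<x))) (≤-reflexive (sym (prefE-C₃ i)))))
        hi : ∀ i → i ≤ N → prefE i C₃ ≤ prefE i L
        hi i i≤N with y <? i | x <? i
        ... | no y≮i | _ = ≤-trans (≤-reflexive (prefE-C₃-≡ i (trans (before-≥ (≤-trans (≮⇒≥ y≮i) (<⇒≤ y<x)))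
                                                               (sym (before-≥ (≮⇒≥ y≮i))))))
                             (proj₂ (proj₂ b₁) i i≤N)
        ... | yes y<i | yes x<i = ≤-trans (≤-reflexive (prefE-C₃-≡ i (trans (before-< x<i) (sym (before-< y<i)))))
                                    (proj₂ (proj₂ b₁) i i≤N)
        ... | yes y<i | no x≮i = ≤-trans (≤-trans (≤-reflexive C₃≡) (C₁behind i y<i (≮⇒≥ x≮i)))
                                   (proj₂ (proj₂ b₂) i (≤-trans i≤N (≤-reflexive C₁≡C₂)))
          where
            C₃≡ : prefE i C₃ ≡ suc (p₁ i)
            C₃≡ = trans (sym (+-identityʳ _)) (trans (cong (prefE i C₃ +_) (sym (before-≥ (≮⇒≥ x≮i))))
                    (trans (prefE-C₃ i) (trans (cong (p₁ i +_) (before-< y<i)) (+-comm (p₁ i) 1))))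

    exchange : ∃ λ y → y < N × Exchanged y
    exchange with p₂ x ≤? p₁ x
    ... | yes p₂x≤p₁x = exchange-after p₂x≤p₁x
    ... | no  p₂x≰p₁x = exchange-before (≰⇒> p₂x≰p₁x)

  BoundedPath : (n d : ℕ) (u : ℕ → ℕ) (L : Path n) → Path n → Set
  BoundedPath n d u L C = InP n d C × (∀ i → i ≤ n → u i ≤ prefE i (toList C)) × WeaklyAbove C L

  BoundedBasis : (n d : ℕ) (u : ℕ → ℕ) (L : Path n) → Subset n → Set
  BoundedBasis n d u L B = ∃ λ C → BoundedPath n d u L C × Epos C ≡ B

  toList-[]≔ : ∀ {n} (C : Path n) (i : Fin n) s → toList (C [ i ]≔ s) ≡ setL (toList C) (toℕ i) s
  toList-[]≔ (c ∷ C) zero    s = refl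
  toList-[]≔ (c ∷ C) (suc i) s = cong (c ∷_) (toList-[]≔ C i s)

  lookupL-toList : ∀ {n} (C : Path n) i → lookupL (toList C) (toℕ i) ≡ lookup C i
  lookupL-toList (c ∷ C) zero    = refl
  lookupL-toList (c ∷ C) (suc i) = lookupL-toList C i

  ∈-Epos⁻ : ∀ {n} (C : Path n) i → i ∈ Epos C → lookup C i ≡ 𝐞
  ∈-Epos⁻ C i i∈C with lookup C i | trans (sym (lookup-map i isE C)) ([]=⇒lookup i∈C)
  ... | 𝐞 | _ = refl

  ∉-Epos⁻ : ∀ {n} (C : Path n) i → i ∉ Epos C → lookup C i ≡ 𝐧
  ∉-Epos⁻ C i i∉C with lookup C i in Ci
  ... | 𝐧 = refl
  ... | 𝐞 = contradiction (lookup⇒[]= i (Epos C) (trans (lookup-map i isE C) (cong isE Ci))) i∉C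

  ∈-Epos⁺ : ∀ {n} (C : Path n) i → lookup C i ≡ 𝐞 → i ∈ Epos C
  ∈-Epos⁺ C i Ci = lookup⇒[]= i (Epos C) (trans (lookup-map i isE C) (cong isE Ci))

  ∉-Epos⁺ : ∀ {n} (C : Path n) i → lookup C i ≡ 𝐧 → i ∉ Epos C
  ∉-Epos⁺ C i Ci i∈C with trans (sym ([]=⇒lookup i∈C)) (trans (lookup-map i isE C) (cong isE Ci))
  ... | ()

  toBounded : ∀ {n d u L} (C : Path n) → BoundedPath n d u L C → Bounded d u (toList L) (toList C)
  toBounded C (#e , lo , hi) = #e , (λ i i≤ → lo i (≤-trans i≤ (≤-reflexive (length-toList C))))
                                  , (λ i i≤ → hi i (≤-trans i≤ (≤-reflexive (length-toList C))))

  fromBounded : ∀ {n d u L} (C : Path n) → Bounded d u (toList L) (toList C) → BoundedPath n d u L C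
  fromBounded C (#e , lo , hi) = #e , (λ i i≤ → lo i (≤-trans i≤ (≤-reflexive (sym (length-toList C)))))
                                    , (λ i i≤ → hi i (≤-trans i≤ (≤-reflexive (sym (length-toList C)))))

  BoundedBasis-isMatroid : ∀ n d u (L C : Path n) → BoundedPath n d u L C → IsMatroid (BoundedBasis n d u L)
  BoundedBasis-isMatroid n d u L C C∈ = (Epos C , C , C∈ , refl) , exchange′
    where
      exchange′ : ∀ B₁ B₂ → BoundedBasis n d u L B₁ → BoundedBasis n d u L B₂ → (x : Fin n) → x ∈ B₁ → x ∉ B₂ →
                  ∃ λ y → y ∈ B₂ × y ∉ B₁ × BoundedBasis n d u L ((B₁ [ x ]≔ outside) [ y ]≔ inside)
      exchange′ _ _ (C₁ , C₁∈ , refl) (C₂ , C₂∈ , refl) x x∈C₁ x∉C₂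
        with Exchange.exchange d u (toList L) (toList C₁) (toList C₂)
               (trans (length-toList C₁) (sym (length-toList C₂))) (toBounded C₁ C₁∈) (toBounded C₂ C₂∈)
               (toℕ x) (≤-trans (toℕ<n x) (≤-reflexive (sym (length-toList C₁))))
               (trans (lookupL-toList C₁ x) (∈-Epos⁻ C₁ x x∈C₁)) (trans (lookupL-toList C₂ x) (∉-Epos⁻ C₂ x x∉C₂))
      ... | y , y<N , C₂y , C₁y , C₃∈ = yF , ∈-Epos⁺ C₂ yF C₂yF , ∉-Epos⁺ C₁ yF C₁yF , C₃ , fromBounded C₃ C₃∈′ , Epos-C₃
        where
          y<n = ≤-trans y<N (≤-reflexive (length-toList C₁))
          yF = fromℕ< y<n
          toℕ-yF = toℕ-fromℕ< y<n
          C₂yF : lookup C₂ yF ≡ 𝐞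
          C₂yF = trans (sym (lookupL-toList C₂ yF)) (trans (cong (lookupL (toList C₂)) toℕ-yF) C₂y)
          C₁yF : lookup C₁ yF ≡ 𝐧
          C₁yF = trans (sym (lookupL-toList C₁ yF)) (trans (cong (lookupL (toList C₁)) toℕ-yF) C₁y)
          C₃ = (C₁ [ x ]≔ 𝐧) [ yF ]≔ 𝐞
          toList-C₃ : toList C₃ ≡ setL (setL (toList C₁) (toℕ x) 𝐧) y 𝐞
          toList-C₃ = trans (toList-[]≔ (C₁ [ x ]≔ 𝐧) yF 𝐞) (cong₂ (λ w k → setL w k 𝐞) (toList-[]≔ C₁ x 𝐧) toℕ-yF)
          C₃∈′ = subst (Bounded d u (toList L)) (sym toList-C₃) C₃∈
          Epos-C₃ : Epos C₃ ≡ (Epos C₁ [ x ]≔ outside) [ yF ]≔ inside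
          Epos-C₃ = trans (map-[]≔ isE (C₁ [ x ]≔ 𝐧) yF) (cong (_[ yF ]≔ inside) (map-[]≔ isE C₁ x))

module BoundedMinors where

  open import Defs
  open PathCounts
  open LatticePathMatroid
  open import Data.Nat using (ℕ; suc; _+_; _≤_)
  open import Data.Nat.Properties
  open import Data.Product using (∃; _×_; _,_)
  open import Data.Sum using (inj₁; inj₂)
  open import Data.List using (_++_; [_]; length)
  open import Data.List.Properties using (length-++)
  open import Data.Vec using (_∷ʳ_; toList; initLast)
  open import Data.Vec.Properties using (toList-∷ʳ; length-toList; map-∷ʳ; ∷ʳ-injective)
  open import Data.Fin.Subset using (Subset; inside; outside)
  open import Relation.Binary.PropositionalEquality hiding ([_])
  open import Relation.Unary using (_≐_)

  private
    variable
      n : ℕ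

  numE-∷ʳ : ∀ (C : Path n) s → numE (C ∷ʳ s) ≡ numE C + countE [ s ]
  numE-∷ʳ C s = trans (cong countE (toList-∷ʳ s C)) (countE-++ (toList C) [ s ])

  prefE-∷ʳ : ∀ (C : Path n) s i → i ≤ n → prefE i (toList (C ∷ʳ s)) ≡ prefE i (toList C)
  prefE-∷ʳ C s i i≤n =
    trans (cong (prefE i) (toList-∷ʳ s C)) (prefE-++ˡ i (toList C) [ s ] (≤-trans i≤n (≤-reflexive (sym (length-toList C)))))

  prefE-length : ∀ (C : Path n) → prefE n (toList C) ≡ numE C
  prefE-length C = prefE-full _ (toList C) (≤-reflexive (length-toList C))

  prefE-length-∷ʳ : ∀ (C : Path n) s → prefE (suc n) (toList (C ∷ʳ s)) ≡ numE C + countE [ s ]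
  prefE-length-∷ʳ C s = trans (prefE-length (C ∷ʳ s)) (numE-∷ʳ C s)

  WeaklyAbove⇒numE : ∀ {C L : Path n} → WeaklyAbove C L → numE C ≤ numE L
  WeaklyAbove⇒numE {C = C} {L} C≥L =
    ≤-trans (≤-reflexive (sym (prefE-length C))) (≤-trans (C≥L _ ≤-refl) (≤-reflexive (prefE-length L)))

  WeaklyAbove⇒Above : ∀ (C L : Path n) s l → WeaklyAbove (C ∷ʳ s) (L ∷ʳ l) → Above (toList C ++ [ s ]) (toList L ++ [ l ])
  WeaklyAbove⇒Above C L s l C≥L i i≤ = subst₂ (λ u v → prefE i u ≤ prefE i v) (toList-∷ʳ s C) (toList-∷ʳ l L)
    (C≥L i (≤-trans i≤ (≤-reflexive (trans (cong length (sym (toList-∷ʳ s C))) (length-toList (C ∷ʳ s))))))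

  Above⇒WeaklyAbove : ∀ (C L : Path n) s l → Above (toList C ++ [ s ]) (toList L ++ [ l ]) → WeaklyAbove C L
  Above⇒WeaklyAbove C L s l C≥L i i≤n = begin
    prefE i (toList C)            ≡⟨ prefE-++ˡ i (toList C) [ s ] i≤C ⟨
    prefE i (toList C ++ [ s ])   ≤⟨ C≥L i (≤-trans i≤C (≤-trans (m≤m+n _ _) (≤-reflexive (sym (length-++ (toList C)))))) ⟩
    prefE i (toList L ++ [ l ])   ≡⟨ prefE-++ˡ i (toList L) [ l ] (≤-trans i≤n (≤-reflexive (sym (length-toList L)))) ⟩
    prefE i (toList L)            ∎
    where
      open ≤-Reasoning
      i≤C = ≤-trans i≤n (≤-reflexive (sym (length-toList C)))

  record BoundedSnoc (n d : ℕ) (u : ℕ → ℕ) (L : Path n) (l : Step) (C : Path n) (s : Step) : Set where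
    field
      numE≡     : numE C + countE [ s ] ≡ d
      lower     : ∀ i → i ≤ n → u i ≤ prefE i (toList C)
      lower-end : u (suc n) ≤ d
      above     : WeaklyAbove C L
      upper-end : d ≤ numE L + countE [ l ]

  BoundedPath-∷ʳ⁻ : ∀ {d u L l C s} → BoundedPath (suc n) d u (L ∷ʳ l) (C ∷ʳ s) → BoundedSnoc n d u L l C s
  BoundedPath-∷ʳ⁻ {n} {d} {u} {L} {l} {C} {s} (numE≡d , lower , above) = record
    { numE≡     = trans (sym (numE-∷ʳ C s)) numE≡d
    ; lower     = λ i i≤n → ≤-trans (lower i (m≤n⇒m≤1+n i≤n)) (≤-reflexive (prefE-∷ʳ C s i i≤n))
    ; lower-end = ≤-trans (lower (suc n) ≤-refl) (≤-reflexive (trans (prefE-length (C ∷ʳ s)) numE≡d))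
    ; above     = λ i i≤n → ≤-trans (≤-reflexive (sym (prefE-∷ʳ C s i i≤n)))
                              (≤-trans (above i (m≤n⇒m≤1+n i≤n)) (≤-reflexive (prefE-∷ʳ L l i i≤n)))
    ; upper-end = ≤-trans (≤-reflexive (trans (sym numE≡d) (sym (prefE-length (C ∷ʳ s)))))
                    (≤-trans (above (suc n) ≤-refl) (≤-reflexive (prefE-length-∷ʳ L l)))
    }

  BoundedPath-∷ʳ⁺ : ∀ {d u L l C s} → BoundedSnoc n d u L l C s → BoundedPath (suc n) d u (L ∷ʳ l) (C ∷ʳ s)
  BoundedPath-∷ʳ⁺ {n} {d} {u} {L} {l} {C} {s} bs = trans (numE-∷ʳ C s) numE≡ , lower′ , above′
    where
      open BoundedSnoc bs
      lower′ : ∀ i → i ≤ suc n → u i ≤ prefE i (toList (C ∷ʳ s))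
      lower′ i i≤1+n with m≤n⇒m<n∨m≡n i≤1+n
      ... | inj₁ i<1+n = ≤-trans (lower i (≤-pred i<1+n)) (≤-reflexive (sym (prefE-∷ʳ C s i (≤-pred i<1+n))))
      ... | inj₂ refl  = ≤-trans lower-end (≤-reflexive (sym (trans (prefE-length-∷ʳ C s) numE≡)))
      above′ : WeaklyAbove (C ∷ʳ s) (L ∷ʳ l)
      above′ i i≤1+n with m≤n⇒m<n∨m≡n i≤1+n
      ... | inj₁ i<1+n = ≤-trans (≤-reflexive (prefE-∷ʳ C s i (≤-pred i<1+n)))
                           (≤-trans (above i (≤-pred i<1+n)) (≤-reflexive (sym (prefE-∷ʳ L l i (≤-pred i<1+n)))))
      ... | inj₂ refl  = ≤-trans (≤-reflexive (trans (prefE-length-∷ʳ C s) numE≡))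
                           (≤-trans upper-end (≤-reflexive (sym (prefE-length-∷ʳ L l))))

  BoundedBasis-∷ʳ⁻ : ∀ {d u L l} (X : Subset n) b → BoundedBasis (suc n) d u (L ∷ʳ l) (X ∷ʳ b) →
                     ∃ λ C → ∃ λ s → isE s ≡ b × Epos C ≡ X × BoundedSnoc n d u L l C s
  BoundedBasis-∷ʳ⁻ X b (C , C∈ , Epos≡) with initLast C
  ... | C′ , s , refl with ∷ʳ-injective (Epos C′) X (trans (sym (map-∷ʳ isE s C′)) Epos≡)
  ...   | Epos≡X , isE≡b = C′ , s , isE≡b , Epos≡X , BoundedPath-∷ʳ⁻ C∈

  module _ {d : ℕ} {u : ℕ → ℕ} {L : Path n} {l : Step} (𝓑 : Subset (suc n) → Set) where

    del-≐ : 𝓑 ≐ BoundedBasis (suc n) d u (L ∷ʳ l) → u (suc n) ≤ d → del 𝓑 ≐ BoundedBasis n d u L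
    del-≐ (𝓑⊆ , ⊆𝓑) lower-end = to , from
      where
        to : ∀ {X} → del 𝓑 X → BoundedBasis n d u L X
        to {X} X∈ with BoundedBasis-∷ʳ⁻ X outside (𝓑⊆ X∈)
        ... | C , 𝐧 , _ , Epos≡ , bs = C , (trans (sym (+-identityʳ _)) numE≡ , lower , above) , Epos≡
          where open BoundedSnoc bs
        from : ∀ {X} → BoundedBasis n d u L X → del 𝓑 X
        from {X} (C , (numE≡d , lower , above) , Epos≡) =
          ⊆𝓑 (C ∷ʳ 𝐧 , BoundedPath-∷ʳ⁺ bs , trans (map-∷ʳ isE 𝐧 C) (cong (_∷ʳ outside) Epos≡))
          where
            bs : BoundedSnoc n d u L l C 𝐧
            bs = record { numE≡ = trans (+-identityʳ _) numE≡d ; lower = lower ; lower-end = lower-end ; above = above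
                        ; upper-end = ≤-trans (≤-reflexive (sym numE≡d)) (≤-trans (WeaklyAbove⇒numE above) (m≤m+n _ _)) }

    con-≐ : ∀ {d′} → d ≡ suc d′ → 𝓑 ≐ BoundedBasis (suc n) d u (L ∷ʳ l) → u (suc n) ≤ d → d ≤ numE L + countE [ l ] →
            con 𝓑 ≐ BoundedBasis n d′ u L
    con-≐ {d′} d≡ (𝓑⊆ , ⊆𝓑) lower-end upper-end = to , from
      where
        to : ∀ {X} → con 𝓑 X → BoundedBasis n d′ u L X
        to {X} X∈ with BoundedBasis-∷ʳ⁻ X inside (𝓑⊆ X∈)
        ... | C , 𝐞 , _ , Epos≡ , bs = C , (suc-injective (trans (+-comm 1 _) (trans numE≡ d≡)) , lower , above) , Epos≡
          where open BoundedSnoc bs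
        from : ∀ {X} → BoundedBasis n d′ u L X → con 𝓑 X
        from {X} (C , (numE≡d′ , lower , above) , Epos≡) =
          ⊆𝓑 (C ∷ʳ 𝐞 , BoundedPath-∷ʳ⁺ bs , trans (map-∷ʳ isE 𝐞 C) (cong (_∷ʳ inside) Epos≡))
          where
            bs : BoundedSnoc n d u L l C 𝐞
            bs = record { numE≡ = trans (cong (_+ 1) numE≡d′) (trans (+-comm d′ 1) (sym d≡)) ; lower = lower
                        ; lower-end = lower-end ; above = above ; upper-end = upper-end }

  WeaklyAbove-∷ʳ𝐧 : ∀ (C L : Path n) l → WeaklyAbove C L → WeaklyAbove (C ∷ʳ 𝐧) (L ∷ʳ l)
  WeaklyAbove-∷ʳ𝐧 {n} C L l C≥L i i≤1+n with m≤n⇒m<n∨m≡n i≤1+n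
  ... | inj₁ i<1+n = ≤-trans (≤-reflexive (prefE-∷ʳ C 𝐧 i (≤-pred i<1+n)))
                       (≤-trans (C≥L i (≤-pred i<1+n)) (≤-reflexive (sym (prefE-∷ʳ L l i (≤-pred i<1+n)))))
  ... | inj₂ refl  = ≤-trans (≤-reflexive (trans (prefE-length-∷ʳ C 𝐧) (+-identityʳ _)))
                       (≤-trans (≤-trans (WeaklyAbove⇒numE C≥L) (m≤m+n _ _)) (≤-reflexive (sym (prefE-length-∷ʳ L l))))

module MarkingPath where

  open import Defs
  open PathCounts
  open import Data.Nat using (ℕ; zero; suc; _+_; _≤_; _<_; _∸_; z≤n; s≤s; _⊔_; _<ᵇ_; _≡ᵇ_; _<?_)
  open import Data.Nat.Properties
  open import Data.Bool using (Bool; true; false; not; if_then_else_; T)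
  open import Data.Bool.Properties using (not-involutive; ∨-identityʳ)
  open import Data.Product using (_×_; _,_; proj₂)
  open import Data.Sum using (inj₁; inj₂)
  open import Data.List using (List; []; _∷_)
  open import Data.Vec using (Vec; []; _∷_; toList)
  open import Data.Vec.Properties using (length-toList)
  open import Function using (_∘_)
  open import Relation.Binary.PropositionalEquality
  open import Relation.Nullary using (¬_; yes; no; contradiction)
  open import Relation.Nullary.Decidable using (dec-true; dec-false)

  private
    variable
      m n : ℕ

  <ᵇ-true : m < n → (m <ᵇ n) ≡ true
  <ᵇ-true {m} {n} = dec-true (m <? n)

  <ᵇ-false : ¬ m < n → (m <ᵇ n) ≡ false
  <ᵇ-false {m} {n} = dec-false (m <? n)

  ≡ᵇ-true : m ≡ n → (m ≡ᵇ n) ≡ true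
  ≡ᵇ-true {m} {n} = dec-true (m ≟ n)

  ≡ᵇ-false : m ≢ n → (m ≡ᵇ n) ≡ false
  ≡ᵇ-false {m} {n} = dec-false (m ≟ n)

  ≡ᵇ-true⁻¹ : (m ≡ᵇ n) ≡ true → m ≡ n
  ≡ᵇ-true⁻¹ {m} {n} eq = ≡ᵇ⇒≡ m n (subst T (sym eq) _)

  -- The marking path column by column: c k is the height of the k-th east
  -- step of C and δ k the height at which D crosses column k.  P enters
  -- column k at height entry k, is pushed up to level k by D, and then takes
  -- an east step if a diagonal one would pass above C.
  module Columns (c δ : ℕ → ℕ) where

    level : ℕ → ℕ
    entry : ℕ → ℕ
    level k = entry k ⊔ δ k
    entry zero    = 0
    entry (suc k) = if c k <ᵇ suc (level k) then level k else suc (level k)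

    marked : ℕ → Bool
    marked k = c k ≡ᵇ level k

    eastSteps : ℕ → ℕ → ℕ → List (ℕ × ℕ)
    eastSteps zero    x y = []
    eastSteps (suc k) x y =
      if c x <ᵇ suc (y ⊔ δ x) then (x , y ⊔ δ x) ∷ eastSteps k (suc x) (y ⊔ δ x)
      else eastSteps k (suc x) (suc (y ⊔ δ x))

    memPt-eastSteps-< : ∀ k x y x′ v → x′ < x → memPt (x′ , v) (eastSteps k x y) ≡ false
    memPt-eastSteps-< zero    x y x′ v x′<x = refl
    memPt-eastSteps-< (suc k) x y x′ v x′<x with c x <ᵇ suc (y ⊔ δ x)
    ... | true  rewrite ≡ᵇ-false (<⇒≢ x′<x) = memPt-eastSteps-< k (suc x) _ x′ v (m<n⇒m<1+n x′<x)
    ... | false = memPt-eastSteps-< k (suc x) _ x′ v (m<n⇒m<1+n x′<x)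

    entry-suc-east : ∀ k → c k ≤ level k → entry (suc k) ≡ level k
    entry-suc-east k c≤ rewrite <ᵇ-true (s≤s c≤) = refl

    entry-suc-diag : ∀ k → level k < c k → entry (suc k) ≡ suc (level k)
    entry-suc-diag k <c rewrite <ᵇ-false (<⇒≱ <c ∘ ≤-pred) = refl

    memPt-eastSteps : ∀ k x x′ → x ≤ x′ → x′ < x + k →
                      memPt (x′ , c x′) (eastSteps k x (entry x)) ≡ marked x′
    memPt-eastSteps zero x x′ x≤x′ x′<x+0 =
      contradiction (≤-<-trans x≤x′ x′<x+0) (<-irrefl (sym (+-identityʳ x)))
    memPt-eastSteps (suc k) x x′ x≤x′ x′<x+k with m≤n⇒m<n∨m≡n x≤x′ | c x <? suc (level x)
    ... | inj₂ refl | yes east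
      rewrite <ᵇ-true east | ≡ᵇ-true (refl {x = x})
            | memPt-eastSteps-< k (suc x) (level x) x (c x) ≤-refl = ∨-identityʳ _
    ... | inj₂ refl | no diag
      rewrite <ᵇ-false diag | memPt-eastSteps-< k (suc x) (suc (level x)) x (c x) ≤-refl =
      sym (≡ᵇ-false (λ c≡level → diag (s≤s (≤-reflexive c≡level))))
    ... | inj₁ x<x′ | yes east rewrite <ᵇ-true east | ≡ᵇ-false (>⇒≢ x<x′) =
      subst (λ y → memPt (x′ , c x′) (eastSteps k (suc x) y) ≡ marked x′)
            (entry-suc-east x (≤-pred east)) (memPt-eastSteps k (suc x) x′ x<x′ x′<1+x+k)
      where x′<1+x+k = ≤-trans x′<x+k (≤-reflexive (+-suc x k))
    ... | inj₁ x<x′ | no diag rewrite <ᵇ-false diag =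
      subst (λ y → memPt (x′ , c x′) (eastSteps k (suc x) y) ≡ marked x′)
            (entry-suc-diag x (≮⇒≥ diag)) (memPt-eastSteps k (suc x) x′ x<x′ x′<1+x+k)
      where x′<1+x+k = ≤-trans x′<x+k (≤-reflexive (+-suc x k))

  private
    m+1+n≡o⇒m<o : ∀ {o} m n → m + suc n ≡ o → m < o
    m+1+n≡o⇒m<o m n eq = ≤-trans (≤-trans (s≤s (m≤m+n m n)) (≤-reflexive (sym (+-suc m n)))) (≤-reflexive eq)

    m+1+n≡o⇒1+m+n≡o : ∀ {o} m n → m + suc n ≡ o → suc m + n ≡ o
    m+1+n≡o⇒1+m+n≡o m n eq = trans (sym (+-suc m n)) eq

    m+0≡n⇒m≡n : ∀ m → m + 0 ≡ n → m ≡ n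
    m+0≡n⇒m≡n m eq = trans (sym (+-identityʳ m)) eq

  module _ (d m : ℕ) (cH dH : List ℕ)
           (c≤m : ∀ i → i < d → nth cH i ≤ m) (δ≤m : ∀ i → i < d → nth dH i ≤ m) where
    open Columns (nth cH) (nth dH)

    markingEast-done : ∀ f y → markingEast f d m cH dH d y ≡ []
    markingEast-done zero    y = refl
    markingEast-done (suc f) y rewrite ≡ᵇ-true (refl {x = d}) with y ≡ᵇ m
    ... | true  = refl
    ... | false = markingEast-done f (suc y)

    eastSteps-cong : ∀ k x y y′ → y ⊔ nth dH x ≡ y′ ⊔ nth dH x → eastSteps (suc k) x y ≡ eastSteps (suc k) x y′
    eastSteps-cong k x y y′ = cong λ z → if nth cH x <ᵇ suc z then (x , z) ∷ eastSteps k (suc x) z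
                                         else eastSteps k (suc x) (suc z)

    -- k and j count the east and north steps still to be taken.
    markingEast≡eastSteps : ∀ f k x y j → x + k ≡ d → y + j ≡ m → k + j ≤ f →
                            markingEast f d m cH dH x y ≡ eastSteps k x y
    markingEast≡eastSteps f zero x y j x+0≡d _ _ =
      subst (λ w → markingEast f d m cH dH w y ≡ []) (sym (m+0≡n⇒m≡n x x+0≡d)) (markingEast-done f y)
    markingEast≡eastSteps zero (suc k) x y j _ _ ()
    markingEast≡eastSteps (suc f) (suc k) x y j x+k≡d y+j≡m k+j≤f
      rewrite ≡ᵇ-false (<⇒≢ (m+1+n≡o⇒m<o x k x+k≡d)) with y <? nth dH x
    ... | yes y<δ rewrite <ᵇ-true y<δ with j
    ...   | zero   = contradiction (≤-trans y<δ (δ≤m x (m+1+n≡o⇒m<o x k x+k≡d))) (<-irrefl (m+0≡n⇒m≡n y y+j≡m))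
    ...   | suc j′ = trans (markingEast≡eastSteps f (suc k) x (suc y) j′ x+k≡d (m+1+n≡o⇒1+m+n≡o y j′ y+j≡m) k+j≤f′)
                           (eastSteps-cong k x (suc y) y (trans (m≤n⇒m⊔n≡n y<δ) (sym (m≤n⇒m⊔n≡n (<⇒≤ y<δ)))))
      where k+j≤f′ = ≤-pred (≤-trans (≤-reflexive (sym (+-suc (suc k) j′))) k+j≤f)
    markingEast≡eastSteps (suc f) (suc k) x y j x+k≡d y+j≡m k+j≤f | no y≮δ
      rewrite <ᵇ-false y≮δ | m≥n⇒m⊔n≡m (≮⇒≥ y≮δ) with nth cH x <? suc y
    ... | yes east rewrite <ᵇ-true east =
      cong ((x , y) ∷_) (markingEast≡eastSteps f k (suc x) y j (m+1+n≡o⇒1+m+n≡o x k x+k≡d) y+j≡m (≤-pred k+j≤f))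
    ... | no diag rewrite <ᵇ-false diag with j
    ...   | zero   = contradiction (≤-trans (≮⇒≥ diag) (c≤m x (m+1+n≡o⇒m<o x k x+k≡d))) (<-irrefl (m+0≡n⇒m≡n y y+j≡m))
    ...   | suc j′ = markingEast≡eastSteps f k (suc x) (suc y) j′ (m+1+n≡o⇒1+m+n≡o x k x+k≡d) (m+1+n≡o⇒1+m+n≡o y j′ y+j≡m)
                       (≤-trans (+-monoʳ-≤ k (n≤1+n j′)) (≤-pred k+j≤f))

  open Columns public

  eastHeight : List Step → ℕ → ℕ
  eastHeight C = nth (eastHeights C 0)

  crossHeight : List Step → List Step → ℕ → ℕ
  crossHeight C L = nth (crossHeights (demarc C L) 0)

  unmarkedBit : List Step → List Step → ℕ → Bool
  unmarkedBit C L k = not (marked (eastHeight C) (crossHeight C L) k)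

  stL : List Step → List Step → List Bool
  stL C L = selectE C (unmarkedBit C L) 0

  toList-unmarked : ∀ {k} ps (C : Vec Step k) g x y →
    (∀ i → i < countE (toList C) → memPt (i + x , nth (eastHeights (toList C) y) i) ps ≡ not (g (i + x))) →
    toList (unmarked ps C x y) ≡ selectE (toList C) g x
  toList-unmarked ps []      g x y _ = refl
  toList-unmarked ps (𝐞 ∷ C) g x y marks =
    cong₂ _∷_ (trans (cong not (marks 0 (s≤s z≤n))) (not-involutive (g x)))
              (toList-unmarked ps C g (suc x) y λ i i<C →
                 trans (cong (λ w → memPt (w , nth (eastHeights (toList C) y) i) ps) (+-suc i x))
                       (trans (marks (suc i) (s≤s i<C)) (cong (not ∘ g) (sym (+-suc i x)))))
  toList-unmarked ps (𝐧 ∷ C) g x y marks = cong (false ∷_) (toList-unmarked ps C g x (suc y) marks)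

  toList-st : ∀ {n} (L C : Path n) → toList (st L C) ≡ stL (toList C) (toList L)
  toList-st {n} L C = toList-unmarked _ C _ 0 0 λ i i<d → begin
    memPt (i + 0 , c i) (markingEast n d (n ∸ d) (eastHeights s 0) (crossHeights (demarc s l) 0) 0 0)
      ≡⟨ cong₂ (λ w ps → memPt (w , c i) ps) (+-identityʳ i) markingEast≡ ⟩
    memPt (i , c i) (eastSteps c δ d 0 0)
      ≡⟨ memPt-eastSteps c δ d 0 i z≤n i<d ⟩
    marked c δ i
      ≡⟨ not-involutive _ ⟨
    not (unmarkedBit s l i)
      ≡⟨ cong (not ∘ unmarkedBit s l) (+-identityʳ i) ⟨
    not (unmarkedBit s l (i + 0)) ∎
    where
      open ≡-Reasoning
      s = toList C
      l = toList L
      d = countE s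
      c = eastHeight s
      δ = crossHeight s l
      n≡d+N : n ≡ d + countN s
      n≡d+N = trans (sym (length-toList C)) (length≡countE+countN s)
      n∸d≡N : n ∸ d ≡ countN s
      n∸d≡N = trans (cong (_∸ d) n≡d+N) (m+n∸m≡n d (countN s))
      c≤ : ∀ i → i < d → c i ≤ n ∸ d
      c≤ i i<d = ≤-trans (proj₂ (eastHeights-bounded s 0 i i<d)) (≤-reflexive (trans (+-identityʳ _) (sym n∸d≡N)))
      δ≤ : ∀ i → i < d → δ i ≤ n ∸ d
      δ≤ i _ = ≤-trans (nth-crossHeights-≤ (demarc s l) 0 i)
                 (≤-reflexive (trans (+-identityʳ _)
                   (trans (rise-demarc s l (trans (length-toList C) (sym (length-toList L)))) (sym n∸d≡N))))
      markingEast≡ : markingEast n d (n ∸ d) (eastHeights s 0) (crossHeights (demarc s l) 0) 0 0 ≡ eastSteps c δ d 0 0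
      markingEast≡ = markingEast≡eastSteps d (n ∸ d) _ _ c≤ δ≤ n d 0 0 (n ∸ d) refl refl
                       (≤-reflexive (trans (cong (d +_) n∸d≡N) (sym n≡d+N)))

module ColumnModel where

  open MarkingPath
  open NatSearch
  open import Data.Nat using (ℕ; zero; suc; _+_; _≤_; _<_; _∸_; z≤n; s≤s; _⊔_; _≤?_; _<?_; _<ᵇ_; _≡ᵇ_)
  open import Data.Nat.Properties
  open import Data.Bool using (true; false; if_then_else_)
  open import Data.Product using (_×_; _,_; proj₁; proj₂)
  open import Data.Sum using (inj₁; inj₂)
  open import Function using (_∘_)
  open import Relation.Binary.PropositionalEquality
  open import Relation.Nullary using (¬_; Dec; yes; no; contradiction)
  open import Relation.Nullary.Decidable using (_×-dec_)

  prevHeight : (ℕ → ℕ) → ℕ → ℕ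
  prevHeight c zero    = 0
  prevHeight c (suc x) = c x

  module _ (c δ : ℕ → ℕ) where

    marked-true : ∀ k → c k ≡ level c δ k → marked c δ k ≡ true
    marked-true k = ≡ᵇ-true

    marked-false : ∀ k → c k ≢ level c δ k → marked c δ k ≡ false
    marked-false k = ≡ᵇ-false

    marked-true⁻¹ : ∀ k → marked c δ k ≡ true → c k ≡ level c δ k
    marked-true⁻¹ k = ≡ᵇ-true⁻¹

    -- Column data of a path C lying weakly above its demarcation path D.
    Admissible : ℕ → Set
    Admissible d = (∀ k → suc k < d → c k ≤ c (suc k)) × (∀ k → k < d → δ k ≤ c k)

    module _ {d : ℕ} (adm : Admissible d) where

      entry≤c : ∀ k → k < d → entry c δ k ≤ c k
      level≤c : ∀ k → k < d → level c δ k ≤ c k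
      entry≤c zero    _     = z≤n
      entry≤c (suc k) 1+k<d = ≤-trans entry≤ck (proj₁ adm k 1+k<d)
        where
          k<d = <-trans (n<1+n k) 1+k<d
          entry≤ck : entry c δ (suc k) ≤ c k
          entry≤ck with c k ≤? level c δ k
          ... | yes east = ≤-trans (≤-reflexive (entry-suc-east c δ k east)) (level≤c k k<d)
          ... | no  diag = ≤-trans (≤-reflexive (entry-suc-diag c δ k (≰⇒> diag))) (≰⇒> diag)
      level≤c k k<d = ⊔-lub (entry≤c k k<d) (proj₂ adm k k<d)

    -- C rises before its x-th east step, and P reaches column x no lower than C's previous east step.
    Candidate : ℕ → Set
    Candidate x = prevHeight c x ≤ level c δ x × prevHeight c x < c x

    candidate? : ∀ x → Dec (Candidate x)
    candidate? x = (prevHeight c x ≤? level c δ x) ×-dec (prevHeight c x <? c x)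

    record LastCandidate (d′ : ℕ) : Set where
      field
        r          : ℕ
        r≤d′       : r ≤ d′
        prev≤level : prevHeight c r ≤ level c δ r
        level<c    : ∀ x → r ≤ x → x ≤ d′ → level c δ x < c x
        level<prev : ∀ x → r < x → x ≤ d′ → level c δ x < prevHeight c x

    module _ {d′ : ℕ} (adm : Admissible (suc d′)) (last-unmarked : c d′ ≢ level c δ d′) where

      private
        level≤c′ : ∀ k → k ≤ d′ → level c δ k ≤ c k
        level≤c′ k k≤d′ = level≤c adm k (s≤s k≤d′)

      marked-if-no-candidate : ∀ x → x ≤ d′ → entry c δ x ≡ prevHeight c x → ¬ Candidate x →
                               c x ≡ level c δ x
      marked-if-no-candidate x x≤d′ entry≡prev ¬cand = ≤-antisym c≤level (level≤c′ x x≤d′)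
        where
          prev≤level = ≤-trans (≤-reflexive (sym entry≡prev)) (m≤m⊔n _ _)
          c≤level = ≤-trans (≮⇒≥ (λ prev<c → ¬cand (prev≤level , prev<c))) prev≤level

      -- Without candidates, P runs along C from column x on and marks its last east step.
      marks-through : ∀ t x → x + t ≡ d′ → entry c δ x ≡ prevHeight c x →
                      (∀ x′ → x ≤ x′ → x′ ≤ d′ → ¬ Candidate x′) → c d′ ≡ level c δ d′
      marks-through zero x x+0≡d′ entry≡prev none =
        subst (λ w → c w ≡ level c δ w) x≡d′
              (marked-if-no-candidate x (≤-reflexive x≡d′) entry≡prev (none x ≤-refl (≤-reflexive x≡d′)))
        where x≡d′ = trans (sym (+-identityʳ x)) x+0≡d′
      marks-through (suc t) x x+t≡d′ entry≡prev none =
        marks-through t (suc x) (trans (sym (+-suc x t)) x+t≡d′)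
          (trans (entry-suc-east c δ x (≤-reflexive c≡level)) (sym c≡level))
          (λ x′ x<x′ → none x′ (≤-trans (n≤1+n x) x<x′))
        where
          x≤d′ = ≤-trans (m≤m+n x (suc t)) (≤-reflexive x+t≡d′)
          c≡level = marked-if-no-candidate x x≤d′ entry≡prev (none x ≤-refl x≤d′)

      lastCandidate : LastCandidate d′
      lastCandidate with lastUpTo candidate? d′
      ... | inj₂ none = contradiction (marks-through d′ 0 refl refl (λ x′ _ → none x′)) last-unmarked
      ... | inj₁ (r , r≤d′ , (prev≤level , _) , none-after) = record
        { r = r ; r≤d′ = r≤d′ ; prev≤level = prev≤level ; level<c = level<c ; level<prev = level<prev }
        where
          unmarked-from-r : ∀ x → r ≤ x → x ≤ d′ → c x ≢ level c δ x
          unmarked-from-r x r≤x x≤d′ c≡level with m≤n⇒m<n∨m≡n x≤d′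
          ... | inj₂ refl = last-unmarked c≡level
          ... | inj₁ x<d′ = last-unmarked (marks-through (d′ ∸ suc x) (suc x) (m+[n∸m]≡n x<d′)
                              (trans (entry-suc-east c δ x (≤-reflexive c≡level)) (sym c≡level))
                              (λ x′ x<x′ → none-after x′ (≤-trans (s≤s r≤x) x<x′)))
          level<c : ∀ x → r ≤ x → x ≤ d′ → level c δ x < c x
          level<c x r≤x x≤d′ = ≤∧≢⇒< (level≤c′ x x≤d′) (unmarked-from-r x r≤x x≤d′ ∘ sym)
          level<prev : ∀ x → r < x → x ≤ d′ → level c δ x < prevHeight c x
          level<prev x r<x x≤d′ = ≰⇒> λ prev≤level → unmarked-from-r x (<⇒≤ r<x) x≤d′
            (≤-antisym (≤-trans (≮⇒≥ (λ prev<c → none-after x r<x x≤d′ (prev≤level , prev<c))) prev≤level)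
                       (level≤c′ x x≤d′))

  -- Column data of C = A 𝐧 B 𝐞 (c, δ) and of C* = A 𝐞 B 𝐧 (c*, δ*), where A has
  -- r east steps and ends at height h, and D meets column j first after the swap.
  record Swapped (c δ c* δ* : ℕ → ℕ) (d′ r h j : ℕ) : Set where
    field
      prefix-c  : ∀ k → k < r → c* k ≡ c k
      c*-r      : c* r ≡ h
      shifted-c : ∀ k → r ≤ k → k < d′ → c k ≡ suc (c* (suc k))
      prefix-δ  : ∀ k → k < j → δ* k ≡ δ k × δ k ≤ h
      shifted-δ : ∀ k → j ≤ k → k ≤ d′ → δ k ≡ suc (δ* k) × h ≤ δ* k

  module _ (c δ c′ δ′ : ℕ → ℕ) {r : ℕ} (agree : ∀ k → k < r → c k ≡ c′ k × δ k ≡ δ′ k) where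

    entry-agree : ∀ k → k ≤ r → entry c δ k ≡ entry c′ δ′ k
    entry-agree zero    _     = refl
    entry-agree (suc k) 1+k≤r =
      cong₂ (λ a b → if a <ᵇ suc b then b else suc b) (proj₁ (agree k 1+k≤r))
            (cong₂ _⊔_ (entry-agree k (<⇒≤ 1+k≤r)) (proj₂ (agree k 1+k≤r)))

    level-agree : ∀ k → k ≤ r → δ k ≡ δ′ k → level c δ k ≡ level c′ δ′ k
    level-agree k k≤r δ≡ = cong₂ _⊔_ (entry-agree k k≤r) δ≡

    marked-agree : ∀ k → k < r → marked c δ k ≡ marked c′ δ′ k
    marked-agree k k<r = cong₂ _≡ᵇ_ (proj₁ (agree k k<r)) (level-agree k (<⇒≤ k<r) (proj₂ (agree k k<r)))

  module _ (c δ c* δ* : ℕ → ℕ) {d′ r h j : ℕ} (sw : Swapped c δ c* δ* d′ r h j) (r<j : r < j) where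
    open Swapped sw

    swapped-agree : ∀ k → k < r → c k ≡ c* k × δ k ≡ δ* k
    swapped-agree k k<r = sym (prefix-c k k<r) , sym (proj₁ (prefix-δ k (<-trans k<r r<j)))

    marked-prefix : ∀ k → k < r → marked c δ k ≡ marked c* δ* k
    marked-prefix = marked-agree c δ c* δ* swapped-agree

    level-r : level c δ r ≡ level c* δ* r
    level-r = level-agree c δ c* δ* swapped-agree r ≤-refl (sym (proj₁ (prefix-δ r r<j)))

  -- If column r is the last candidate of C, then in C* the swapped east step
  -- (column r) is marked and every later one is unmarked.
  module SwapForward (c δ c* δ* : ℕ → ℕ) {d′ r h j : ℕ} (sw : Swapped c δ c* δ* d′ r h j)
                     (r≤d′ : r ≤ d′) (level-r≡h : level c δ r ≡ h)
                     (level<c : ∀ x → r ≤ x → x ≤ d′ → level c δ x < c x)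
                     (level<prev : ∀ x → r < x → x ≤ d′ → level c δ x < prevHeight c x) where
    open Swapped sw
    private
      E  = entry c δ
      Lv = level c δ
      E*  = entry c* δ*
      Lv* = level c* δ*

    r<j : r < j
    r<j = ≰⇒> λ j≤r → let (δ≡ , h≤δ*) = shifted-δ r j≤r r≤d′ in
      <-irrefl refl (begin-strict
        h          <⟨ s≤s h≤δ* ⟩
        suc (δ* r) ≡⟨ δ≡ ⟨
        δ r        ≤⟨ m≤n⊔m (E r) (δ r) ⟩
        Lv r       ≡⟨ level-r≡h ⟩
        h          ∎)
      where open ≤-Reasoning

    level*-r≡h : Lv* r ≡ h
    level*-r≡h = trans (sym (level-r c δ c* δ* sw r<j)) level-r≡h

    marked*-r : marked c* δ* r ≡ true
    marked*-r = marked-true c* δ* r (trans c*-r (sym level*-r≡h))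

    step : ∀ x → r < x → x ≤ d′ → suc (E* x) ≤ E x → h ≤ E* x →
           Lv* x < c* x × suc (E* (suc x)) ≤ E (suc x) × h ≤ E* (suc x)
    step (suc x) r<1+x 1+x≤d′ E*<E h≤E* = level*<c* , E*<E′ , h≤E*′
      where
        level*<level : suc (Lv* (suc x)) ≤ Lv (suc x)
        level*<level with suc x <? j
        ... | yes 1+x<j = let (δ*≡δ , δ≤h) = prefix-δ (suc x) 1+x<j in
          ≤-trans (≤-reflexive (cong suc (m≥n⇒m⊔n≡m (≤-trans (≤-trans (≤-reflexive δ*≡δ) δ≤h) h≤E*))))
                  (≤-trans E*<E (m≤m⊔n _ _))
        ... | no  1+x≮j = ⊔-mono-≤ E*<E (≤-reflexive (sym (proj₁ (shifted-δ (suc x) (≮⇒≥ 1+x≮j) 1+x≤d′))))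
        level*<c* : Lv* (suc x) < c* (suc x)
        level*<c* = ≤-pred (≤-trans (s≤s level*<level)
                      (≤-trans (level<prev (suc x) r<1+x 1+x≤d′) (≤-reflexive (shifted-c x (≤-pred r<1+x) 1+x≤d′))))
        E*<E′ : suc (E* (suc (suc x))) ≤ E (suc (suc x))
        E*<E′ = ≤-trans (≤-reflexive (cong suc (entry-suc-diag c* δ* (suc x) level*<c*)))
                  (≤-trans (s≤s level*<level)
                    (≤-reflexive (sym (entry-suc-diag c δ (suc x) (level<c (suc x) (<⇒≤ r<1+x) 1+x≤d′)))))
        h≤E*′ : h ≤ E* (suc (suc x))
        h≤E*′ = ≤-trans h≤E* (≤-trans (m≤m⊔n _ _)
                  (≤-trans (n≤1+n _) (≤-reflexive (sym (entry-suc-diag c* δ* (suc x) level*<c*)))))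

    E*-1+r≡h : E* (suc r) ≡ h
    E*-1+r≡h = trans (entry-suc-east c* δ* r (≤-reflexive (trans c*-r (sym level*-r≡h)))) level*-r≡h

    E-1+r≡1+h : E (suc r) ≡ suc h
    E-1+r≡1+h = trans (entry-suc-diag c δ r (level<c r ≤-refl r≤d′)) (cong suc level-r≡h)

    -- After column r the marking path of C* runs strictly below that of C.
    invariant : ∀ x → r < x → x ≤ suc d′ → suc (E* x) ≤ E x × h ≤ E* x
    invariant (suc x) r<1+x 1+x≤1+d′ with m≤n⇒m<n∨m≡n (≤-pred r<1+x)
    ... | inj₂ refl = ≤-reflexive (trans (cong suc E*-1+r≡h) (sym E-1+r≡1+h)) , ≤-reflexive (sym E*-1+r≡h)
    ... | inj₁ r<x with invariant x r<x (≤-trans (n≤1+n x) 1+x≤1+d′)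
    ...   | E*<E , h≤E* = proj₂ (step x r<x (≤-pred 1+x≤1+d′) E*<E h≤E*)

    marked*-after : ∀ x → r < x → x ≤ d′ → marked c* δ* x ≡ false
    marked*-after x r<x x≤d′ = marked-false c* δ* x (λ c*≡ → <-irrefl (sym c*≡) level*<c*)
      where
        inv = invariant x r<x (≤-trans x≤d′ (n≤1+n d′))
        level*<c* = proj₁ (step x r<x x≤d′ (proj₁ inv) (proj₂ inv))

  -- Conversely, if in C* column r is marked and every later column unmarked,
  -- then in C every column from r on is unmarked.
  module SwapBackward (c δ c* δ* : ℕ → ℕ) {d′ r h j : ℕ} (sw : Swapped c δ c* δ* d′ r h j)
                      (r≤d′ : r ≤ d′) (r<j : r < j) (adm* : Admissible c* δ* (suc d′)) (top : c* d′ < c d′)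
                      (marked*-r : marked c* δ* r ≡ true)
                      (unmarked*-after : ∀ x → r < x → x ≤ d′ → marked c* δ* x ≡ false) where
    open Swapped sw
    private
      E  = entry c δ
      Lv = level c δ
      E*  = entry c* δ*
      Lv* = level c* δ*

    level-r≡h : Lv r ≡ h
    level-r≡h = trans (level-r c δ c* δ* sw r<j) (trans (sym (marked-true⁻¹ c* δ* r marked*-r)) c*-r)

    c*<c : ∀ x → r ≤ x → x ≤ d′ → c* x < c x
    c*<c x r≤x x≤d′ with m≤n⇒m<n∨m≡n x≤d′
    ... | inj₂ refl = top
    ... | inj₁ x<d′ = ≤-trans (s≤s (proj₁ adm* x (s≤s x<d′))) (≤-reflexive (sym (shifted-c x r≤x x<d′)))

    level*<c* : ∀ x → r < x → x ≤ d′ → Lv* x < c* x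
    level*<c* x r<x x≤d′ = ≤∧≢⇒< (level≤c c* δ* adm* x (s≤s x≤d′))
      (λ level≡c → contradiction (trans (sym (marked-true c* δ* x (sym level≡c))) (unmarked*-after x r<x x≤d′)) λ ())

    level<c-r : Lv r < c r
    level<c-r = ≤-trans (≤-reflexive (cong suc (trans level-r≡h (sym c*-r)))) (c*<c r ≤-refl r≤d′)

    step : ∀ x → r < x → x ≤ d′ → E x ≤ suc (E* x) → Lv x < c x × E (suc x) ≤ suc (E* (suc x))
    step x r<x x≤d′ E≤ = level<c , E≤′
      where
        δ≤ : δ x ≤ suc (δ* x)
        δ≤ with x <? j
        ... | yes x<j = ≤-trans (≤-reflexive (sym (proj₁ (prefix-δ x x<j)))) (n≤1+n _)
        ... | no  x≮j = ≤-reflexive (proj₁ (shifted-δ x (≮⇒≥ x≮j) x≤d′))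
        level≤ : Lv x ≤ suc (Lv* x)
        level≤ = ⊔-lub (≤-trans E≤ (s≤s (m≤m⊔n _ _))) (≤-trans δ≤ (s≤s (m≤n⊔m _ _)))
        level<c : Lv x < c x
        level<c = ≤-trans (s≤s level≤) (≤-trans (s≤s (level*<c* x r<x x≤d′)) (c*<c x (<⇒≤ r<x) x≤d′))
        E≤′ : E (suc x) ≤ suc (E* (suc x))
        E≤′ = ≤-trans (≤-reflexive (entry-suc-diag c δ x level<c))
                (≤-trans (s≤s level≤) (≤-reflexive (cong suc (sym (entry-suc-diag c* δ* x (level*<c* x r<x x≤d′))))))

    -- After column r the marking path of C is at most one step above that of C*.
    invariant : ∀ x → r < x → x ≤ suc d′ → E x ≤ suc (E* x)
    invariant (suc x) r<1+x 1+x≤1+d′ with m≤n⇒m<n∨m≡n (≤-pred r<1+x)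
    ... | inj₂ refl = ≤-reflexive (trans (entry-suc-diag c δ r level<c-r)
                        (cong suc (trans level-r≡h (sym E*-1+r))))
      where
        E*-1+r : E* (suc r) ≡ h
        E*-1+r = trans (entry-suc-east c* δ* r (≤-reflexive (marked-true⁻¹ c* δ* r marked*-r)))
                       (trans (sym (marked-true⁻¹ c* δ* r marked*-r)) c*-r)
    ... | inj₁ r<x = proj₂ (step x r<x (≤-pred 1+x≤1+d′) (invariant x r<x (≤-trans (n≤1+n x) 1+x≤1+d′)))

    unmarked-from-r : ∀ x → r ≤ x → x ≤ d′ → marked c δ x ≡ false
    unmarked-from-r x r≤x x≤d′ with m≤n⇒m<n∨m≡n r≤x
    ... | inj₂ refl = marked-false c δ r (λ c≡ → <-irrefl (sym c≡) level<c-r)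
    ... | inj₁ r<x  = marked-false c δ x λ c≡ → <-irrefl (sym c≡)
                        (proj₁ (step x r<x x≤d′ (invariant x r<x (≤-trans x≤d′ (n≤1+n d′)))))

module PathColumns where

  open import Defs
  open PathCounts
  open MarkingPath
  open ColumnModel
  open import Data.Nat using (ℕ; zero; suc; _+_; _≤_; _<_; z≤n; s≤s; _≟_)
  open import Data.Nat.Properties
  open import Data.Product using (∃; ∃₂; _×_; _,_; proj₁; proj₂)
  open import Data.Sum using (inj₁; inj₂)
  open import Data.Bool using (true)
  open import Data.List using (List; []; _∷_; _++_; [_]; length)
  open import Data.List.Properties using (length-++)
  open import Relation.Binary.PropositionalEquality hiding ([_])
  open import Function using (_∘_)
  open import Relation.Nullary using (yes; no; contradiction)

  eastHeight-++ˡ : ∀ X Y k → k < countE X → eastHeight (X ++ Y) k ≡ eastHeight X k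
  eastHeight-++ˡ X Y k k<X =
    trans (cong (λ w → nth w k) (eastHeights-++ X Y 0))
          (nth-++ˡ (eastHeights X 0) _ k (≤-trans k<X (≤-reflexive (sym (length-eastHeights X 0)))))

  eastHeight-++ˡ-≤ : ∀ X Y k → k < countE X → eastHeight (X ++ Y) k ≤ countN X + 0
  eastHeight-++ˡ-≤ X Y k k<X =
    ≤-trans (≤-reflexive (eastHeight-++ˡ X Y k k<X)) (proj₂ (eastHeights-bounded X 0 k k<X))

  crossHeight-++ˡ : ∀ X LX Y LY k → length X ≡ length LX → k < countE LX →
                    crossHeight (X ++ Y) (LX ++ LY) k ≡ crossHeight X LX k
  crossHeight-++ˡ X LX Y LY k X≡LX k<LX =
    trans (cong (λ w → nth w k) (crossHeights-demarc-++ X LX Y LY X≡LX))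
          (nth-++ˡ (crossHeights (demarc X LX) 0) _ k
                   (≤-trans k<LX (≤-reflexive (sym (length-crossHeights-demarc X LX 0 X≡LX)))))

  crossHeight-++ˡ-≤ : ∀ X LX Y LY k → length X ≡ length LX → k < countE LX →
                      crossHeight (X ++ Y) (LX ++ LY) k ≤ countN X + 0
  crossHeight-++ˡ-≤ X LX Y LY k X≡LX k<LX =
    ≤-trans (≤-reflexive (crossHeight-++ˡ X LX Y LY k X≡LX k<LX))
            (≤-trans (nth-crossHeights-≤ (demarc X LX) 0 k) (≤-reflexive (cong (_+ 0) (rise-demarc X LX X≡LX))))

  -- Where C meets L after X, the next crossing of D is not below C.
  crossHeight-at-touch : ∀ X Y LX LY → length X ≡ length LX → length Y ≡ length LY →
                         countE X ≡ countE LX → 1 ≤ countE LY →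
                         countN X + 0 ≤ crossHeight (X ++ Y) (LX ++ LY) (countE X)
  crossHeight-at-touch X Y LX LY X≡LX Y≡LY cX≡cLX 1≤LY = begin
    countN X + 0
      ≤⟨ proj₁ (crossHeights-bounded (demarc Y LY) (countN X + 0) 0
                  (≤-trans 1≤LY (≤-reflexive (sym (length-crossHeights-demarc Y LY _ Y≡LY))))) ⟩
    nth (crossHeights (demarc Y LY) (countN X + 0)) 0
      ≡⟨ nth-++ʳ (crossHeights (demarc X LX) 0) _ 0 ⟨
    nth (crossHeights (demarc X LX) 0 ++ crossHeights (demarc Y LY) (countN X + 0))
        (length (crossHeights (demarc X LX) 0) + 0)
      ≡⟨ cong (nth (crossHeights (demarc X LX) 0 ++ crossHeights (demarc Y LY) (countN X + 0)))
              (trans (+-identityʳ _) (trans (length-crossHeights-demarc X LX 0 X≡LX) (sym cX≡cLX))) ⟩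
    nth (crossHeights (demarc X LX) 0 ++ crossHeights (demarc Y LY) (countN X + 0)) (countE X)
      ≡⟨ cong (λ w → nth w (countE X)) (crossHeights-demarc-++ X LX Y LY X≡LX) ⟨
    crossHeight (X ++ Y) (LX ++ LY) (countE X) ∎
    where open ≤-Reasoning

  crossHeight-at-touch-𝐞 : ∀ X Y LX LY → length X ≡ length LX → countE X ≡ countE LX →
                           crossHeight (X ++ 𝐞 ∷ Y) (LX ++ 𝐞 ∷ LY) (countE X) ≡ countN X + 0
  crossHeight-at-touch-𝐞 X Y LX LY X≡LX cX≡cLX = begin
    crossHeight (X ++ 𝐞 ∷ Y) (LX ++ 𝐞 ∷ LY) (countE X)
      ≡⟨ cong (λ w → nth w (countE X)) (crossHeights-demarc-++ X LX (𝐞 ∷ Y) (𝐞 ∷ LY) X≡LX) ⟩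
    nth (Q ++ (countN X + 0) ∷ R) (countE X)
      ≡⟨ cong (nth (Q ++ (countN X + 0) ∷ R)) (trans cX≡cLX (sym (length-crossHeights-demarc X LX 0 X≡LX))) ⟩
    nth (Q ++ (countN X + 0) ∷ R) (length Q)
      ≡⟨ nth-++-length Q _ R ⟩
    countN X + 0 ∎
    where
      open ≡-Reasoning
      Q = crossHeights (demarc X LX) 0
      R = crossHeights (demarc Y LY) (countN X + 0)

  -- If C ≥ L touches L after X, then L continues with an east step.
  𝐞-after-touch : ∀ X Y LX LY → length X ≡ length LX → countE X ≡ countE LX →
                  Above (X ++ 𝐞 ∷ Y) (LX ++ LY) → ∃ λ LY′ → LY ≡ 𝐞 ∷ LY′
  𝐞-after-touch X Y LX LY X≡LX cX≡cLX above = prefE-1-≥1 LY (+-cancelˡ-≤ (countE LX) 1 _ (begin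
    countE LX + 1                     ≡⟨ cong (_+ 1) cX≡cLX ⟨
    countE X + 1                      ≡⟨ prefE-length-+1 X 𝐞 Y ⟨
    prefE (length X + 1) (X ++ 𝐞 ∷ Y) ≤⟨ above _ (≤-trans (+-monoʳ-≤ (length X) (s≤s z≤n)) (≤-reflexive (sym (length-++ X)))) ⟩
    prefE (length X + 1) (LX ++ LY)   ≡⟨ cong (λ w → prefE (w + 1) (LX ++ LY)) X≡LX ⟩
    prefE (length LX + 1) (LX ++ LY)  ≡⟨ prefE-++ʳ 1 LX LY ⟩
    countE LX + prefE 1 LY            ∎))
    where open ≤-Reasoning

  Above⇒Admissible : ∀ C L → length C ≡ length L → Above C L →
                     Admissible (eastHeight C) (crossHeight C L) (countE C)
  Above⇒Admissible C L C≡L above = (λ k → eastHeights-mono C 0 k) , δ≤c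
    where
      δ≤c : ∀ k → k < countE C → crossHeight C L k ≤ eastHeight C k
      δ≤c k k<C with split-at-east C k k<C
      ... | X , Y , refl , refl with split-at L (length X) (≤-trans (m≤m+n _ _) (≤-trans (≤-reflexive (sym (length-++ X))) (≤-reflexive C≡L)))
      ...   | LX , LY , refl , LX≡X = ≤-trans δ≤ (≤-reflexive (sym (nth-eastHeights-++-𝐞 X Y)))
        where
          X≡LX = sym LX≡X
          δ≤ : crossHeight (X ++ 𝐞 ∷ Y) (LX ++ LY) (countE X) ≤ countN X + 0
          δ≤ with m≤n⇒m<n∨m≡n (Above-countE X (𝐞 ∷ Y) LX LY X≡LX above)
          ... | inj₁ cX<cLX = crossHeight-++ˡ-≤ X LX (𝐞 ∷ Y) LY (countE X) X≡LX cX<cLX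
          ... | inj₂ cX≡cLX with 𝐞-after-touch X Y LX LY X≡LX cX≡cLX above
          ...   | LY′ , refl = ≤-reflexive (crossHeight-at-touch-𝐞 X Y LX LY′ X≡LX cX≡cLX)

  last-marked-if-touching : ∀ C L lz → length C ≡ length L → Above (C ++ [ 𝐞 ]) (L ++ [ lz ]) →
                            countE L ≤ countE C →
                            marked (eastHeight (C ++ [ 𝐞 ])) (crossHeight (C ++ [ 𝐞 ]) (L ++ [ lz ])) (countE C) ≡ true
  last-marked-if-touching C L 𝐧 C≡L above L≤C =
    contradiction (≤-trans (Above-∷ʳ-at-end C L 𝐞 𝐧 C≡L above) (≤-trans (≤-reflexive (+-identityʳ _)) L≤C))
                  (m+1+n≰m (countE C))
  last-marked-if-touching C L 𝐞 C≡L above L≤C =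
    marked-true c δ (countE C) (≤-antisym c≤level (level≤c c δ adm (countE C) d<))
    where
      c = eastHeight (C ++ [ 𝐞 ])
      δ = crossHeight (C ++ [ 𝐞 ]) (L ++ [ 𝐞 ])
      CL≡ = trans (length-++ C) (trans (cong (_+ 1) C≡L) (sym (length-++ L)))
      adm = Above⇒Admissible (C ++ [ 𝐞 ]) (L ++ [ 𝐞 ]) CL≡ above
      d< : countE C < countE (C ++ [ 𝐞 ])
      d< = ≤-trans (≤-reflexive (+-comm 1 (countE C))) (≤-reflexive (sym (countE-++ C [ 𝐞 ])))
      cC≡cL = ≤-antisym (+-cancelʳ-≤ 1 _ _ (Above-∷ʳ-at-end C L 𝐞 𝐞 C≡L above)) L≤C
      c≤level : c (countE C) ≤ level c δ (countE C)
      c≤level = ≤-trans (≤-reflexive (nth-eastHeights-++-𝐞 C []))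
                  (≤-trans (crossHeight-at-touch C [ 𝐞 ] L [ 𝐞 ] C≡L refl cC≡cL (s≤s z≤n)) (m≤n⊔m _ _))

  prevHeightFrom : ℕ → List ℕ → ℕ → ℕ
  prevHeightFrom y H zero    = y
  prevHeightFrom y H (suc r) = nth H r

  prevHeightFrom-∷ : ∀ y H r → prevHeightFrom y H r ≡ nth (y ∷ H) r
  prevHeightFrom-∷ y H zero    = refl
  prevHeightFrom-∷ y H (suc r) = refl

  prevHeight≡prevHeightFrom : ∀ C r → prevHeight (eastHeight C) r ≡ prevHeightFrom 0 (eastHeights C 0) r
  prevHeight≡prevHeightFrom C zero    = refl
  prevHeight≡prevHeightFrom C (suc r) = refl

  -- A height h strictly between the (r-1)-st and the r-th east step of C ∷ʳ 𝐞
  -- is the height of a north step of C.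
  split-at-north : ∀ C y r h → r ≤ countE C →
                   prevHeightFrom y (eastHeights (C ++ [ 𝐞 ]) y) r ≤ h →
                   h < nth (eastHeights (C ++ [ 𝐞 ]) y) r →
                   ∃₂ λ A B → C ≡ A ++ 𝐧 ∷ B × countE A ≡ r × countN A + y ≡ h
  split-at-north []      y zero    h _ y≤h h<y = contradiction (≤-trans h<y y≤h) (<-irrefl refl)
  split-at-north (𝐞 ∷ C) y zero    h _ y≤h h<y = contradiction (≤-trans h<y y≤h) (<-irrefl refl)
  split-at-north (𝐞 ∷ C) y (suc r) h (s≤s r≤C) prev≤h h<c
    with split-at-north C y r h r≤C (≤-trans (≤-reflexive (prevHeightFrom-∷ y _ r)) prev≤h) h<c
  ... | A , B , refl , cA≡ , h≡ = 𝐞 ∷ A , B , refl , cong suc cA≡ , h≡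
  split-at-north (𝐧 ∷ C) y zero    h r≤C y≤h h<c with h ≟ y
  ... | yes refl = [] , C , refl , refl , refl
  ... | no  h≢y with split-at-north C (suc y) zero h z≤n (≤∧≢⇒< y≤h (h≢y ∘ sym)) h<c
  ...   | A , B , refl , cA≡ , h≡ = 𝐧 ∷ A , B , refl , cA≡ , trans (sym (+-suc (countN A) y)) h≡
  split-at-north (𝐧 ∷ C) y (suc r) h r≤C prev≤h h<c with split-at-north C (suc y) (suc r) h r≤C prev≤h h<c
  ... | A , B , refl , cA≡ , h≡ = 𝐧 ∷ A , B , refl , cA≡ , trans (sym (+-suc (countN A) y)) h≡

  Admissible-∷ʳ : ∀ C L s lz → length C ≡ length L → Above (C ++ [ s ]) (L ++ [ lz ]) →
                  Admissible (eastHeight (C ++ [ s ])) (crossHeight (C ++ [ s ]) (L ++ [ lz ])) (countE C + countE [ s ])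
  Admissible-∷ʳ C L s lz C≡L above =
    subst (Admissible _ _) (countE-++ C [ s ])
          (Above⇒Admissible (C ++ [ s ]) (L ++ [ lz ]) (trans (length-++ C) (trans (cong (_+ 1) C≡L) (sym (length-++ L)))) above)

module StSnoc where

  open import Defs
  open PathCounts
  open MarkingPath
  open ColumnModel
  open PathColumns
  open import Data.Nat using (ℕ; suc; _+_; _≤_; _<_)
  open import Data.Nat.Properties
  open import Data.Bool using (Bool; not)
  open import Data.Product using (_×_; _,_)
  open import Data.List using (_++_; [_]; length)
  open import Data.Vec using (Vec; _∷ʳ_; toList)
  open import Data.Vec.Properties using (toList-∷ʳ; toList-injective; length-toList; cast-is-id)
  open import Data.Fin.Subset using (outside)
  open import Relation.Binary.PropositionalEquality hiding ([_])

  unmarkedBit-++ : ∀ X LX s l → length X ≡ length LX → countE X ≤ countE LX → ∀ k → k < countE X →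
                   unmarkedBit (X ++ [ s ]) (LX ++ [ l ]) k ≡ unmarkedBit X LX k
  unmarkedBit-++ X LX s l X≡LX X≤LX k k<X = cong not (marked-agree _ _ _ _ agree k k<X)
    where
      agree : ∀ k → k < countE X → eastHeight (X ++ [ s ]) k ≡ eastHeight X k
                                  × crossHeight (X ++ [ s ]) (LX ++ [ l ]) k ≡ crossHeight X LX k
      agree k k<X = eastHeight-++ˡ X [ s ] k k<X , crossHeight-++ˡ X LX [ s ] [ l ] k X≡LX (≤-trans k<X X≤LX)

  stL-++ : ∀ X LX s l → length X ≡ length LX → countE X ≤ countE LX →
           stL (X ++ [ s ]) (LX ++ [ l ]) ≡ stL X LX ++ selectE [ s ] (unmarkedBit (X ++ [ s ]) (LX ++ [ l ])) (countE X + 0)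
  stL-++ X LX s l X≡LX X≤LX =
    trans (selectE-++ X [ s ] _ 0)
          (cong (_++ selectE [ s ] (unmarkedBit (X ++ [ s ]) (LX ++ [ l ])) (countE X + 0)) (selectE-cong X _ _ 0 0 λ i i<X →
            unmarkedBit-++ X LX s l X≡LX X≤LX (i + 0) (≤-trans (≤-reflexive (cong suc (+-identityʳ i))) i<X)))

  toList-injective′ : ∀ {A : Set} {m} {xs ys : Vec A m} → toList xs ≡ toList ys → xs ≡ ys
  toList-injective′ {xs = xs} {ys} eq = trans (sym (cast-is-id refl xs)) (toList-injective refl xs ys eq)

  module _ {n : ℕ} (C L : Path n) (l : Step) where

    toList-st-∷ʳ : ∀ s → toList (st (L ∷ʳ l) (C ∷ʳ s)) ≡ stL (toList C ++ [ s ]) (toList L ++ [ l ])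
    toList-st-∷ʳ s = trans (toList-st (L ∷ʳ l) (C ∷ʳ s))
                           (cong₂ stL (toList-∷ʳ s C) (toList-∷ʳ l L))

    lastBit : Bool
    lastBit = unmarkedBit (toList C ++ [ 𝐞 ]) (toList L ++ [ l ]) (numE C + 0)

    lastBit≡ : lastBit ≡ not (marked (eastHeight (toList C ++ [ 𝐞 ])) (crossHeight (toList C ++ [ 𝐞 ]) (toList L ++ [ l ])) (numE C))
    lastBit≡ = cong (unmarkedBit (toList C ++ [ 𝐞 ]) (toList L ++ [ l ])) (+-identityʳ (numE C))

    module _ (C≤L : numE C ≤ numE L) where

      private
        C≡L = trans (length-toList C) (sym (length-toList L))


        toList-st-∷ʳ-++ : ∀ s → toList (st (L ∷ʳ l) (C ∷ʳ s))
                              ≡ toList (st L C) ++ selectE [ s ] (unmarkedBit (toList C ++ [ s ]) (toList L ++ [ l ])) (numE C + 0)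
        toList-st-∷ʳ-++ s = trans (toList-st-∷ʳ s)
          (trans (stL-++ (toList C) (toList L) s l C≡L C≤L)
                 (cong (_++ selectE [ s ] (unmarkedBit (toList C ++ [ s ]) (toList L ++ [ l ])) (numE C + 0)) (sym (toList-st L C))))

      st-∷ʳ-𝐧 : st (L ∷ʳ l) (C ∷ʳ 𝐧) ≡ st L C ∷ʳ outside
      st-∷ʳ-𝐧 = toList-injective′ (trans (toList-st-∷ʳ-++ 𝐧) (sym (toList-∷ʳ outside (st L C))))

      st-∷ʳ-𝐞 : st (L ∷ʳ l) (C ∷ʳ 𝐞) ≡ st L C ∷ʳ lastBit
      st-∷ʳ-𝐞 = toList-injective′ (trans (toList-st-∷ʳ-++ 𝐞) (sym (toList-∷ʳ lastBit (st L C))))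

module SwapPaths where

  open import Defs
  open PathCounts
  open MarkingPath
  open ColumnModel
  open PathColumns
  open import Data.Nat using (ℕ; zero; suc; pred; _+_; _≤_; _<_; _∸_; z≤n; s≤s; _<?_; _≤?_; >-nonZero)
  open import Data.Nat.Properties
  open import Data.Product using (_×_; _,_; proj₁; proj₂)
  open import Data.Bool using (Bool; true; false; not)
  open import Data.Sum using (_⊎_; inj₁; inj₂)
  open import Data.Empty using (⊥)
  open import Data.List using (List; []; _∷_; _++_; [_]; length; map)
  open import Data.List.Properties using (length-++; length-map; ++-assoc)
  open import Relation.Binary.PropositionalEquality hiding ([_])
  open import Relation.Nullary using (yes; no)

  -- The crossing of D contributed by a diagonal or east step at height y.
  crossingAt : Step → ℕ → List ℕ
  crossingAt 𝐞 y = [ y ]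
  crossingAt 𝐧 y = []

  length-crossingAt : ∀ l y → length (crossingAt l y) ≡ countE [ l ]
  length-crossingAt 𝐞 y = refl
  length-crossingAt 𝐧 y = refl

  crossingAt-≤ : ∀ l y i → i < length (crossingAt l y) → nth (crossingAt l y) i ≤ y
  crossingAt-≤ 𝐞 y zero _ = ≤-refl
  crossingAt-≤ 𝐞 y (suc i) (s≤s ())

  crossHeights-demarc-𝐧∷ : ∀ l X Y y → crossHeights (demarc (𝐧 ∷ X) (l ∷ Y)) y ≡ crossingAt l y ++ crossHeights (demarc X Y) (suc y)
  crossHeights-demarc-𝐧∷ 𝐞 X Y y = refl
  crossHeights-demarc-𝐧∷ 𝐧 X Y y = refl

  crossHeights-demarc-𝐞∷ : ∀ l X Y y → crossHeights (demarc (𝐞 ∷ X) (l ∷ Y)) y ≡ crossingAt l y ++ crossHeights (demarc X Y) y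
  crossHeights-demarc-𝐞∷ 𝐞 X Y y = refl
  crossHeights-demarc-𝐞∷ 𝐧 X Y y = refl

  record SameStPrefix (Cₑ Cₙ L : List Step) : Set where
    field
      W   : List Bool
      stₑ : stL Cₑ L ≡ W ++ [ true ]
      stₙ : stL Cₙ L ≡ W ++ [ false ]

  -- Cₑ = A 𝐧 B 𝐞 and Cₙ = A 𝐞 B 𝐧 differ by moving one east step; both are
  -- compared with L = LA l LB lz.
  module Swap (A B LA LB : List Step) (l lz : Step)
              (A≡LA : length A ≡ length LA) (B≡LB : length B ≡ length LB) where

    Cₑ Cₙ L : List Step
    Cₑ = (A ++ 𝐧 ∷ B) ++ [ 𝐞 ]
    Cₙ = (A ++ 𝐞 ∷ B) ++ [ 𝐧 ]
    L  = (LA ++ l ∷ LB) ++ [ lz ]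

    r h d′ j : ℕ
    r  = countE A
    h  = countN A + 0
    d′ = r + countE B
    j  = countE LA + countE [ l ]

    c δ c* δ* : ℕ → ℕ
    c  = eastHeight Cₑ
    δ  = crossHeight Cₑ L
    c* = eastHeight Cₙ
    δ* = crossHeight Cₙ L

    P E Q F : List ℕ
    P = eastHeights A 0
    E = eastHeights B h
    Q = crossHeights (demarc A LA) 0 ++ crossingAt l h
    F = crossHeights (demarc B LB) h

    length-P : length P ≡ r
    length-P = length-eastHeights A 0

    length-E : length E ≡ countE B
    length-E = length-eastHeights B h

    length-Q : length Q ≡ j
    length-Q = trans (length-++ (crossHeights (demarc A LA) 0))
                     (cong₂ _+_ (length-crossHeights-demarc A LA 0 A≡LA) (length-crossingAt l h))

    length-F : length F ≡ countE LB
    length-F = length-crossHeights-demarc B LB h B≡LB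

    eastHeights-Cₑ : eastHeights Cₑ 0 ≡ P ++ (map suc E ++ [ countN B + suc h ])
    eastHeights-Cₑ = begin
      eastHeights ((A ++ 𝐧 ∷ B) ++ [ 𝐞 ]) 0      ≡⟨ cong (λ w → eastHeights w 0) (++-assoc A (𝐧 ∷ B) [ 𝐞 ]) ⟩
      eastHeights (A ++ 𝐧 ∷ B ++ [ 𝐞 ]) 0        ≡⟨ eastHeights-++ A (𝐧 ∷ B ++ [ 𝐞 ]) 0 ⟩
      P ++ eastHeights (B ++ [ 𝐞 ]) (suc h)      ≡⟨ cong (P ++_) (eastHeights-++ B [ 𝐞 ] (suc h)) ⟩
      P ++ (eastHeights B (suc h) ++ [ countN B + suc h ])
                                                 ≡⟨ cong (λ w → P ++ (w ++ [ countN B + suc h ])) (eastHeights-suc B h) ⟩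
      P ++ (map suc E ++ [ countN B + suc h ])   ∎
      where open ≡-Reasoning

    eastHeights-Cₙ : eastHeights Cₙ 0 ≡ P ++ (h ∷ E ++ [])
    eastHeights-Cₙ = begin
      eastHeights ((A ++ 𝐞 ∷ B) ++ [ 𝐧 ]) 0      ≡⟨ cong (λ w → eastHeights w 0) (++-assoc A (𝐞 ∷ B) [ 𝐧 ]) ⟩
      eastHeights (A ++ 𝐞 ∷ B ++ [ 𝐧 ]) 0        ≡⟨ eastHeights-++ A (𝐞 ∷ B ++ [ 𝐧 ]) 0 ⟩
      P ++ (h ∷ eastHeights (B ++ [ 𝐧 ]) h)      ≡⟨ cong (λ w → P ++ (h ∷ w)) (eastHeights-++ B [ 𝐧 ] h) ⟩
      P ++ (h ∷ E ++ [])                         ∎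
      where open ≡-Reasoning

    private
      rise-A : rise (demarc A LA) + 0 ≡ h
      rise-A = cong (_+ 0) (rise-demarc A LA A≡LA)

      crossHeights-A∷ : ∀ s LR R → crossHeights (demarc ((A ++ s ∷ R)) (LA ++ l ∷ LR)) 0
                        ≡ crossHeights (demarc A LA) 0 ++ crossHeights (demarc (s ∷ R) (l ∷ LR)) h
      crossHeights-A∷ s LR R = trans (cong (λ w → crossHeights w 0) (demarc-++ A LA (s ∷ R) (l ∷ LR) A≡LA))
        (trans (crossHeights-++ (demarc A LA) _ 0) (cong (λ y → crossHeights (demarc A LA) 0 ++ crossHeights (demarc (s ∷ R) (l ∷ LR)) y) rise-A))

    T₁ T₂ : List ℕ
    T₁ = crossHeights (demarc [ 𝐞 ] [ lz ]) (rise (demarc B LB) + suc h)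
    T₂ = crossHeights (demarc [ 𝐧 ] [ lz ]) (rise (demarc B LB) + h)

    crossHeights-Cₑ : crossHeights (demarc Cₑ L) 0 ≡ Q ++ (map suc F ++ T₁)
    crossHeights-Cₑ = begin
      crossHeights (demarc Cₑ L) 0
        ≡⟨ cong₂ (λ u v → crossHeights (demarc u v) 0) (++-assoc A (𝐧 ∷ B) [ 𝐞 ]) (++-assoc LA (l ∷ LB) [ lz ]) ⟩
      crossHeights (demarc (A ++ 𝐧 ∷ B ++ [ 𝐞 ]) (LA ++ l ∷ LB ++ [ lz ])) 0
        ≡⟨ crossHeights-A∷ 𝐧 (LB ++ [ lz ]) (B ++ [ 𝐞 ]) ⟩
      crossHeights (demarc A LA) 0 ++ crossHeights (demarc (𝐧 ∷ B ++ [ 𝐞 ]) (l ∷ LB ++ [ lz ])) h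
        ≡⟨ cong (crossHeights (demarc A LA) 0 ++_) (crossHeights-demarc-𝐧∷ l (B ++ [ 𝐞 ]) (LB ++ [ lz ]) h) ⟩
      crossHeights (demarc A LA) 0 ++ (crossingAt l h ++ crossHeights (demarc (B ++ [ 𝐞 ]) (LB ++ [ lz ])) (suc h))
        ≡⟨ ++-assoc (crossHeights (demarc A LA) 0) _ _ ⟨
      Q ++ crossHeights (demarc (B ++ [ 𝐞 ]) (LB ++ [ lz ])) (suc h)
        ≡⟨ cong (λ w → Q ++ crossHeights w (suc h)) (demarc-++ B LB [ 𝐞 ] [ lz ] B≡LB) ⟩
      Q ++ crossHeights (demarc B LB ++ demarc [ 𝐞 ] [ lz ]) (suc h)
        ≡⟨ cong (Q ++_) (crossHeights-++ (demarc B LB) _ (suc h)) ⟩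
      Q ++ (crossHeights (demarc B LB) (suc h) ++ T₁)
        ≡⟨ cong (λ w → Q ++ (w ++ T₁)) (crossHeights-suc (demarc B LB) h) ⟩
      Q ++ (map suc F ++ T₁) ∎
      where open ≡-Reasoning

    crossHeights-Cₙ : crossHeights (demarc Cₙ L) 0 ≡ Q ++ (F ++ T₂)
    crossHeights-Cₙ = begin
      crossHeights (demarc Cₙ L) 0
        ≡⟨ cong₂ (λ u v → crossHeights (demarc u v) 0) (++-assoc A (𝐞 ∷ B) [ 𝐧 ]) (++-assoc LA (l ∷ LB) [ lz ]) ⟩
      crossHeights (demarc (A ++ 𝐞 ∷ B ++ [ 𝐧 ]) (LA ++ l ∷ LB ++ [ lz ])) 0
        ≡⟨ crossHeights-A∷ 𝐞 (LB ++ [ lz ]) (B ++ [ 𝐧 ]) ⟩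
      crossHeights (demarc A LA) 0 ++ crossHeights (demarc (𝐞 ∷ B ++ [ 𝐧 ]) (l ∷ LB ++ [ lz ])) h
        ≡⟨ cong (crossHeights (demarc A LA) 0 ++_) (crossHeights-demarc-𝐞∷ l (B ++ [ 𝐧 ]) (LB ++ [ lz ]) h) ⟩
      crossHeights (demarc A LA) 0 ++ (crossingAt l h ++ crossHeights (demarc (B ++ [ 𝐧 ]) (LB ++ [ lz ])) h)
        ≡⟨ ++-assoc (crossHeights (demarc A LA) 0) _ _ ⟨
      Q ++ crossHeights (demarc (B ++ [ 𝐧 ]) (LB ++ [ lz ])) h
        ≡⟨ cong (λ w → Q ++ crossHeights w h) (demarc-++ B LB [ 𝐧 ] [ lz ] B≡LB) ⟩
      Q ++ crossHeights (demarc B LB ++ demarc [ 𝐧 ] [ lz ]) h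
        ≡⟨ cong (Q ++_) (crossHeights-++ (demarc B LB) _ h) ⟩
      Q ++ (F ++ T₂) ∎
      where open ≡-Reasoning

    private
      nth-offset : ∀ xs ys n k → length xs ≡ n → n ≤ k → nth (xs ++ ys) k ≡ nth ys (k ∸ n)
      nth-offset xs ys n k refl n≤k = nth-++-≥ xs ys k n≤k

      nth-P++ : ∀ ys k → k < r → nth (P ++ ys) k ≡ nth P k
      nth-P++ ys k k<r = nth-++ˡ P ys k (≤-trans k<r (≤-reflexive (sym length-P)))

      nth-Q++ : ∀ ys k → k < j → nth (Q ++ ys) k ≡ nth Q k
      nth-Q++ ys k k<j = nth-++ˡ Q ys k (≤-trans k<j (≤-reflexive (sym length-Q)))

      Q-≤ : ∀ k → k < j → nth Q k ≤ h
      Q-≤ k k<j with k <? length (crossHeights (demarc A LA) 0)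
      ... | yes k<QA = ≤-trans (≤-reflexive (nth-++ˡ (crossHeights (demarc A LA) 0) (crossingAt l h) k k<QA))
                         (≤-trans (proj₂ (crossHeights-bounded (demarc A LA) 0 k k<QA)) (≤-reflexive rise-A))
      ... | no  k≮QA = ≤-trans (≤-reflexive (nth-++-≥ (crossHeights (demarc A LA) 0) (crossingAt l h) k (≮⇒≥ k≮QA))) (crossingAt-≤ l h _ k∸<)
        where
          k∸< : k ∸ length (crossHeights (demarc A LA) 0) < length (crossingAt l h)
          k∸< = +-cancelˡ-< (length (crossHeights (demarc A LA) 0)) _ _
                  (≤-trans (≤-reflexive (cong suc (m+[n∸m]≡n (≮⇒≥ k≮QA))))
                    (≤-trans k<j (≤-reflexive (trans (sym length-Q) (length-++ (crossHeights (demarc A LA) 0))))))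

    c-shifted : ∀ k → r ≤ k → k < d′ → c k ≡ suc (c* (suc k))
    c-shifted k r≤k k<d′ = begin
      c k                                    ≡⟨ cong (λ w → nth w k) eastHeights-Cₑ ⟩
      nth (P ++ (map suc E ++ _)) k          ≡⟨ nth-offset P _ r k length-P r≤k ⟩
      nth (map suc E ++ _) i                 ≡⟨ nth-++ˡ (map suc E) _ i (≤-trans i<E (≤-reflexive (sym (length-map suc E)))) ⟩
      nth (map suc E) i                      ≡⟨ nth-map-suc E i i<E ⟩
      suc (nth E i)                          ≡⟨ cong suc (nth-++ˡ E [] i i<E) ⟨
      suc (nth (h ∷ E ++ []) (suc i))        ≡⟨ cong (λ w → suc (nth (h ∷ E ++ []) w)) (+-∸-assoc 1 r≤k) ⟨
      suc (nth (h ∷ E ++ []) (suc k ∸ r))    ≡⟨ cong suc (nth-offset P _ r (suc k) length-P (m≤n⇒m≤1+n r≤k)) ⟨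
      suc (nth (P ++ (h ∷ E ++ [])) (suc k)) ≡⟨ cong (λ w → suc (nth w (suc k))) eastHeights-Cₙ ⟨
      suc (c* (suc k))                       ∎
      where
        open ≡-Reasoning
        i = k ∸ r
        i<E : i < length E
        i<E = ≤-trans (+-cancelˡ-≤ r _ _ (≤-trans (≤-reflexive (trans (+-suc r i) (cong suc (m+[n∸m]≡n r≤k)))) k<d′))
                      (≤-reflexive (sym length-E))

    δ-prefix : ∀ k → k < j → δ* k ≡ δ k × δ k ≤ h
    δ-prefix k k<j = trans (δ≡Q Cₙ crossHeights-Cₙ) (sym (δ≡Q Cₑ crossHeights-Cₑ)) ,
                     ≤-trans (≤-reflexive (δ≡Q Cₑ crossHeights-Cₑ)) (Q-≤ k k<j)
      where
        δ≡Q : ∀ C {R} → crossHeights (demarc C L) 0 ≡ Q ++ R → crossHeight C L k ≡ nth Q k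
        δ≡Q C eq = trans (cong (λ w → nth w k) eq) (nth-Q++ _ k k<j)

    δ-shifted : suc d′ ≤ countE (LA ++ l ∷ LB) → ∀ k → j ≤ k → k ≤ d′ → δ k ≡ suc (δ* k) × h ≤ δ* k
    δ-shifted d′<L k j≤k k≤d′ = trans δk (cong suc (sym δ*k)) ,
                                ≤-trans (proj₁ (crossHeights-bounded (demarc B LB) h i i<F)) (≤-reflexive (sym δ*k))
      where
        i = k ∸ j
        countE-LA-l-LB : countE (LA ++ l ∷ LB) ≡ j + countE LB
        countE-LA-l-LB = trans (countE-++ LA (l ∷ LB))
          (trans (cong (countE LA +_) (countE-++ [ l ] LB)) (sym (+-assoc (countE LA) _ _)))
        i<F : i < length F
        i<F = ≤-trans (+-cancelˡ-≤ j _ _ (≤-trans (≤-reflexive (trans (+-suc j i) (cong suc (m+[n∸m]≡n j≤k))))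
                        (≤-trans (s≤s k≤d′) (≤-trans d′<L (≤-reflexive countE-LA-l-LB)))))
                      (≤-reflexive (sym length-F))
        δk : δ k ≡ suc (nth F i)
        δk = trans (cong (λ w → nth w k) crossHeights-Cₑ)
               (trans (nth-offset Q _ j k length-Q j≤k)
                 (trans (nth-++ˡ (map suc F) T₁ i (≤-trans i<F (≤-reflexive (sym (length-map suc F)))))
                   (nth-map-suc F i i<F)))
        δ*k : δ* k ≡ nth F i
        δ*k = trans (cong (λ w → nth w k) crossHeights-Cₙ)
                (trans (nth-offset Q _ j k length-Q j≤k) (nth-++ˡ F T₂ i i<F))

    swapped : suc d′ ≤ countE (LA ++ l ∷ LB) → Swapped c δ c* δ* d′ r h j
    swapped d′<L = record
      { prefix-c  = λ k k<r → trans (cong (λ w → nth w k) eastHeights-Cₙ)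
                      (trans (nth-P++ _ k k<r) (sym (trans (cong (λ w → nth w k) eastHeights-Cₑ) (nth-P++ _ k k<r))))
      ; c*-r      = trans (cong (λ w → nth w r) eastHeights-Cₙ)
                      (trans (nth-offset P _ r r length-P ≤-refl) (cong (nth (h ∷ E ++ [])) (n∸n≡0 r)))
      ; shifted-c = c-shifted
      ; prefix-δ  = δ-prefix
      ; shifted-δ = δ-shifted d′<L
      }

    length-Cₑ : length Cₑ ≡ length L
    length-Cₑ = begin
      length ((A ++ 𝐧 ∷ B) ++ [ 𝐞 ])   ≡⟨ length-++ (A ++ 𝐧 ∷ B) ⟩
      length (A ++ 𝐧 ∷ B) + 1          ≡⟨ cong (_+ 1) (length-++ A) ⟩
      length A + suc (length B) + 1    ≡⟨ cong₂ (λ a b → a + suc b + 1) A≡LA B≡LB ⟩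
      length LA + suc (length LB) + 1  ≡⟨ cong (_+ 1) (length-++ LA) ⟨
      length (LA ++ l ∷ LB) + 1        ≡⟨ length-++ (LA ++ l ∷ LB) ⟨
      length L                         ∎
      where open ≡-Reasoning

    length-Cₙ : length Cₙ ≡ length Cₑ
    length-Cₙ = trans (length-++ (A ++ 𝐞 ∷ B)) (trans (cong (_+ 1) (trans (length-++ A) (sym (length-++ A))))
                                                     (sym (length-++ (A ++ 𝐧 ∷ B))))

    countE-Cₙ : countE Cₙ ≡ suc d′
    countE-Cₙ = trans (countE-++ (A ++ 𝐞 ∷ B) [ 𝐧 ])
                  (trans (+-identityʳ _) (trans (countE-++ A (𝐞 ∷ B)) (+-suc (countE A) (countE B))))

    top : c* d′ < c d′
    top = begin-strict
      c* d′                         ≡⟨ cong (λ w → nth w d′) eastHeights-Cₙ ⟩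
      nth (P ++ (h ∷ E ++ [])) d′   ≡⟨ nth-offset P _ r d′ length-P (m≤m+n r _) ⟩
      nth (h ∷ E ++ []) (d′ ∸ r)    ≡⟨ cong (nth (h ∷ E ++ [])) (m+n∸m≡n r (countE B)) ⟩
      nth (h ∷ E ++ []) (countE B)  ≤⟨ last-≤ (countE B) refl ⟩
      countN B + h                  <⟨ ≤-reflexive (sym (+-suc (countN B) h)) ⟩
      countN B + suc h              ≡⟨ nth-++-length (map suc E) _ [] ⟨
      nth (map suc E ++ [ countN B + suc h ]) (length (map suc E))
                                    ≡⟨ cong (nth (map suc E ++ [ countN B + suc h ]))
                                            (trans (length-map suc E) (trans length-E (sym (m+n∸m≡n r (countE B))))) ⟩
      nth (map suc E ++ [ countN B + suc h ]) (d′ ∸ r)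
                                    ≡⟨ nth-offset P _ r d′ length-P (m≤m+n r _) ⟨
      nth (P ++ (map suc E ++ [ countN B + suc h ])) d′
                                    ≡⟨ cong (λ w → nth w d′) eastHeights-Cₑ ⟨
      c d′                          ∎
      where
        open ≤-Reasoning
        last-≤ : ∀ m → m ≡ countE B → nth (h ∷ E ++ []) m ≤ countN B + h
        last-≤ zero    _    = m≤n+m h (countN B)
        last-≤ (suc m) 1+m≡ = ≤-trans (≤-reflexive (nth-++ˡ E [] m (≤-trans (≤-reflexive 1+m≡) (≤-reflexive (sym length-E)))))
                                      (proj₂ (eastHeights-bounded B h m (≤-reflexive 1+m≡)))

    Above-Cₙ⇒Cₑ : Above Cₙ L → Above Cₑ L
    Above-Cₙ⇒Cₑ aboveₙ i i≤Cₑ = ≤-trans (prefE-swap-≤ i A B) (aboveₙ i (≤-trans i≤Cₑ (≤-reflexive (sym length-Cₙ))))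

    module SameMarks (prefix : ∀ k → k < r → marked c δ k ≡ marked c* δ* k) (marked*-r : marked c* δ* r ≡ true)
                     (unmarked : ∀ x → r ≤ x → x ≤ d′ → marked c δ x ≡ false)
                     (unmarked* : ∀ x → r < x → x ≤ d′ → marked c* δ* x ≡ false) where

      private
        f g : ℕ → Bool
        f = unmarkedBit Cₑ L
        g = unmarkedBit Cₙ L

        r+i≡i+r+0 : ∀ i → i + (r + 0) ≡ r + i
        r+i≡i+r+0 i = trans (cong (i +_) (+-identityʳ r)) (+-comm i r)

      W : List Bool
      W = selectE A f 0 ++ false ∷ selectE B f (r + 0)

      selectE-A : selectE A g 0 ≡ selectE A f 0
      selectE-A = selectE-cong A g f 0 0 λ i i<A →
        cong not (sym (prefix (i + 0) (≤-trans (≤-reflexive (cong suc (+-identityʳ i))) i<A)))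

      selectE-B : selectE B g (suc (r + 0)) ≡ selectE B f (r + 0)
      selectE-B = selectE-cong B g f _ _ λ i i<B → begin
        g (i + suc (r + 0)) ≡⟨ cong g (trans (+-suc i (r + 0)) (cong suc (r+i≡i+r+0 i))) ⟩
        g (suc (r + i))     ≡⟨ cong not (unmarked* (suc (r + i)) (s≤s (m≤m+n r i))
                                          (≤-trans (≤-reflexive (sym (+-suc r i))) (+-monoʳ-≤ r i<B))) ⟩
        true                ≡⟨ cong not (unmarked (r + i) (m≤m+n r i) (+-monoʳ-≤ r (<⇒≤ i<B))) ⟨
        f (r + i)           ≡⟨ cong f (r+i≡i+r+0 i) ⟨
        f (i + (r + 0))     ∎
        where open ≡-Reasoning

      stₑ : stL Cₑ L ≡ W ++ [ true ]
      stₑ = begin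
        selectE ((A ++ 𝐧 ∷ B) ++ [ 𝐞 ]) f 0
          ≡⟨ selectE-++ (A ++ 𝐧 ∷ B) [ 𝐞 ] f 0 ⟩
        selectE (A ++ 𝐧 ∷ B) f 0 ++ [ f (countE (A ++ 𝐧 ∷ B) + 0) ]
          ≡⟨ cong₂ _++_ (selectE-++ A (𝐧 ∷ B) f 0) (cong [_] f-last) ⟩
        W ++ [ true ] ∎
        where
          open ≡-Reasoning
          f-last : f (countE (A ++ 𝐧 ∷ B) + 0) ≡ true
          f-last = cong not (trans (cong (marked c δ) (trans (+-identityʳ _) (countE-++ A (𝐧 ∷ B))))
                                   (unmarked d′ (m≤m+n r _) ≤-refl))

      stₙ : stL Cₙ L ≡ W ++ [ false ]
      stₙ = begin
        selectE ((A ++ 𝐞 ∷ B) ++ [ 𝐧 ]) g 0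
          ≡⟨ selectE-++ (A ++ 𝐞 ∷ B) [ 𝐧 ] g 0 ⟩
        selectE (A ++ 𝐞 ∷ B) g 0 ++ [ false ]
          ≡⟨ cong (_++ [ false ]) (selectE-++ A (𝐞 ∷ B) g 0) ⟩
        (selectE A g 0 ++ g (r + 0) ∷ selectE B g (suc (r + 0))) ++ [ false ]
          ≡⟨ cong (_++ [ false ]) (cong₂ _++_ selectE-A (cong₂ _∷_ g-r selectE-B)) ⟩
        W ++ [ false ] ∎
        where
          open ≡-Reasoning
          g-r : g (r + 0) ≡ false
          g-r = cong not (trans (cong (marked c* δ*) (+-identityʳ r)) marked*-r)

    same-st-prefix : (∀ k → k < r → marked c δ k ≡ marked c* δ* k) → marked c* δ* r ≡ true →
                     (∀ x → r ≤ x → x ≤ d′ → marked c δ x ≡ false) →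
                     (∀ x → r < x → x ≤ d′ → marked c* δ* x ≡ false) → SameStPrefix Cₑ Cₙ L
    same-st-prefix prefix marked*-r unmarked unmarked* = record { W = W ; stₑ = stₑ ; stₙ = stₙ }
      where open SameMarks prefix marked*-r unmarked unmarked*

    Above-Cₙ⇒d′<L : Above Cₙ L → suc d′ ≤ countE (LA ++ l ∷ LB)
    Above-Cₙ⇒d′<L aboveₙ = ≤-trans (≤-reflexive (sym (trans (countE-++ A (𝐞 ∷ B)) (+-suc (countE A) (countE B)))))
                                   (Above-∷ʳ-countE (A ++ 𝐞 ∷ B) (LA ++ l ∷ LB) 𝐧 lz length≡ aboveₙ)
      where
        length≡ : length (A ++ 𝐞 ∷ B) ≡ length (LA ++ l ∷ LB)
        length≡ = +-cancelʳ-≡ 1 _ _ (trans (sym (length-++ (A ++ 𝐞 ∷ B))) (trans length-Cₙ (trans length-Cₑ (length-++ (LA ++ l ∷ LB)))))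

    Above-Cₙ⇒r<j : Above Cₙ L → r < j
    Above-Cₙ⇒r<j aboveₙ = begin-strict
      r                                         <⟨ ≤-reflexive (+-comm 1 r) ⟩
      r + 1                                     ≡⟨ prefE-length-+1 A 𝐞 (B ++ [ 𝐧 ]) ⟨
      prefE (length A + 1) (A ++ 𝐞 ∷ B ++ [ 𝐧 ]) ≡⟨ cong (prefE (length A + 1)) (++-assoc A (𝐞 ∷ B) [ 𝐧 ]) ⟨
      prefE (length A + 1) Cₙ                   ≤⟨ aboveₙ (length A + 1) A+1≤Cₙ ⟩
      prefE (length A + 1) L                    ≡⟨ cong₂ prefE (cong (_+ 1) A≡LA) (++-assoc LA (l ∷ LB) [ lz ]) ⟩
      prefE (length LA + 1) (LA ++ l ∷ LB ++ [ lz ])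
                                                ≡⟨ prefE-length-+1 LA l (LB ++ [ lz ]) ⟩
      j                                         ∎
      where
        open ≤-Reasoning
        A+1≤Cₙ = ≤-trans (+-monoʳ-≤ (length A) (s≤s z≤n))
                   (≤-trans (≤-reflexive (sym (length-++ A))) (≤-trans (m≤m+n _ _) (≤-reflexive (sym (length-++ (A ++ 𝐞 ∷ B))))))

    -- Moving the last east step of Cₑ back to the end of A keeps the path above L:
    -- Cₑ cannot touch L inside B, since there D would cross column x at or above
    -- C's previous east step, whereas P runs strictly below it.
    module _ (aboveₑ : Above Cₑ L) (d′<L : suc d′ ≤ countE (LA ++ l ∷ LB))
             (level-r≡h : level c δ r ≡ h)
             (level<prev : ∀ x → r < x → x ≤ d′ → level c δ x < prevHeight c x) where

      Cₑ-split : ∀ {B₁ B₂} → B ≡ B₁ ++ B₂ → Cₑ ≡ (A ++ 𝐧 ∷ B₁) ++ B₂ ++ [ 𝐞 ]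
      Cₑ-split {B₁} {B₂} B≡ = trans (cong (λ w → (A ++ 𝐧 ∷ w) ++ [ 𝐞 ]) B≡) (++-∷-++-assoc A B₁ B₂ 𝐧 [ 𝐞 ])

      -- A touching point of Cₑ and L after X = A 𝐧 B₁.
      module TouchAt (B₁ B₂ : List Step) (B≡ : B ≡ B₁ ++ B₂) (LX LY : List Step) (L≡ : L ≡ LX ++ LY)
                     (X≡LX : length (A ++ 𝐧 ∷ B₁) ≡ length LX) (cX≡cLX : countE (A ++ 𝐧 ∷ B₁) ≡ countE LX) where

        X Y : List Step
        X = A ++ 𝐧 ∷ B₁
        Y = B₂ ++ [ 𝐞 ]

        x : ℕ
        x = countE X

        Y≡LY : length Y ≡ length LY
        Y≡LY = +-cancelˡ-≡ (length X) _ _ (begin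
          length X + length Y   ≡⟨ length-++ X ⟨
          length (X ++ Y)       ≡⟨ cong length (Cₑ-split B≡) ⟨
          length Cₑ             ≡⟨ length-Cₑ ⟩
          length L              ≡⟨ cong length L≡ ⟩
          length (LX ++ LY)     ≡⟨ length-++ LX ⟩
          length LX + length LY ≡⟨ cong (_+ length LY) X≡LX ⟨
          length X + length LY  ∎)
          where open ≡-Reasoning


        countE-X : x ≡ r + countE B₁
        countE-X = countE-++ A (𝐧 ∷ B₁)

        r≤x : r ≤ x
        r≤x = ≤-trans (m≤m+n r _) (≤-reflexive (sym countE-X))

        x≤d′ : x ≤ d′
        x≤d′ = ≤-trans (≤-reflexive countE-X)
                 (+-monoʳ-≤ r (≤-trans (m≤m+n _ _) (≤-reflexive (sym (trans (cong countE B≡) (countE-++ B₁ B₂))))))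

        1≤LY : 1 ≤ countE LY
        1≤LY = n≢0⇒n>0 λ LY≡0 → <-irrefl refl (begin-strict
          x                       ≤⟨ x≤d′ ⟩
          d′                      <⟨ d′<L ⟩
          countE (LA ++ l ∷ LB)   ≤⟨ m≤m+n _ _ ⟩
          countE (LA ++ l ∷ LB) + countE [ lz ] ≡⟨ countE-++ (LA ++ l ∷ LB) [ lz ] ⟨
          countE L                ≡⟨ cong countE L≡ ⟩
          countE (LX ++ LY)       ≡⟨ countE-++ LX LY ⟩
          countE LX + countE LY   ≡⟨ cong₂ _+_ (sym cX≡cLX) LY≡0 ⟩
          x + 0                   ≡⟨ +-identityʳ x ⟩
          x                       ∎)
          where open ≤-Reasoning

        h<N : h < countN X + 0
        h<N = +-monoˡ-≤ 0 (≤-trans (s≤s (m≤m+n (countN A) (countN B₁)))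
                                    (≤-reflexive (sym (trans (countN-++ A (𝐧 ∷ B₁)) (+-suc (countN A) (countN B₁))))))

        N≤level : countN X + 0 ≤ level c δ x
        N≤level = ≤-trans (crossHeight-at-touch X Y LX LY X≡LX Y≡LY cX≡cLX 1≤LY)
                    (≤-trans (≤-reflexive (cong₂ (λ u v → crossHeight u v x) (sym (Cₑ-split B≡)) (sym L≡))) (m≤n⊔m _ _))

        no-touch : r < x ⊎ r ≡ x → ⊥
        no-touch (inj₂ r≡x) = <-irrefl refl (begin-strict
          h             <⟨ h<N ⟩
          countN X + 0  ≤⟨ N≤level ⟩
          level c δ x   ≡⟨ cong (level c δ) r≡x ⟨
          level c δ r   ≡⟨ level-r≡h ⟩
          h             ∎)
          where open ≤-Reasoning
        no-touch (inj₁ r<x) = <-irrefl refl (begin-strict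
          level c δ x          <⟨ level<prev x r<x x≤d′ ⟩
          prevHeight c x       ≡⟨ cong (prevHeight c) x≡1+x-1 ⟨
          c (pred x)           ≡⟨ cong (λ w → eastHeight w (pred x)) (Cₑ-split B≡) ⟩
          eastHeight (X ++ Y) (pred x)
                               ≤⟨ eastHeight-++ˡ-≤ X Y (pred x) (≤-reflexive x≡1+x-1) ⟩
          countN X + 0         ≤⟨ N≤level ⟩
          level c δ x          ∎)
          where
            open ≤-Reasoning
            x≡1+x-1 : suc (pred x) ≡ x
            x≡1+x-1 = suc-pred x {{>-nonZero (≤-<-trans z≤n r<x)}}

      middle≤length : ∀ i → i ≤ length B → suc (length A) + i ≤ length Cₑ
      middle≤length i i≤B = begin
        suc (length A) + i               ≤⟨ +-monoʳ-≤ (suc (length A)) i≤B ⟩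
        suc (length A) + length B        ≡⟨ +-suc (length A) (length B) ⟨
        length A + suc (length B)        ≡⟨ length-++ A ⟨
        length (A ++ 𝐧 ∷ B)              ≤⟨ m≤m+n _ _ ⟩
        length (A ++ 𝐧 ∷ B) + 1          ≡⟨ length-++ (A ++ 𝐧 ∷ B) ⟨
        length Cₑ                        ∎
        where open ≤-Reasoning

      no-touch-in-B : ∀ i → i ≤ length B → prefE (suc (length A) + i) Cₑ ≢ prefE (suc (length A) + i) L
      no-touch-in-B i i≤B touch
        with split-at B i i≤B | split-at L (suc (length A) + i) (≤-trans (middle≤length i i≤B) (≤-reflexive length-Cₑ))
      ... | B₁ , B₂ , B≡ , B₁≡i | LX , LY , L≡ , LX≡ = no-touch (m≤n⇒m<n∨m≡n r≤x)
        where
          X = A ++ 𝐧 ∷ B₁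
          |X|≡ : length X ≡ suc (length A) + i
          |X|≡ = trans (length-++ A) (trans (+-suc (length A) (length B₁)) (cong (λ w → suc (length A + w)) B₁≡i))
          cX≡cLX : countE X ≡ countE LX
          cX≡cLX = begin
            countE X                            ≡⟨ prefE-length-++ X (B₂ ++ [ 𝐞 ]) ⟨
            prefE (length X) (X ++ B₂ ++ [ 𝐞 ]) ≡⟨ cong₂ prefE |X|≡ (sym (Cₑ-split B≡)) ⟩
            prefE (suc (length A) + i) Cₑ       ≡⟨ touch ⟩
            prefE (suc (length A) + i) L        ≡⟨ cong₂ prefE (sym LX≡) L≡ ⟩
            prefE (length LX) (LX ++ LY)        ≡⟨ prefE-length-++ LX LY ⟩
            countE LX                           ∎
            where open ≡-Reasoning
          open TouchAt B₁ B₂ B≡ LX LY L≡ (trans |X|≡ (sym LX≡)) cX≡cLX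

      prefE-before-A : ∀ s T {i} → i ≤ length A → prefE i ((A ++ s ∷ B) ++ T) ≡ prefE i A
      prefE-before-A s T {i} i≤A = trans (cong (prefE i) (++-assoc A (s ∷ B) T)) (prefE-++ˡ i A (s ∷ B ++ T) i≤A)

      Above-Cₙ-in-B : ∀ i → i ≤ length B → prefE (suc (length A) + i) Cₙ ≤ prefE (suc (length A) + i) L
      Above-Cₙ-in-B i i≤B = begin
        prefE (suc (length A) + i) Cₙ ≡⟨ prefE-middle A 𝐞 B [ 𝐧 ] i i≤B ⟩
        r + suc (prefE i B)           ≡⟨ +-suc r _ ⟩
        suc (r + prefE i B)           ≡⟨ cong suc (prefE-middle A 𝐧 B [ 𝐞 ] i i≤B) ⟨
        suc (prefE (suc (length A) + i) Cₑ)
                                      ≤⟨ ≤∧≢⇒< (aboveₑ _ (middle≤length i i≤B)) (no-touch-in-B i i≤B) ⟩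
        prefE (suc (length A) + i) L  ∎
        where open ≤-Reasoning

      Above-Cₑ⇒Cₙ : Above Cₙ L
      Above-Cₑ⇒Cₙ i i≤Cₙ with i ≤? length A
      ... | yes i≤A = begin
        prefE i Cₙ ≡⟨ prefE-before-A 𝐞 [ 𝐧 ] i≤A ⟩
        prefE i A  ≡⟨ prefE-before-A 𝐧 [ 𝐞 ] i≤A ⟨
        prefE i Cₑ ≤⟨ aboveₑ i (≤-trans i≤Cₙ (≤-reflexive length-Cₙ)) ⟩
        prefE i L  ∎
        where open ≤-Reasoning
      ... | no i≰A with i ∸ suc (length A) ≤? length B
      ...   | yes i′≤B = subst (λ w → prefE w Cₙ ≤ prefE w L) (m+[n∸m]≡n (≰⇒> i≰A)) (Above-Cₙ-in-B (i ∸ suc (length A)) i′≤B)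
      ...   | no  i′≰B = begin
        prefE i Cₙ              ≡⟨ prefE-full i Cₙ |Cₙ|≤i ⟩
        countE Cₙ               ≡⟨ countE-Cₙ ⟩
        suc d′                  ≤⟨ d′<L ⟩
        countE (LA ++ l ∷ LB)   ≤⟨ m≤m+n _ _ ⟩
        countE (LA ++ l ∷ LB) + countE [ lz ] ≡⟨ countE-++ (LA ++ l ∷ LB) [ lz ] ⟨
        countE L                ≡⟨ prefE-full i L (≤-trans (≤-reflexive (sym (trans length-Cₙ length-Cₑ))) |Cₙ|≤i) ⟨
        prefE i L               ∎
        where
          open ≤-Reasoning
          |Cₙ|≤i : length Cₙ ≤ i
          |Cₙ|≤i = begin
            length Cₙ                         ≡⟨ length-++ (A ++ 𝐞 ∷ B) ⟩
            length (A ++ 𝐞 ∷ B) + 1           ≡⟨ cong (_+ 1) (length-++ A) ⟩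
            length A + suc (length B) + 1     ≡⟨ +-assoc (length A) _ 1 ⟩
            length A + suc (length B + 1)     ≡⟨ +-suc (length A) _ ⟩
            suc (length A) + (length B + 1)   ≡⟨ cong (suc (length A) +_) (+-comm (length B) 1) ⟩
            suc (length A) + suc (length B)   ≤⟨ +-monoʳ-≤ (suc (length A)) (≰⇒> i′≰B) ⟩
            suc (length A) + (i ∸ suc (length A)) ≡⟨ m+[n∸m]≡n (≰⇒> i≰A) ⟩
            i                                 ∎

module LastEastStep where

  open import Defs
  open NatSearch
  open PathCounts
  open MarkingPath
  open ColumnModel
  open PathColumns
  open SwapPaths
  open import Data.Nat using (suc; pred; _≤_; _<_; z≤n; s≤s; _≤?_; >-nonZero)
  open import Data.Nat.Properties
  open import Data.Bool using (true; false)
  open import Data.Bool.Properties using (¬-not) renaming (_≟_ to _≟ᵇ_)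
  open import Data.Product using (_,_)
  open import Data.List using (List; _∷_; _++_; [_]; length)
  open import Data.List.Properties using (length-++)
  open import Relation.Binary.PropositionalEquality hiding ([_])
  open import Relation.Nullary using (yes; no; contradiction)

  record NorthPartner (C L : List Step) (lz : Step) : Set where
    field
      C₂      : List Step
      length≡ : length C₂ ≡ length C
      countE≡ : countE C₂ ≡ suc (countE C)
      prefE≤  : ∀ i → prefE i C ≤ prefE i C₂
      above   : Above (C₂ ++ [ 𝐧 ]) (L ++ [ lz ])
      sameSt  : SameStPrefix (C ++ [ 𝐞 ]) (C₂ ++ [ 𝐧 ]) (L ++ [ lz ])

  record EastPartner (C₂ L : List Step) (lz : Step) : Set where
    field
      C       : List Step
      length≡ : length C ≡ length C₂
      countE≡ : suc (countE C) ≡ countE C₂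
      above   : Above (C ++ [ 𝐞 ]) (L ++ [ lz ])
      sameSt  : SameStPrefix (C ++ [ 𝐞 ]) (C₂ ++ [ 𝐧 ]) (L ++ [ lz ])

  lastCandidate⇒northPartner : ∀ C L lz → length C ≡ length L → Above (C ++ [ 𝐞 ]) (L ++ [ lz ]) →
    countE C < countE L →
    LastCandidate (eastHeight (C ++ [ 𝐞 ])) (crossHeight (C ++ [ 𝐞 ]) (L ++ [ lz ])) (countE C) →
    NorthPartner C L lz
  lastCandidate⇒northPartner C L lz C≡L above C<L
    record { r = r₀ ; r≤d′ = r₀≤d′ ; prev≤level = prev≤level ; level<c = level<c ; level<prev = level<prev }
    with split-at-north C 0 r₀ _ r₀≤d′ (≤-trans (≤-reflexive (sym (prevHeight≡prevHeightFrom (C ++ [ 𝐞 ]) r₀))) prev≤level)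
                                       (level<c r₀ ≤-refl r₀≤d′)
  ... | A , B , refl , refl , h≡level with split-alike A 𝐧 B L C≡L
  ...   | LA , LB , l , refl , A≡LA , B≡LB = record
    { C₂ = A ++ 𝐞 ∷ B
    ; length≡ = trans (length-++ A) (sym (length-++ A))
    ; countE≡ = trans (countE-++ A (𝐞 ∷ B)) (trans (+-suc (countE A) (countE B)) (cong suc (sym d′≡)))
    ; prefE≤ = λ i → prefE-𝐧→𝐞 i A B
    ; above = Above-Cₑ⇒Cₙ above (≤-trans (s≤s (≤-reflexive (sym d′≡))) C<L) (sym h≡level) level<prev′
    ; sameSt = same-st-prefix (marked-prefix c δ c* δ* sw Fwd.r<j) Fwd.marked*-r
        (λ x r≤x x≤d′ → marked-false c δ x (λ c≡ → <-irrefl (sym c≡) (level<c′ x r≤x x≤d′))) Fwd.marked*-after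
    }
    where
      open Swap A B LA LB l lz A≡LA B≡LB
      d′≡ : countE (A ++ 𝐧 ∷ B) ≡ d′
      d′≡ = countE-++ A (𝐧 ∷ B)
      level<c′ : ∀ x → r ≤ x → x ≤ d′ → level c δ x < c x
      level<c′ x r≤x x≤d′ = level<c x r≤x (≤-trans x≤d′ (≤-reflexive (sym d′≡)))
      level<prev′ : ∀ x → r < x → x ≤ d′ → level c δ x < prevHeight c x
      level<prev′ x r<x x≤d′ = level<prev x r<x (≤-trans x≤d′ (≤-reflexive (sym d′≡)))
      sw = swapped (≤-trans (s≤s (≤-reflexive (sym d′≡))) C<L)
      module Fwd = SwapForward c δ c* δ* sw (≤-trans r₀≤d′ (≤-reflexive d′≡)) (sym h≡level) level<c′ level<prev′

  -- If the last east step of C ∷ʳ 𝐞 is unmarked, moving it back to the north step in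
  -- the last candidate column gives a path C₂ ∷ʳ 𝐧 with the same statistic.
  unmarked⇒northPartner : ∀ C L lz → length C ≡ length L → Above (C ++ [ 𝐞 ]) (L ++ [ lz ]) →
    marked (eastHeight (C ++ [ 𝐞 ])) (crossHeight (C ++ [ 𝐞 ]) (L ++ [ lz ])) (countE C) ≡ false →
    NorthPartner C L lz
  unmarked⇒northPartner C L lz C≡L above unmarked with countE L ≤? countE C
  ... | yes L≤C = contradiction (trans (sym (last-marked-if-touching C L lz C≡L above L≤C)) unmarked) λ ()
  ... | no  L≰C = lastCandidate⇒northPartner C L lz C≡L above (≰⇒> L≰C)
                    (lastCandidate _ _ (subst (Admissible _ _) (+-comm (countE C) 1) (Admissible-∷ʳ C L 𝐞 lz C≡L above))
                       λ c≡level → contradiction (trans (sym (marked-true (eastHeight (C ++ [ 𝐞 ])) (crossHeight (C ++ [ 𝐞 ]) (L ++ [ lz ])) (countE C) c≡level)) unmarked) λ ())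

  -- Conversely, moving the last marked east step of C₂ ∷ʳ 𝐧 to the end gives a path
  -- C ∷ʳ 𝐞 with the same statistic.
  marked⇒eastPartner : ∀ C₂ L lz → length C₂ ≡ length L → Above (C₂ ++ [ 𝐧 ]) (L ++ [ lz ]) →
    ∀ k → k < countE C₂ → marked (eastHeight (C₂ ++ [ 𝐧 ])) (crossHeight (C₂ ++ [ 𝐧 ]) (L ++ [ lz ])) k ≡ true →
    EastPartner C₂ L lz
  marked⇒eastPartner C₂ L lz C₂≡L above k k<C₂ marked-k
    with lastUpTo-witness (λ x → marked (eastHeight (C₂ ++ [ 𝐧 ])) (crossHeight (C₂ ++ [ 𝐧 ]) (L ++ [ lz ])) x ≟ᵇ true)
                          (pred (countE C₂)) k (<⇒≤pred k<C₂) marked-k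
  ... | r₀ , r₀≤pred , marked*-r , unmarked-after
    with split-at-east C₂ r₀ (m≤pred[n]⇒suc[m]≤n {{>-nonZero (≤-<-trans z≤n k<C₂)}} r₀≤pred)
  ...   | A , B , refl , refl with split-alike A 𝐞 B L C₂≡L
  ...     | LA , LB , l , refl , A≡LA , B≡LB = record
    { C = A ++ 𝐧 ∷ B
    ; length≡ = trans (length-++ A) (sym (length-++ A))
    ; countE≡ = trans (cong suc (countE-++ A (𝐧 ∷ B))) (trans (sym (+-suc (countE A) (countE B))) (sym (countE-++ A (𝐞 ∷ B))))
    ; above = Above-Cₙ⇒Cₑ above
    ; sameSt = same-st-prefix (marked-prefix c δ c* δ* sw r<j) marked*-r Bwd.unmarked-from-r unmarked*-after
    }
    where
      open Swap A B LA LB l lz A≡LA B≡LB hiding (L)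
      1+d′≡ : countE (A ++ 𝐞 ∷ B) ≡ suc d′
      1+d′≡ = trans (countE-++ A (𝐞 ∷ B)) (+-suc (countE A) (countE B))
      d′<L = Above-Cₙ⇒d′<L above
      r<j = Above-Cₙ⇒r<j above
      unmarked*-after : ∀ x → r < x → x ≤ d′ → marked c* δ* x ≡ false
      unmarked*-after x r<x x≤d′ = ¬-not (unmarked-after x r<x (≤-trans x≤d′ (≤-reflexive (cong pred (sym 1+d′≡)))))
      adm* : Admissible c* δ* (suc d′)
      adm* = subst (Admissible c* δ*) (trans (+-identityʳ _) 1+d′≡) (Admissible-∷ʳ (A ++ 𝐞 ∷ B) (LA ++ l ∷ LB) 𝐧 lz C₂≡L above)
      sw = swapped d′<L
      module Bwd = SwapBackward c δ c* δ* sw (m≤m+n r (countE B)) r<j adm* top marked*-r unmarked*-after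

module LexInduction where

  open import Defs
  open PathCounts
  open MarkingPath
  open SwapPaths using (SameStPrefix)
  open LastEastStep
  open StSnoc
  open LatticePathMatroid
  open BoundedMinors
  open Minors
  open import Data.Nat using (ℕ; zero; suc; _+_; _≤_; _<_; z≤n)
  open import Data.Nat.Properties
  open import Data.Bool using (Bool; true; false; not)
  open import Data.Bool.Properties using (¬-not; not-involutive) renaming (_≟_ to _≟ᵇ_)
  open import Data.Product using (∃; _×_; _,_; proj₁; proj₂)
  open import Data.List using (List; []; _∷_; _++_; [_]; length)
  import Data.List.Properties as List
  open import Data.Vec using ([]; _∷_; _∷ʳ_; toList; last; head; tail; initLast)
  open import Data.Vec.Properties using (toList-∷ʳ; length-toList; map-∷ʳ)
  open import Data.Fin.Subset using (Subset; inside; outside)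
  open import Function.Bundles using (_⇔_; mk⇔; Equivalence)
  open import Function.Construct.Composition using (_⇔-∘_)
  open import Relation.Binary.PropositionalEquality hiding ([_])
  open import Relation.Nullary using (yes; no; contradiction)
  open import Relation.Unary using (_≐_)
  open import Relation.Unary.Properties using (≐-refl)
  open import Function using (_∘_)

  private
    variable
      n : ℕ

  fromList′ : ∀ (xs : List Step) → length xs ≡ n → ∃ λ (C : Path n) → toList C ≡ xs
  fromList′ []       refl = [] , refl
  fromList′ (x ∷ xs) refl with fromList′ xs refl
  ... | C , C≡xs = x ∷ C , cong (x ∷_) C≡xs

  Epos-injective : ∀ (C C′ : Path n) → Epos C ≡ Epos C′ → C ≡ C′
  Epos-injective []      []        _      = refl
  Epos-injective (c ∷ C) (c′ ∷ C′) Epos≡ = cong₂ _∷_ (isE-injective (cong head Epos≡)) (Epos-injective C C′ (cong tail Epos≡))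
    where
      isE-injective : ∀ {s t} → isE s ≡ isE t → s ≡ t
      isE-injective {𝐞} {𝐞} _ = refl
      isE-injective {𝐧} {𝐧} _ = refl

  Bool-ext : ∀ {a b : Bool} → (a ≡ true ⇔ b ≡ true) → a ≡ b
  Bool-ext {false} {false} _   = refl
  Bool-ext {true}  {true}  _   = refl
  Bool-ext {true}  {false} a⇔b = sym (Equivalence.to a⇔b refl)
  Bool-ext {false} {true}  a⇔b = Equivalence.from a⇔b refl

  SameStPrefix⇒st≡ : ∀ (C C₂ L : Path n) l → numE C ≤ numE L → numE C₂ ≤ numE L →
                     SameStPrefix (toList C ++ [ 𝐞 ]) (toList C₂ ++ [ 𝐧 ]) (toList L ++ [ l ]) →
                     st L C ≡ st L C₂ × lastBit C L l ≡ true
  SameStPrefix⇒st≡ C C₂ L l C≤L C₂≤L same with List.∷ʳ-injective _ _ stC | List.∷ʳ-injective _ _ stC₂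
    where
      open SameStPrefix same
      stC : toList (st L C) ++ [ lastBit C L l ] ≡ W ++ [ true ]
      stC = trans (sym (toList-∷ʳ _ (st L C)))
              (trans (cong toList (sym (st-∷ʳ-𝐞 C L l C≤L))) (trans (toList-st-∷ʳ C L l 𝐞) stₑ))
      stC₂ : toList (st L C₂) ++ [ false ] ≡ W ++ [ false ]
      stC₂ = trans (sym (toList-∷ʳ _ (st L C₂)))
               (trans (cong toList (sym (st-∷ʳ-𝐧 C₂ L l C₂≤L))) (trans (toList-st-∷ʳ C₂ L l 𝐧) stₙ))
  ... | stC≡W , lastBit≡true | stC₂≡W , _ = toList-injective′ (trans stC≡W (sym stC₂≡W)) , lastBit≡true

  module _ (Λ : LambdaFam) (isLex : IsLexFamily Λ) where
    open IsLexFamily isLex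

    Λ≡st-at : ℕ → Set₁
    Λ≡st-at n = ∀ d u (L : Path n) (𝓑 : Subset n → Set) → 𝓑 ≐ BoundedBasis n d u L → IsMatroid 𝓑 →
                ∀ C → BoundedPath n d u L C → Λ n 𝓑 (Epos C) ≡ st L C

    module InductionStep (ih : Λ≡st-at n) where

      -- By induction st_L agrees with Λ, which is injective.
      st-injective : ∀ {d} {L C C′ : Path n} → BoundedPath n d (λ _ → 0) L C → BoundedPath n d (λ _ → 0) L C′ →
                     st L C ≡ st L C′ → C ≡ C′
      st-injective {d} {L} {C} {C′} C∈ C′∈ st≡ =
        Epos-injective C C′ (inj n 𝓑₀ M₀ _ _ (C , C∈ , refl) (C′ , C′∈ , refl)
          (trans (ih d _ L 𝓑₀ ≐-refl M₀ C C∈) (trans st≡ (sym (ih d _ L 𝓑₀ ≐-refl M₀ C′ C′∈)))))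
        where
          𝓑₀ = BoundedBasis n d (λ _ → 0) L
          M₀ = BoundedBasis-isMatroid n d _ L C C∈

      module LastBit {d : ℕ} {u : ℕ → ℕ} (L : Path n) (l : Step) (C : Path n) (C∈ : BoundedPath (suc n) d u (L ∷ʳ l) (C ∷ʳ 𝐞)) where
        open BoundedSnoc (BoundedPath-∷ʳ⁻ C∈)

        1+numE-C : suc (numE C) ≡ d
        1+numE-C = trans (+-comm 1 _) numE≡

        C≤L : numE C ≤ numE L
        C≤L = WeaklyAbove⇒numE above

        C≡L : length (toList C) ≡ length (toList L)
        C≡L = trans (length-toList C) (sym (length-toList L))

        Partner : Set
        Partner = ∃ λ C₂ → BoundedPath n d u L C₂ × st L C₂ ≡ st L C

        unmarked⇒partner : lastBit C L l ≡ true → Partner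
        unmarked⇒partner unmarked = C₂ , (numE-C₂ , lower-C₂ , above-C₂) , sym (proj₁ (SameStPrefix⇒st≡ C C₂ L l C≤L (WeaklyAbove⇒numE above-C₂) sameSt′))
          where
            np = unmarked⇒northPartner (toList C) (toList L) l C≡L (WeaklyAbove⇒Above C L 𝐞 l (proj₂ (proj₂ C∈)))
                   (trans (sym (not-involutive _)) (cong not (trans (sym (lastBit≡ C L l)) unmarked)))
            open NorthPartner np renaming (C₂ to C₂ˡ; above to aboveˡ)
            C₂-vec = fromList′ C₂ˡ (trans length≡ (length-toList C))
            C₂ = proj₁ C₂-vec
            toList-C₂ : toList C₂ ≡ C₂ˡ
            toList-C₂ = proj₂ C₂-vec
            numE-C₂ : numE C₂ ≡ d
            numE-C₂ = trans (cong countE toList-C₂) (trans countE≡ 1+numE-C)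
            lower-C₂ : ∀ i → i ≤ n → u i ≤ prefE i (toList C₂)
            lower-C₂ i i≤n = ≤-trans (lower i i≤n) (≤-trans (prefE≤ i) (≤-reflexive (cong (prefE i) (sym toList-C₂))))
            above-C₂ : WeaklyAbove C₂ L
            above-C₂ = Above⇒WeaklyAbove C₂ L 𝐧 l (subst (λ w → Above (w ++ [ 𝐧 ]) (toList L ++ [ l ])) (sym toList-C₂) aboveˡ)
            sameSt′ = subst (λ w → SameStPrefix (toList C ++ [ 𝐞 ]) (w ++ [ 𝐧 ]) (toList L ++ [ l ])) (sym toList-C₂) sameSt

        private
          markedₙ : Path n → ℕ → Bool
          markedₙ C₂ = marked (eastHeight (toList C₂ ++ [ 𝐧 ])) (crossHeight (toList C₂ ++ [ 𝐧 ]) (toList L ++ [ l ]))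

        -- Otherwise st L C₂ would contain all d east steps of C₂, while st L C has at most d - 1 elements.
        partner-has-marked-step : ∀ C₂ → BoundedPath n d u L C₂ → st L C₂ ≡ st L C →
                                  ∃ λ k → k < numE C₂ × markedₙ C₂ k ≡ true
        partner-has-marked-step C₂ (numE-C₂ , _ , C₂≥L) st≡ with anyUpTo? (λ k → markedₙ C₂ k ≟ᵇ true) (numE C₂)
        ... | yes found = found
        ... | no  none  = contradiction (begin
          suc (numE C)                           ≡⟨ trans 1+numE-C (sym numE-C₂) ⟩
          countE (toList C₂)                     ≡⟨ countTrue-selectE-all (toList C₂) _ 0 all-unmarked ⟨
          countTrue (stL (toList C₂) (toList L)) ≡⟨ cong countTrue (toList-st L C₂) ⟨
          countTrue (toList (st L C₂))           ≡⟨ cong (countTrue ∘ toList) st≡ ⟩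
          countTrue (toList (st L C))            ≡⟨ cong countTrue (toList-st L C) ⟩
          countTrue (stL (toList C) (toList L))  ≤⟨ countTrue-selectE-≤ (toList C) _ 0 ⟩
          numE C                                 ∎) (<-irrefl refl)
          where
            open ≤-Reasoning
            all-unmarked : ∀ i → i < countE (toList C₂) → unmarkedBit (toList C₂) (toList L) (i + 0) ≡ true
            all-unmarked i i<C₂ =
              trans (sym (unmarkedBit-++ (toList C₂) (toList L) 𝐧 l (trans (length-toList C₂) (sym (length-toList L)))
                            (WeaklyAbove⇒numE C₂≥L) (i + 0) i+0<))
                    (cong not (¬-not λ marked-i → none (i + 0 , i+0< , marked-i)))
              where i+0< = ≤-trans (≤-reflexive (cong suc (+-identityʳ i))) i<C₂

        -- Moving the last marked east step of C₂ to the end gives a path with the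
        -- statistic of C, hence C itself, and its last east step is unmarked.
        marked-partner⇒unmarked : ∀ C₂ → BoundedPath n d u L C₂ → st L C₂ ≡ st L C →
                                  ∀ k → k < numE C₂ → markedₙ C₂ k ≡ true → lastBit C L l ≡ true
        marked-partner⇒unmarked C₂ (numE-C₂ , _ , C₂≥L) st≡ k k<C₂ marked-k =
          subst (λ w → lastBit w L l ≡ true) C″≡C (proj₂ same)
          where
            ep = marked⇒eastPartner (toList C₂) (toList L) l (trans (length-toList C₂) (sym (length-toList L)))
                   (WeaklyAbove⇒Above C₂ L 𝐧 l (WeaklyAbove-∷ʳ𝐧 C₂ L l C₂≥L)) k k<C₂ marked-k
            open EastPartner ep renaming (C to C″ˡ; above to above″)
            C″-vec = fromList′ C″ˡ (trans length≡ (length-toList C₂))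
            C″ = proj₁ C″-vec
            toList-C″ : toList C″ ≡ C″ˡ
            toList-C″ = proj₂ C″-vec
            numE-C″ : numE C″ ≡ numE C
            numE-C″ = suc-injective (trans (cong (suc ∘ countE) toList-C″) (trans countE≡ (trans numE-C₂ (sym 1+numE-C))))
            C″≥L : WeaklyAbove C″ L
            C″≥L = Above⇒WeaklyAbove C″ L 𝐞 l (subst (λ w → Above (w ++ [ 𝐞 ]) (toList L ++ [ l ])) (sym toList-C″) above″)
            same = SameStPrefix⇒st≡ C″ C₂ L l (WeaklyAbove⇒numE C″≥L) (WeaklyAbove⇒numE C₂≥L)
                     (subst (λ w → SameStPrefix (w ++ [ 𝐞 ]) (toList C₂ ++ [ 𝐧 ]) (toList L ++ [ l ])) (sym toList-C″) sameSt)
            C″≡C : C″ ≡ C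
            C″≡C = st-injective (numE-C″ , (λ _ _ → z≤n) , C″≥L) (refl , (λ _ _ → z≤n) , above) (trans (proj₁ same) st≡)

        partner⇒unmarked : Partner → lastBit C L l ≡ true
        partner⇒unmarked (C₂ , C₂∈ , st≡) with partner-has-marked-step C₂ C₂∈ st≡
        ... | k , k<C₂ , marked-k = marked-partner⇒unmarked C₂ C₂∈ st≡ k k<C₂ marked-k

      module _ {d : ℕ} {u : ℕ → ℕ} (L : Path n) (l : Step) (𝓑 : Subset (suc n) → Set)
               (𝓑≐ : 𝓑 ≐ BoundedBasis (suc n) d u (L ∷ʳ l)) (M : IsMatroid 𝓑) where

        step-𝐧 : ∀ C → BoundedPath (suc n) d u (L ∷ʳ l) (C ∷ʳ 𝐧) → Λ (suc n) 𝓑 (Epos (C ∷ʳ 𝐧)) ≡ st (L ∷ʳ l) (C ∷ʳ 𝐧)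
        step-𝐧 C C∈ = begin
          Λ (suc n) 𝓑 (Epos (C ∷ʳ 𝐧))      ≡⟨ cong (Λ (suc n) 𝓑) (map-∷ʳ isE 𝐧 C) ⟩
          Λ (suc n) 𝓑 (Epos C ∷ʳ outside)  ≡⟨ recDel n 𝓑 M (Epos C) C∈𝓑 ⟩
          Λ n (del 𝓑) (Epos C) ∷ʳ outside  ≡⟨ cong (_∷ʳ outside) (ih d u L (del 𝓑) (del-≐ 𝓑 𝓑≐ lower-end) (del-isMatroid 𝓑 M _ C∈𝓑) C C∈′) ⟩
          st L C ∷ʳ outside                ≡⟨ st-∷ʳ-𝐧 C L l (WeaklyAbove⇒numE above) ⟨
          st (L ∷ʳ l) (C ∷ʳ 𝐧)             ∎
          where
            open ≡-Reasoning
            open BoundedSnoc (BoundedPath-∷ʳ⁻ C∈)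
            C∈𝓑 = proj₂ 𝓑≐ (C ∷ʳ 𝐧 , C∈ , map-∷ʳ isE 𝐧 C)
            C∈′ = trans (sym (+-identityʳ _)) numE≡ , lower , above

        module _ (C : Path n) (C∈ : BoundedPath (suc n) d u (L ∷ʳ l) (C ∷ʳ 𝐞)) where
          open BoundedSnoc (BoundedPath-∷ʳ⁻ C∈)
          open LastBit L l C C∈ using (Partner; unmarked⇒partner; partner⇒unmarked)

          private
            C∈𝓑 : 𝓑 (Epos C ∷ʳ inside)
            C∈𝓑 = proj₂ 𝓑≐ (C ∷ʳ 𝐞 , C∈ , map-∷ʳ isE 𝐞 C)

            del≐ = del-≐ 𝓑 𝓑≐ lower-end

            Λcon≡st : ∀ C′ → BoundedPath n (numE C) u L C′ → Λ n (con 𝓑) (Epos C′) ≡ st L C′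
            Λcon≡st = ih (numE C) u L (con 𝓑) (con-≐ 𝓑 (sym (trans (+-comm 1 _) numE≡)) 𝓑≐ lower-end upper-end)
                         (con-isMatroid 𝓑 M _ C∈𝓑)

            Λdel≡st : ∀ C′ → BoundedPath n d u L C′ → Λ n (del 𝓑) (Epos C′) ≡ st L C′
            Λdel≡st C′ C′∈ = ih d u L (del 𝓑) del≐ (del-isMatroid 𝓑 M _ (proj₂ del≐ (C′ , C′∈ , refl))) C′ C′∈

            attained⇒partner : ∀ {X′} → BoundedBasis n d u L X′ → Λ n (del 𝓑) X′ ≡ Λ n (con 𝓑) (Epos C) → Partner
            attained⇒partner (C₂ , C₂∈ , refl) Λ≡ =
              C₂ , C₂∈ , trans (sym (Λdel≡st C₂ C₂∈)) (trans Λ≡ (Λcon≡st C (refl , lower , above)))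

          attained⇔partner : Attained Λ isLex n 𝓑 M (Epos C) C∈𝓑 ⇔ Partner
          attained⇔partner = mk⇔
            (λ { (X′ , X′∈ , Λ≡) → attained⇒partner (proj₁ del≐ X′∈) Λ≡ })
            (λ { (C₂ , C₂∈ , st≡) → Epos C₂ , proj₂ del≐ (C₂ , C₂∈ , refl)
                                  , trans (Λdel≡st C₂ C₂∈) (trans st≡ (sym (Λcon≡st C (refl , lower , above)))) })

          last-Λ≡lastBit : last (Λ (suc n) 𝓑 (Epos C ∷ʳ inside)) ≡ lastBit C L l
          last-Λ≡lastBit = Bool-ext (mk⇔ partner⇒unmarked unmarked⇒partner
                                     ⇔-∘ (attained⇔partner ⇔-∘ last-Λ≡inside⇔attained Λ isLex n 𝓑 M (Epos C) C∈𝓑))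

          step-𝐞 : Λ (suc n) 𝓑 (Epos (C ∷ʳ 𝐞)) ≡ st (L ∷ʳ l) (C ∷ʳ 𝐞)
          step-𝐞 = begin
            Λ (suc n) 𝓑 (Epos (C ∷ʳ 𝐞))                               ≡⟨ cong (Λ (suc n) 𝓑) (map-∷ʳ isE 𝐞 C) ⟩
            Λ (suc n) 𝓑 (Epos C ∷ʳ inside)                            ≡⟨ Λ-∷ʳ-inside Λ isLex n 𝓑 M (Epos C) C∈𝓑 ⟩
            Λ n (con 𝓑) (Epos C) ∷ʳ last (Λ (suc n) 𝓑 (Epos C ∷ʳ inside)) ≡⟨ cong₂ _∷ʳ_ (Λcon≡st C (refl , lower , above)) last-Λ≡lastBit ⟩
            st L C ∷ʳ lastBit C L l                                   ≡⟨ st-∷ʳ-𝐞 C L l (WeaklyAbove⇒numE above) ⟨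
            st (L ∷ʳ l) (C ∷ʳ 𝐞)                                      ∎
            where open ≡-Reasoning

      step : Λ≡st-at (suc n)
      step d u L 𝓑 𝓑≐ M C C∈ with initLast C | initLast L
      ... | C′ , 𝐧 , refl | L′ , l , refl = step-𝐧 L′ l 𝓑 𝓑≐ M C′ C∈
      ... | C′ , 𝐞 , refl | L′ , l , refl = step-𝐞 L′ l 𝓑 𝓑≐ M C′ C∈

    Λ≡st : ∀ n → Λ≡st-at n
    Λ≡st zero d u [] 𝓑 𝓑≐ M [] C∈ with Λ zero 𝓑 []
    ... | [] = refl
    Λ≡st (suc n) = InductionStep.step (Λ≡st n)

open IsLexFamily using (surj; intoStd)
open LatticePathMatroid using (BoundedBasis-isMatroid)
open LexInduction using (Λ≡st)

theorem4p8 : (n d : ℕ) (U L : Path n) → InP n d U → InP n d L → WeaklyAbove U L →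
    (Λ : LambdaFam) → IsLexFamily Λ →
    ((C : Path n) → InPUL n d U L C → st L C ≡ Λ n (LPM n d U L) (Epos C))
    × ((τ : Subset n) → Standard (LPM n d U L) τ ⇔ Σ (Path n) (λ C → InPUL n d U L C × st L C ≡ τ))
theorem4p8 n d U L U∈ _ U≥L Λ isLex = st≡Λ , λ τ → mk⇔ (from-standard τ) to-standard
  where
    M : IsMatroid (LPM n d U L)
    M = BoundedBasis-isMatroid n d (λ i → prefE i (toList U)) L U (U∈ , (λ _ _ → ≤-refl) , U≥L)

    st≡Λ : (C : Path n) → InPUL n d U L C → st L C ≡ Λ n (LPM n d U L) (Epos C)
    st≡Λ C C∈ = sym (Λ≡st Λ isLex n d _ L (LPM n d U L) ≐-refl M C C∈)

    from-standard : ∀ τ → Standard (LPM n d U L) τ → Σ (Path n) (λ C → InPUL n d U L C × st L C ≡ τ)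
    from-standard τ τ-std with surj isLex n (LPM n d U L) M τ τ-std
    ... | _ , (C , C∈ , refl) , Λ≡τ = C , C∈ , trans (st≡Λ C C∈) Λ≡τ

    to-standard : ∀ {τ} → Σ (Path n) (λ C → InPUL n d U L C × st L C ≡ τ) → Standard (LPM n d U L) τ
    to-standard (C , C∈ , refl) = subst (Standard (LPM n d U L)) (sym (st≡Λ C C∈)) (intoStd isLex n (LPM n d U L) M (Epos C) (C , C∈ , refl))
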